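{- Let $\Phi\in\{B_n,C_n,D_n\}$, $\mathbf s\in{\rm Score}(\Phi)$, and suppose there is a path of length two between $\mathcal T_1,\mathcal T_2$ in ${\rm IntGr}(\Phi,\mathbf s)$ passing through $\mathcal T_{12}$, with copies of generators $\mathcal G_1,\mathcal G_2\subseteq\mathcal T_{12}$ such that $\mathcal T_i=\mathcal T_{12}*\mathcal G_i$, where $\mathcal G_1,\mathcal G_2$ are adjacent (have exactly one game in common). Let $\mathcal D=\mathcal T_1\setminus\mathcal T_2$ and $N=N(\mathcal T_1,\mathcal T_2)$. Then: (1) if $\Phi=B_n$ or $D_n$, $N$ is a single diamond; (2) if $\Phi=C_n$ and $\pi(\mathcal D)$ is a square, $N$ is a single diamond; (3) if $\Phi=C_n$ and $\pi(\mathcal D)$ is a tent, $N$ is a split diamond; (4) if $\Phi=C_n$ and $\pi(\mathcal D)$ is a hanger, $N$ is a double or heavy diamond.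
   Context: Vectors: $\mathbf e^{\pm}_{ij}=\mathbf e_i\pm\mathbf e_j$ ($i>j$), $\mathbf e^h_i=\mathbf e_i$, $\mathbf e^\ell_i=2\mathbf e_i$ for negative edges $e^-_{ij}$, positive edges $e^+_{ij}$, half edges $e^h_i$, loops $e^\ell_i$. $\mathcal K_{D_n}$: all negative and positive edges on $[n]$; $\mathcal K_{B_n}$: these plus all half edges; $\mathcal K_{C_n}$: all negative and positive edges plus all loops. A Coxeter tournament on $\mathcal K_\Phi$ is $(w_e)$, $w_e\in\{0,1\}$, over its edges (games); score $\sum_e(w_e-\frac12)\mathbf e$; a sub-tournament (subset of games) is neutral if this sum over its games is $\mathbf 0$; $\mathcal T*\mathcal X$ flips outcomes of the games of $\mathcal X$. ${\rm Score}(\Phi)$ = set of score sequences of tournaments on $\mathcal K_\Phi$. A copy of a type-$\Phi$ generator is a neutral sub-tournament whose games are: (a) neutral triangle (all types): three negative edges pairwise joining three distinct vertices, or one negative and two positive edges pairwise joining three distinct vertices; (b) neutral pair (only $B_n$): a negative or positive edge between $i\ne j$ plus $e^h_i,e^h_j$; (c) neutral clover (only $C_n$): $e^-_{ij},e^+_{ij},e^\ell_i$. ${\rm IntGr}(\Phi,\mathbf s)$: multigraph on tournaments on $\mathcal K_\Phi$ with score $\mathbf s$, $\mathcal T_1,\mathcal T_2$ joined iff $\mathcal T_2=\mathcal T_1*\mathcal G$ for a generator copy $\mathcal G\subseteq\mathcal T_1$ (double edge if $\mathcal G$ is a clover, single otherwise). $\mathcal T_1\setminus\mathcal T_2$ is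 the sub-tournament of $\mathcal T_1$ of games whose outcomes differ in $\mathcal T_2$. The projection graph $\pi(\mathcal D)$ forgets outcomes (undirected edges, half edges, loops). Square = $4$-cycle on four vertices; tent = vertices $x,y,z$ with two parallel edges $xy$ and two parallel edges $xz$; hanger = triangle on $x,y,z$ plus a loop at $x$. For $\mathcal T_1,\mathcal T_2$ at distance two, $N(\mathcal T_1,\mathcal T_2)$ is the union of all paths of length two between them. Shapes (with $\mathcal T_1,\mathcal T_2$ the two ends): single diamond = two paths $\mathcal T_1-X-\mathcal T_2$, $\mathcal T_1-Y-\mathcal T_2$, all edges single; double diamond = two such paths with $\mathcal T_1X$, $Y\mathcal T_2$ double and $\mathcal T_1Y$, $X\mathcal T_2$ single; heavy diamond = two such paths in which the two edges at one end are double and the two edges at the other end are single; split diamond = three paths $\mathcal T_1-X-\mathcal T_2$, $\mathcal T_1-Y-\mathcal T_2$, $\mathcal T_1-Z-\mathcal T_2$ with the four edges through $X,Y$ single and the two edges through $Z$ double. -}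

module Defs where

open import Data.Bool using (Bool; true; false; not; if_then_else_)
open import Data.Nat using (ℕ)
open import Data.Fin using (Fin; _<_)
open import Data.Fin.Properties using (_<?_) renaming (_≟_ to _≟F_)
open import Data.Integer using (ℤ; 0ℤ; 1ℤ; -1ℤ; _+_; _-_; _*_)
open import Data.List using (List; []; _∷_; _++_; map; concatMap; foldr)
open import Data.List.Membership.Propositional using (_∈_)
open import Data.List.Membership.DecPropositional using () renaming (_∈?_ to mem?)
open import Data.Product using (Σ; _×_; _,_)
open import Data.Sum using (_⊎_)
open import Data.Empty using (⊥)
open import Data.Unit using (⊤)
open import Relation.Nullary using (¬_; Dec; yes; no; does)
open import Relation.Binary.Definitions using (DecidableEquality)
open import Relation.Binary.PropositionalEquality using (_≡_; _≢_; refl)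
open import Data.List using () renaming (allFin to allFinL)

data Ty : Set where
  B C D : Ty

-- Edges (games) on the vertex set [n] = Fin n.
--   neg i j _  is  e^-_{ij} = e_i - e_j   (i > j)
--   pos i j _  is  e^+_{ij} = e_i + e_j   (i > j)
--   half i     is  e^h_i    = e_i
--   loop i     is  e^l_i    = 2 e_i
-- The proof of j < i is irrelevant, so an edge is determined by its
-- kind and its endpoints.

data Edge (n : ℕ) : Set where
  neg  : (i j : Fin n) → .(j < i) → Edge n
  pos  : (i j : Fin n) → .(j < i) → Edge n
  half : Fin n → Edge n
  loop : Fin n → Edge n

_≟E_ : ∀ {n} → DecidableEquality (Edge n)
neg i j _ ≟E neg i' j' _ with i ≟F i' | j ≟F j'
... | yes refl | yes refl = yes refl
... | no ne | _ = no λ { refl → ne refl }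
... | yes _ | no ne = no λ { refl → ne refl }
pos i j _ ≟E pos i' j' _ with i ≟F i' | j ≟F j'
... | yes refl | yes refl = yes refl
... | no ne | _ = no λ { refl → ne refl }
... | yes _ | no ne = no λ { refl → ne refl }
half i ≟E half i' with i ≟F i'
... | yes refl = yes refl
... | no ne = no λ { refl → ne refl }
loop i ≟E loop i' with i ≟F i'
... | yes refl = yes refl
... | no ne = no λ { refl → ne refl }
neg _ _ _ ≟E pos _ _ _ = no λ ()
neg _ _ _ ≟E half _ = no λ ()
neg _ _ _ ≟E loop _ = no λ ()
pos _ _ _ ≟E neg _ _ _ = no λ ()
pos _ _ _ ≟E half _ = no λ ()
pos _ _ _ ≟E loop _ = no λ ()
half _ ≟E neg _ _ _ = no λ ()
half _ ≟E pos _ _ _ = no λ ()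
half _ ≟E loop _ = no λ ()
loop _ ≟E neg _ _ _ = no λ ()
loop _ ≟E pos _ _ _ = no λ ()
loop _ ≟E half _ = no λ ()

InK : ∀ {n} → Ty → Edge n → Set
InK Φ (neg _ _ _) = ⊤
InK Φ (pos _ _ _) = ⊤
InK B (half _) = ⊤
InK C (half _) = ⊥
InK D (half _) = ⊥
InK B (loop _) = ⊥
InK C (loop _) = ⊤
InK D (loop _) = ⊥

negPosEdges : (n : ℕ) → List (Edge n)
negPosEdges n = concatMap (λ i → concatMap (λ j → pick i j (j <? i)) (allFinL n)) (allFinL n)
  where
  pick : (i j : Fin n) → Dec (j < i) → List (Edge n)
  pick i j (yes p) = neg i j p ∷ pos i j p ∷ []
  pick i j (no _)  = []

games : Ty → (n : ℕ) → List (Edge n)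
games B n = negPosEdges n ++ map half (allFinL n)
games C n = negPosEdges n ++ map loop (allFinL n)
games D n = negPosEdges n

δ : ∀ {n} → Fin n → Fin n → ℤ
δ i k = if does (i ≟F k) then 1ℤ else 0ℤ

vec : ∀ {n} → Edge n → Fin n → ℤ
vec (neg i j _) k = δ i k - δ j k
vec (pos i j _) k = δ i k + δ j k
vec (half i) k = δ i k
vec (loop i) k = δ i k + δ i k

-- A tournament is an outcome w_e ∈ {0,1} (false/true) for
-- every edge; only the values on games of K_Φ matter, and tournaments on
-- K_Φ are identified when they agree on all games of K_Φ.

Tour : ℕ → Set
Tour n = Edge n → Bool

_≈[_]_ : ∀ {n} → Tour n → Ty → Tour n → Set
T ≈[ Φ ] T' = ∀ e → InK Φ e → T e ≡ T' e

-- 2 (w_e - 1/2) ∈ {-1, +1}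
sgn : Bool → ℤ
sgn true = 1ℤ
sgn false = -1ℤ

sumℤ : List ℤ → ℤ
sumℤ = foldr _+_ 0ℤ

-- twice the weighted sum  Σ_{e ∈ S} (w_e - 1/2) e , coordinate k
wsum2 : ∀ {n} → Tour n → List (Edge n) → Fin n → ℤ
wsum2 T S k = sumℤ (map (λ e → sgn (T e) * vec e k) S)

-- TWICE the score sequence of T on K_Φ (doubling avoids half-integers)
score2 : ∀ {n} → Ty → Tour n → Fin n → ℤ
score2 {n} Φ T = wsum2 T (games Φ n)

Neutral : ∀ {n} → Tour n → List (Edge n) → Set
Neutral T S = ∀ k → wsum2 T S k ≡ 0ℤ

_*_⟨flip⟩ : ∀ {n} → Tour n → List (Edge n) → Tour n
(T * X ⟨flip⟩) e = if does (mem? _≟E_ e X) then not (T e) else T e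

Joins : ∀ {n} → Edge n → Fin n → Fin n → Set
Joins (neg i j _) a b = (i ≡ a × j ≡ b) ⊎ (i ≡ b × j ≡ a)
Joins (pos i j _) a b = (i ≡ a × j ≡ b) ⊎ (i ≡ b × j ≡ a)
Joins (half _) a b = ⊥
Joins (loop _) a b = ⊥

data IsNeg {n} : Edge n → Set where
  isNeg : ∀ {i j} .{p : j < i} → IsNeg (neg i j p)

data IsPos {n} : Edge n → Set where
  isPos : ∀ {i j} .{p : j < i} → IsPos (pos i j p)

TriKinds : ∀ {n} → Edge n → Edge n → Edge n → Set
TriKinds e₁ e₂ e₃ =
  (IsNeg e₁ × IsNeg e₂ × IsNeg e₃) ⊎
  (IsNeg e₁ × IsPos e₂ × IsPos e₃) ⊎
  (IsPos e₁ × IsNeg e₂ × IsPos e₃) ⊎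
  (IsPos e₁ × IsPos e₂ × IsNeg e₃)

Distinct3 : ∀ {n} → Fin n → Fin n → Fin n → Set
Distinct3 a b c = a ≢ b × b ≢ c × a ≢ c

-- Shapes of type-Φ generators.  The Bool index records whether the
-- generator is a clover (these give double edges in IntGr).

data GenShape {n} (Φ : Ty) : List (Edge n) → Bool → Set where
  triangle : ∀ {a b c e₁ e₂ e₃} → Distinct3 a b c →
             Joins e₁ a b → Joins e₂ b c → Joins e₃ a c → TriKinds e₁ e₂ e₃ →
             GenShape Φ (e₁ ∷ e₂ ∷ e₃ ∷ []) false
  pair     : ∀ {i j e} → Φ ≡ B → Joins e i j →
             GenShape Φ (e ∷ half i ∷ half j ∷ []) false
  clover   : ∀ {i j e₁ e₂} → Φ ≡ C → Joins e₁ i j → Joins e₂ i j →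
             IsNeg e₁ → IsPos e₂ →
             GenShape Φ (e₁ ∷ e₂ ∷ loop i ∷ []) true

GenCopy : ∀ {n} → Ty → Tour n → List (Edge n) → Bool → Set
GenCopy Φ T G c = GenShape Φ G c × Neutral T G

GenCopyAny : ∀ {n} → Ty → Tour n → List (Edge n) → Set
GenCopyAny Φ T G = Σ Bool λ c → GenCopy Φ T G c

OneCommon : ∀ {n} → List (Edge n) → List (Edge n) → Set
OneCommon {n} G₁ G₂ = Σ (Edge n) λ e → e ∈ G₁ × e ∈ G₂ ×
  (∀ e' → e' ∈ G₁ → e' ∈ G₂ → e' ≡ e)

Vtx : ∀ {n} → Ty → (Fin n → ℤ) → Tour n → Set
Vtx Φ s T = ∀ k → score2 Φ T k ≡ s k

Joined : ∀ {n} → Ty → Bool → Tour n → Tour n → Set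
Joined {n} Φ c T T' = Σ (List (Edge n)) λ G → GenCopy Φ T G c × (T' ≈[ Φ ] (T * G ⟨flip⟩))

Adj : ∀ {n} → Ty → (Fin n → ℤ) → Tour n → Tour n → Set
Adj Φ s T T' = Vtx Φ s T × Vtx Φ s T' × (Joined Φ false T T' ⊎ Joined Φ true T T')

SingleE : ∀ {n} → Ty → (Fin n → ℤ) → Tour n → Tour n → Set
SingleE Φ s T T' = Vtx Φ s T × Vtx Φ s T' × Joined Φ false T T' × ¬ Joined Φ true T T'

DoubleE : ∀ {n} → Ty → (Fin n → ℤ) → Tour n → Tour n → Set
DoubleE Φ s T T' = Vtx Φ s T × Vtx Φ s T' × Joined Φ true T T' × ¬ Joined Φ false T T'

Mid : ∀ {n} → Ty → (Fin n → ℤ) → Tour n → Tour n → Tour n → Set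
Mid Φ s T₁ T₂ X = Adj Φ s T₁ X × Adj Φ s X T₂

-- Shapes of N(T₁, T₂).  The set of middle vertices of length-two paths
-- (up to identification of tournaments) is exactly the listed one.

SingleDiamond : ∀ {n} → Ty → (Fin n → ℤ) → Tour n → Tour n → Set
SingleDiamond {n} Φ s T₁ T₂ = Σ (Tour n) λ X → Σ (Tour n) λ Y →
  ¬ (X ≈[ Φ ] Y) ×
  (∀ Z → Mid Φ s T₁ T₂ Z → (Z ≈[ Φ ] X) ⊎ (Z ≈[ Φ ] Y)) ×
  SingleE Φ s T₁ X × SingleE Φ s X T₂ × SingleE Φ s T₁ Y × SingleE Φ s Y T₂

DoubleDiamond : ∀ {n} → Ty → (Fin n → ℤ) → Tour n → Tour n → Set
DoubleDiamond {n} Φ s T₁ T₂ = Σ (Tour n) λ X → Σ (Tour n) λ Y →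
  ¬ (X ≈[ Φ ] Y) ×
  (∀ Z → Mid Φ s T₁ T₂ Z → (Z ≈[ Φ ] X) ⊎ (Z ≈[ Φ ] Y)) ×
  DoubleE Φ s T₁ X × SingleE Φ s X T₂ × SingleE Φ s T₁ Y × DoubleE Φ s Y T₂

HeavyDiamond : ∀ {n} → Ty → (Fin n → ℤ) → Tour n → Tour n → Set
HeavyDiamond {n} Φ s T₁ T₂ = Σ (Tour n) λ X → Σ (Tour n) λ Y →
  ¬ (X ≈[ Φ ] Y) ×
  (∀ Z → Mid Φ s T₁ T₂ Z → (Z ≈[ Φ ] X) ⊎ (Z ≈[ Φ ] Y)) ×
  ((DoubleE Φ s T₁ X × DoubleE Φ s T₁ Y × SingleE Φ s X T₂ × SingleE Φ s Y T₂) ⊎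
   (SingleE Φ s T₁ X × SingleE Φ s T₁ Y × DoubleE Φ s X T₂ × DoubleE Φ s Y T₂))

SplitDiamond : ∀ {n} → Ty → (Fin n → ℤ) → Tour n → Tour n → Set
SplitDiamond {n} Φ s T₁ T₂ = Σ (Tour n) λ X → Σ (Tour n) λ Y → Σ (Tour n) λ Z →
  ¬ (X ≈[ Φ ] Y) × ¬ (X ≈[ Φ ] Z) × ¬ (Y ≈[ Φ ] Z) ×
  (∀ W → Mid Φ s T₁ T₂ W → (W ≈[ Φ ] X) ⊎ (W ≈[ Φ ] Y) ⊎ (W ≈[ Φ ] Z)) ×
  SingleE Φ s T₁ X × SingleE Φ s X T₂ × SingleE Φ s T₁ Y × SingleE Φ s Y T₂ ×
  DoubleE Φ s T₁ Z × DoubleE Φ s Z T₂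

DiffIs : ∀ {n} → Ty → Tour n → Tour n → List (Edge n) → Set
DiffIs Φ T₁ T₂ L = ∀ e → ((InK Φ e × T₁ e ≢ T₂ e) → e ∈ L) × (e ∈ L → (InK Φ e × T₁ e ≢ T₂ e))

Distinct4 : ∀ {n} → Fin n → Fin n → Fin n → Fin n → Set
Distinct4 a b c d = a ≢ b × a ≢ c × a ≢ d × b ≢ c × b ≢ d × c ≢ d

ProjSquare : ∀ {n} → Ty → Tour n → Tour n → Set
ProjSquare {n} Φ T₁ T₂ = Σ (Fin n) λ a → Σ (Fin n) λ b → Σ (Fin n) λ c → Σ (Fin n) λ d →
  Σ (Edge n) λ e₁ → Σ (Edge n) λ e₂ → Σ (Edge n) λ e₃ → Σ (Edge n) λ e₄ →
  Distinct4 a b c d × Joins e₁ a b × Joins e₂ b c × Joins e₃ c d × Joins e₄ d a ×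
  DiffIs Φ T₁ T₂ (e₁ ∷ e₂ ∷ e₃ ∷ e₄ ∷ [])

ProjTent : ∀ {n} → Ty → Tour n → Tour n → Set
ProjTent {n} Φ T₁ T₂ = Σ (Fin n) λ x → Σ (Fin n) λ y → Σ (Fin n) λ z →
  Σ (Edge n) λ e₁ → Σ (Edge n) λ e₂ → Σ (Edge n) λ e₃ → Σ (Edge n) λ e₄ →
  Distinct3 x y z × Joins e₁ x y × Joins e₂ x y × e₁ ≢ e₂ ×
  Joins e₃ x z × Joins e₄ x z × e₃ ≢ e₄ ×
  DiffIs Φ T₁ T₂ (e₁ ∷ e₂ ∷ e₃ ∷ e₄ ∷ [])

ProjHanger : ∀ {n} → Ty → Tour n → Tour n → Set
ProjHanger {n} Φ T₁ T₂ = Σ (Fin n) λ x → Σ (Fin n) λ y → Σ (Fin n) λ z →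
  Σ (Edge n) λ e₁ → Σ (Edge n) λ e₂ → Σ (Edge n) λ e₃ →
  Distinct3 x y z × Joins e₁ x y × Joins e₂ y z × Joins e₃ x z ×
  DiffIs Φ T₁ T₂ (e₁ ∷ e₂ ∷ e₃ ∷ loop x ∷ [])

{-# OPTIONS --safe #-}
-- Write σ T e for the signed vector (2 w_e − 1) e of a game.  If T₁ \ T₂ = D has four games, a middle
-- vertex Z of a path T₁ − Z − T₂ is T₁ with two games a, b of D and one game g outside D flipped, and
-- neutrality forces σ g = −(σ a + σ b).  A signed vector determines its game, so each of the three splits
-- {a,b} | {c,d} of D yields at most one middle vertex, and none when σ a + σ b has three points of support.
-- Going through the splits for each possible D (square, tent, hanger, and in types B and D the differences
-- of two adjacent triangles or pairs) gives the diamonds; an edge is double exactly when its generator is a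
-- clover.  Parts (2)–(4) hold for any two vertices whose difference has the given projection.
module Submission where

open import Defs
open import Data.Bool using (Bool; true; false; not; if_then_else_; _xor_; _∨_) renaming (_≟_ to _≟B_)
open import Data.Bool.Properties using (not-involutive; not-¬; ¬-not; not-injective; xor-assoc; xor-comm)
open import Data.Empty using (⊥; ⊥-elim)
open import Data.Fin using (Fin; zero; suc; _<_)
open import Data.Fin.Properties using (_<?_; <⇒≢; <-asym; <-cmp; suc-injective) renaming (_≟_ to _≟F_)
open import Data.Integer using (ℤ; +0; -[1+_]; 0ℤ; 1ℤ; -1ℤ; _+_; _-_; _*_; -_)
open import Data.Integer.Properties
  using (+-identityˡ; +-identityʳ; +-assoc; +-inverseʳ; neg-distribˡ-*; neg-involutive; -1*i≡-i;
         *-identityˡ; *-identityʳ; *-zeroʳ; *-distribˡ-+)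
open import Data.Integer.Tactic.RingSolver using (solve-∀)
open import Data.List using (List; []; _∷_; _++_; map; concatMap; tabulate; allFin; length; filter)
open import Data.List.Properties using (concatMap-cong; map-tabulate; filter-notAll; ++-identityʳ)
import Data.List.Relation.Unary.All as All
open All using (All; []; _∷_)
open import Data.List.Relation.Unary.All.Properties using (All¬⇒¬Any; ¬Any⇒All¬)
open import Data.List.Relation.Unary.Unique.Propositional using (Unique; []; _∷_)
import Data.List.Relation.Unary.AllPairs as AllPairs
open import Data.List.Membership.Propositional using (_∈_; _∉_)
open import Data.List.Membership.Propositional.Properties
  using (∈-tabulate⁻; ∈-++⁻; ∈-++⁺ˡ; ∈-++⁺ʳ; ∈-map⁻; ∈-filter⁺)
open import Data.List.Relation.Binary.Subset.Propositional using (_⊆_)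
import Data.List.Relation.Unary.Any as Any
open import Data.List.Membership.DecPropositional using () renaming (_∈?_ to mem?)
open import Data.List.Relation.Unary.Any using (here; there)
open import Data.List.Relation.Binary.Permutation.Propositional using (_↭_; refl; prep; swap; trans; ↭-sym; ↭⇒↭ₛ)
open import Data.List.Relation.Binary.Permutation.Propositional.Properties using (∈-resp-↭; All-resp-↭; ++-comm)
import Data.List.Relation.Binary.Permutation.Setoid.Properties as PermutationProperties
open import Data.Nat using (ℕ; _≤_; z≤n; s≤s)
open import Data.Nat.Properties using (≤-trans)
open import Data.Unit using (tt)
open import Data.Product using (Σ; ∃; _×_; _,_; proj₁; proj₂)
open import Data.Product.Properties using (,-injective)
import Data.Product as Product
open import Data.Sum using (_⊎_; inj₁; inj₂; [_,_])
import Data.Sum as Sum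
open import Function using (_∘_; _∘₂_)
open import Relation.Nullary using (¬_; ¬?; Dec; yes; no; does)
open import Relation.Binary.Definitions using (tri<; tri≈; tri>)
open import Relation.Nullary.Decidable using (dec-true; dec-false; recompute; _⊎-dec_)
open import Relation.Binary.PropositionalEquality using (_≡_; _≢_; refl; sym; cong; cong₂; subst; setoid; module ≡-Reasoning)
  renaming (trans to ≡-trans)

open ≡-Reasoning

sumOver : ∀ {A : Set} → (A → ℤ) → List A → ℤ
sumOver f xs = sumℤ (map f xs)

sumOver-++ : ∀ {A : Set} (f : A → ℤ) xs ys → sumOver f (xs ++ ys) ≡ sumOver f xs + sumOver f ys
sumOver-++ f [] ys = sym (+-identityˡ _)
sumOver-++ f (x ∷ xs) ys = ≡-trans (cong (f x +_) (sumOver-++ f xs ys)) (sym (+-assoc (f x) _ _))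

sumOver-concatMap : ∀ {A B : Set} (f : B → ℤ) (g : A → List B) xs →
                    sumOver f (concatMap g xs) ≡ sumOver (sumOver f ∘ g) xs
sumOver-concatMap f g [] = refl
sumOver-concatMap f g (x ∷ xs) =
  ≡-trans (sumOver-++ f (g x) (concatMap g xs)) (cong (sumOver f (g x) +_) (sumOver-concatMap f g xs))

sumOver-cong : ∀ {A : Set} (f g : A → ℤ) xs → (∀ {x} → x ∈ xs → f x ≡ g x) → sumOver f xs ≡ sumOver g xs
sumOver-cong f g [] eq = refl
sumOver-cong f g (x ∷ xs) eq = cong₂ _+_ (eq (here refl)) (sumOver-cong f g xs (eq ∘ there))

sumOver-zero : ∀ {A : Set} (f : A → ℤ) xs → (∀ {x} → x ∈ xs → f x ≡ 0ℤ) → sumOver f xs ≡ 0ℤ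
sumOver-zero f [] eq = refl
sumOver-zero f (x ∷ xs) eq = cong₂ _+_ (eq (here refl)) (sumOver-zero f xs (eq ∘ there))

sumOver-+ : ∀ {A : Set} (f g : A → ℤ) xs → sumOver (λ x → f x + g x) xs ≡ sumOver f xs + sumOver g xs
sumOver-+ f g [] = refl
sumOver-+ f g (x ∷ xs) = ≡-trans (cong (f x + g x +_) (sumOver-+ f g xs)) (interchange (f x) (g x) _ _)
  where
  interchange : ∀ a b c d → a + b + (c + d) ≡ a + c + (b + d)
  interchange = solve-∀

sumOver-↭ : ∀ {A : Set} (f : A → ℤ) {xs ys} → xs ↭ ys → sumOver f xs ≡ sumOver f ys
sumOver-↭ f refl = refl
sumOver-↭ f (prep x p) = cong (f x +_) (sumOver-↭ f p)
sumOver-↭ f (swap x y p) =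
  ≡-trans (cong (λ r → f x + (f y + r)) (sumOver-↭ f p)) (swap-front (f x) (f y) _)
  where
  swap-front : ∀ a b c → a + (b + c) ≡ b + (a + c)
  swap-front = solve-∀
sumOver-↭ f (trans p q) = ≡-trans (sumOver-↭ f p) (sumOver-↭ f q)

sumOver-two : ∀ {A : Set} (f : A → ℤ) {xs p q rest} → xs ↭ p ∷ q ∷ rest → All (λ r → f r ≡ 0ℤ) rest →
              sumOver f xs ≡ f p + f q
sumOver-two f {p = p} {q} {rest} xs↭ rest≡0 = begin
  _                            ≡⟨ sumOver-↭ f xs↭ ⟩
  f p + (f q + sumOver f rest) ≡⟨ cong (λ r → f p + (f q + r)) (sumOver-zero f rest (All.lookup rest≡0)) ⟩
  f p + (f q + 0ℤ)             ≡⟨ cong (f p +_) (+-identityʳ (f q)) ⟩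
  f p + f q                    ∎

sumOver-tabulate-single : ∀ {A : Set} {n} (f : A → ℤ) (g : Fin n → A) (i₀ : Fin n) →
                          (∀ i → i ≢ i₀ → f (g i) ≡ 0ℤ) → sumOver f (tabulate g) ≡ f (g i₀)
sumOver-tabulate-single f g zero off = begin
  f (g zero) + sumOver f (tabulate (g ∘ suc)) ≡⟨ cong (f (g zero) +_) (sumOver-zero f _ rest) ⟩
  f (g zero) + 0ℤ                               ≡⟨ +-identityʳ _ ⟩
  f (g zero)                                    ∎
  where
  rest : ∀ {x} → x ∈ tabulate (g ∘ suc) → f x ≡ 0ℤ
  rest x∈ with ∈-tabulate⁻ x∈
  ... | i , refl = off (suc i) λ ()
sumOver-tabulate-single f g (suc i₀) off = begin
  f (g zero) + sumOver f (tabulate (g ∘ suc))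
    ≡⟨ cong₂ _+_ (off zero λ ()) (sumOver-tabulate-single f (g ∘ suc) i₀ λ i ne → off (suc i) (ne ∘ suc-injective)) ⟩
  0ℤ + f (g (suc i₀)) ≡⟨ +-identityˡ _ ⟩
  f (g (suc i₀))      ∎

a+b≡a⇒b≡0 : ∀ a b → a + b ≡ a → b ≡ 0ℤ
a+b≡a⇒b≡0 a b eq = begin
  b         ≡⟨ sym (rearrange a b) ⟩
  a + b - a ≡⟨ cong (_- a) eq ⟩
  a - a     ≡⟨ +-inverseʳ a ⟩
  0ℤ        ∎
  where
  rearrange : ∀ a b → a + b - a ≡ b
  rearrange = solve-∀

x+x≡0⇒x≡0 : ∀ x → x + x ≡ 0ℤ → x ≡ 0ℤ
x+x≡0⇒x≡0 +0 _ = refl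
x+x≡0⇒x≡0 -[1+ _ ] ()

x≡-x⇒x≡0 : ∀ (x : ℤ) → x ≡ - x → x ≡ 0ℤ
x≡-x⇒x≡0 x x≡-x = x+x≡0⇒x≡0 x (≡-trans (cong (x +_) x≡-x) (+-inverseʳ x))

+0-≢0 : ∀ {x y : ℤ} → y ≡ 0ℤ → x ≢ 0ℤ → x + y ≢ 0ℤ
+0-≢0 {x} refl x≢0 = x≢0 ∘ ≡-trans (sym (+-identityʳ x))

0+-≢0 : ∀ {x y : ℤ} → x ≡ 0ℤ → y ≢ 0ℤ → x + y ≢ 0ℤ
0+-≢0 {y = y} refl y≢0 = y≢0 ∘ ≡-trans (sym (+-identityˡ y))

neg-≢0 : ∀ {x : ℤ} → x ≢ 0ℤ → - x ≢ 0ℤ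
neg-≢0 {x} x≢0 -x≡0 = x≢0 (≡-trans (sym (neg-involutive x)) (cong -_ -x≡0))

sgn-not : ∀ b → sgn (not b) ≡ - sgn b
sgn-not true  = refl
sgn-not false = refl

sgn-not-* : ∀ b v → sgn (not b) * v ≡ - (sgn b * v)
sgn-not-* b v = ≡-trans (cong (_* v) (sgn-not b)) (sym (neg-distribˡ-* (sgn b) v))

sgn≢0 : ∀ b → sgn b ≢ 0ℤ
sgn≢0 true  ()
sgn≢0 false ()

sgn+sgn≢0 : ∀ b → sgn b + sgn b ≢ 0ℤ
sgn+sgn≢0 true  ()
sgn+sgn≢0 false ()

sgn+sgn≡0 : ∀ {x y} → sgn x + sgn y ≡ 0ℤ → y ≡ not x
sgn+sgn≡0 {true}  {false} _ = refl
sgn+sgn≡0 {false} {true}  _ = refl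
sgn+sgn≡0 {true}  {true}  ()
sgn+sgn≡0 {false} {false} ()

sgn+sgn-not : ∀ b → sgn b + sgn (not b) ≡ 0ℤ
sgn+sgn-not true  = refl
sgn+sgn-not false = refl

xor-cancelˡ : ∀ t {x y} → t xor x ≡ t xor y → x ≡ y
xor-cancelˡ true  = not-injective
xor-cancelˡ false = λ x≡y → x≡y

unique₃ : ∀ {A : Set} {x y z : A} → x ≢ y → x ≢ z → y ≢ z → Unique (x ∷ y ∷ z ∷ [])
unique₃ x≢y x≢z y≢z = (x≢y ∷ x≢z ∷ []) ∷ (y≢z ∷ []) ∷ [] ∷ []

unique₄ : ∀ {A : Set} {w x y z : A} → w ≢ x → w ≢ y → w ≢ z → x ≢ y → x ≢ z → y ≢ z →
          Unique (w ∷ x ∷ y ∷ z ∷ [])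
unique₄ w≢x w≢y w≢z x≢y x≢z y≢z = (w≢x ∷ w≢y ∷ w≢z ∷ []) ∷ unique₃ x≢y x≢z y≢z

Unique-↭ : ∀ {A : Set} {xs ys : List A} → xs ↭ ys → Unique xs → Unique ys
Unique-↭ {A} xs↭ys = PermutationProperties.Unique-resp-↭ (setoid A) (↭⇒↭ₛ xs↭ys)

Unique-++-disjoint : ∀ {A : Set} (xs : List A) {ys e} → Unique (xs ++ ys) → e ∈ xs → e ∉ ys
Unique-++-disjoint (x ∷ xs) (x∉ ∷ _) (here refl) e∈ys = All.lookup x∉ (∈-++⁺ʳ xs e∈ys) refl
Unique-++-disjoint (x ∷ xs) (_ ∷ u) (there e∈xs) = Unique-++-disjoint xs u e∈xs

∉-++-∷ : ∀ {A : Set} (xs : List A) {e g} → e ∉ xs → e ≢ g → e ∉ xs ++ g ∷ []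
∉-++-∷ xs e∉ e≢g e∈ = Sum.[ e∉ , (λ { (here e≡g) → e≢g e≡g }) ] (∈-++⁻ xs e∈)

triple-↭ : ∀ {A : Set} {x y z a b : A} → a ∈ x ∷ y ∷ z ∷ [] → b ∈ x ∷ y ∷ z ∷ [] → a ≢ b →
           ∃ λ g → x ∷ y ∷ z ∷ [] ↭ a ∷ b ∷ g ∷ []
triple-↭ (here refl)                 (here refl)                 a≢b = ⊥-elim (a≢b refl)
triple-↭ (there (here refl))         (there (here refl))         a≢b = ⊥-elim (a≢b refl)
triple-↭ (there (there (here refl))) (there (there (here refl))) a≢b = ⊥-elim (a≢b refl)
triple-↭ {z = z} (here refl) (there (here refl)) _ = z , refl
triple-↭ {x = x} {y} {z} (here refl) (there (there (here refl))) _ = y , prep x (swap y z refl)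
triple-↭ {x = x} {y} {z} (there (here refl)) (here refl) _ = z , swap x y refl
triple-↭ {x = x} {y} {z} (there (here refl)) (there (there (here refl))) _ = x , trans (swap x y refl) (prep y (swap x z refl))
triple-↭ {x = x} {y} {z} (there (there (here refl))) (here refl) _ = y , trans (prep x (swap y z refl)) (swap x z refl)
triple-↭ {x = x} {y} {z} (there (there (here refl))) (there (here refl)) _ =
  x , trans (swap x y refl) (trans (prep y (swap x z refl)) (swap y z refl))

unique-⊆⇒length≤ : ∀ {n} {xs ys : List (Edge n)} → Unique xs → xs ⊆ ys → length xs ≤ length ys
unique-⊆⇒length≤ {xs = []} [] _ = z≤n
unique-⊆⇒length≤ {xs = x ∷ xs} {ys} (x∉xs ∷ uxs) xs⊆ys =
  ≤-trans (s≤s (unique-⊆⇒length≤ uxs xs⊆others))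
          (filter-notAll other? ys (Any.map (λ x≡y y≢x → y≢x (sym x≡y)) (xs⊆ys (here refl))))
  where
  other? = λ y → ¬? (y ≟E x)
  xs⊆others : xs ⊆ filter other? ys
  xs⊆others y∈ = ∈-filter⁺ other? (xs⊆ys (there y∈)) (λ y≡x → All.lookup x∉xs y∈ (sym y≡x))

∈-concatMap⁻ : ∀ {A B : Set} (g : A → List B) xs {y} → y ∈ concatMap g xs → ∃ λ x → y ∈ g x
∈-concatMap⁻ g (x ∷ xs) y∈ with ∈-++⁻ (g x) y∈
... | inj₁ y∈gx = x , y∈gx
... | inj₂ y∈rest = ∈-concatMap⁻ g xs y∈rest

pairAt : ∀ {n} (i j : Fin n) → Dec (j < i) → List (Edge n)
pairAt i j (yes p) = neg i j p ∷ pos i j p ∷ []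
pairAt i j (no _)  = []

private
  -- Defs builds negPosEdges from a helper local to its definition; unification names it here.
  negPosEdges-helper : ∀ n → Σ (Fin n → Fin n → List (Edge n)) λ P →
                       negPosEdges n ≡ concatMap (λ i → concatMap (P i) (allFin n)) (allFin n)
  negPosEdges-helper n = _ , refl

  helper≡pairAt : ∀ n (i j : Fin n) → proj₁ (negPosEdges-helper n) i j ≡ pairAt i j (j <? i)
  helper≡pairAt n i j with j <? i
  ... | yes _ = refl
  ... | no _  = refl

negPosEdges-pairAt : ∀ n → negPosEdges n ≡ concatMap (λ i → concatMap (λ j → pairAt i j (j <? i)) (allFin n)) (allFin n)
negPosEdges-pairAt n = ≡-trans (proj₂ (negPosEdges-helper n))
  (concatMap-cong (λ i → concatMap-cong (helper≡pairAt n i) (allFin n)) (allFin n))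

ends : ∀ {n} → Edge n → Fin n × Fin n
ends (neg i j _) = i , j
ends (pos i j _) = i , j
ends (half i)    = i , i
ends (loop i)    = i , i

pairAt-ends : ∀ {n} {i j : Fin n} d {e} → e ∈ pairAt i j d → ends e ≡ (i , j)
pairAt-ends (yes _) (here refl)         = refl
pairAt-ends (yes _) (there (here refl)) = refl

IsNegPos : ∀ {n} → Edge n → Set
IsNegPos e = IsNeg e ⊎ IsPos e

pairAt-IsNegPos : ∀ {n} {i j : Fin n} d {e} → e ∈ pairAt i j d → IsNegPos e
pairAt-IsNegPos (yes _) (here refl)         = inj₁ isNeg
pairAt-IsNegPos (yes _) (there (here refl)) = inj₂ isPos

∈-pairAt : ∀ {n} {i j : Fin n} .(p : j < i) → neg i j p ∈ pairAt i j (j <? i) × pos i j p ∈ pairAt i j (j <? i)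
∈-pairAt {i = i} {j} p with j <? i
... | yes _ = here refl , there (here refl)
... | no j≮i = ⊥-elim (j≮i (recompute (j <? i) p))

∈-negPosEdges : ∀ {n} {e : Edge n} → e ∈ negPosEdges n → IsNegPos e
∈-negPosEdges {n} e∈ rewrite negPosEdges-pairAt n with ∈-concatMap⁻ _ (allFin n) e∈
... | i , e∈row with ∈-concatMap⁻ _ (allFin n) e∈row
... | j , e∈cell = pairAt-IsNegPos (j <? i) e∈cell

sumOver-negPosEdges : ∀ {n} (f : Edge n → ℤ) → sumOver f (negPosEdges n) ≡
  sumOver (λ i → sumOver (λ j → sumOver f (pairAt i j (j <? i))) (allFin n)) (allFin n)
sumOver-negPosEdges {n} f rewrite negPosEdges-pairAt n =
  ≡-trans (sumOver-concatMap f _ (allFin n)) (sumOver-cong _ _ (allFin n) λ _ → sumOver-concatMap f _ (allFin n))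

sumOver-pairAt-single : ∀ {n} {i j : Fin n} d {x} → x ∈ pairAt i j d → (f : Edge n → ℤ) →
                        (∀ {e} → e ≢ x → f e ≡ 0ℤ) → sumOver f (pairAt i j d) ≡ f x
sumOver-pairAt-single (yes _) (here refl) f off =
  ≡-trans (cong (λ r → f _ + (r + 0ℤ)) (off λ ())) (+-identityʳ _)
sumOver-pairAt-single (yes _) (there (here refl)) f off =
  ≡-trans (cong (_+ (f _ + 0ℤ)) (off λ ())) (≡-trans (+-identityˡ _) (+-identityʳ _))

sumOver-negPosEdges-single : ∀ {n} {i₀ j₀ : Fin n} {x} → x ∈ pairAt i₀ j₀ (j₀ <? i₀) → (f : Edge n → ℤ) →
                             (∀ {e} → e ≢ x → f e ≡ 0ℤ) → sumOver f (negPosEdges n) ≡ f x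
sumOver-negPosEdges-single {n} {i₀} {j₀} {x} x∈ f off = begin
  sumOver f (negPosEdges n)          ≡⟨ sumOver-negPosEdges f ⟩
  sumOver row (allFin n)             ≡⟨ sumOver-tabulate-single row (λ i → i) i₀ row-off ⟩
  sumOver (cell i₀) (allFin n)       ≡⟨ sumOver-tabulate-single (cell i₀) (λ j → j) j₀ (λ j j≢j₀ → cell-off i₀ j (j≢j₀ ∘ cong proj₂)) ⟩
  sumOver f (pairAt i₀ j₀ (j₀ <? i₀)) ≡⟨ sumOver-pairAt-single (j₀ <? i₀) x∈ f off ⟩
  f x                                ∎
  where
  cell : Fin n → Fin n → ℤ
  cell i j = sumOver f (pairAt i j (j <? i))
  row : Fin n → ℤ
  row i = sumOver (cell i) (allFin n)
  cell-off : ∀ i j → (i , j) ≢ (i₀ , j₀) → cell i j ≡ 0ℤ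
  cell-off i j ij≢ = sumOver-zero f _ λ e∈ → off λ { refl → ij≢ (≡-trans (sym (pairAt-ends (j <? i) e∈)) (pairAt-ends _ x∈)) }
  row-off : ∀ i → i ≢ i₀ → row i ≡ 0ℤ
  row-off i i≢i₀ = sumOver-zero (cell i) (allFin n) λ {j} _ → cell-off i j (i≢i₀ ∘ cong proj₁)

vertexGames : Ty → (n : ℕ) → List (Edge n)
vertexGames B n = map half (allFin n)
vertexGames C n = map loop (allFin n)
vertexGames D n = []

games-split : ∀ Φ n → games Φ n ≡ negPosEdges n ++ vertexGames Φ n
games-split B n = refl
games-split C n = refl
games-split D n = sym (++-identityʳ (negPosEdges n))

sumOver-games : ∀ Φ {n} (f : Edge n → ℤ) → sumOver f (games Φ n) ≡ sumOver f (negPosEdges n) + sumOver f (vertexGames Φ n)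
sumOver-games Φ {n} f = ≡-trans (cong (sumOver f) (games-split Φ n)) (sumOver-++ f (negPosEdges n) _)

∈-vertexGames : ∀ Φ {n} {e : Edge n} → e ∈ vertexGames Φ n → ¬ IsNegPos e
∈-vertexGames B e∈ with ∈-map⁻ _ e∈
... | _ , _ , refl = λ { (inj₁ ()) ; (inj₂ ()) }
∈-vertexGames C e∈ with ∈-map⁻ _ e∈
... | _ , _ , refl = λ { (inj₁ ()) ; (inj₂ ()) }

IsNegPos-InK : ∀ Φ {n} {e : Edge n} → IsNegPos e → InK Φ e
IsNegPos-InK Φ (inj₁ isNeg) = tt
IsNegPos-InK Φ (inj₂ isPos) = tt

vertexGames-InK : ∀ Φ {n} {e : Edge n} → e ∈ vertexGames Φ n → InK Φ e
vertexGames-InK B e∈ with ∈-map⁻ _ e∈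
... | _ , _ , refl = tt
vertexGames-InK C e∈ with ∈-map⁻ _ e∈
... | _ , _ , refl = tt

games-InK : ∀ Φ {n} {e : Edge n} → e ∈ games Φ n → InK Φ e
games-InK Φ {n} e∈ = Sum.[ IsNegPos-InK Φ ∘ ∈-negPosEdges , vertexGames-InK Φ ]
                           (∈-++⁻ (negPosEdges n) (subst (_ ∈_) (games-split Φ n) e∈))

sumOver-allFin-map-single : ∀ {n} (c : Fin n → Edge n) → (∀ {i j} → c i ≡ c j → i ≡ j) → (f : Edge n → ℤ) →
                            ∀ i₀ → (∀ {e} → e ≢ c i₀ → f e ≡ 0ℤ) → sumOver f (map c (allFin n)) ≡ f (c i₀)
sumOver-allFin-map-single c c-inj f i₀ off =
  ≡-trans (cong (sumOver f) (map-tabulate (λ i → i) c)) (sumOver-tabulate-single f c i₀ λ i i≢i₀ → off (i≢i₀ ∘ c-inj))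

private
  sumOver-games-negPos : ∀ Φ {n} {i j : Fin n} {x} → x ∈ pairAt i j (j <? i) → (f : Edge n → ℤ) →
                         (∀ {e} → e ≢ x → f e ≡ 0ℤ) → sumOver f (games Φ n) ≡ f x
  sumOver-games-negPos Φ x∈ f off = begin
    _ ≡⟨ sumOver-games Φ f ⟩
    _ ≡⟨ cong₂ _+_ (sumOver-negPosEdges-single x∈ f off)
                   (sumOver-zero f _ λ e∈ → off λ { refl → ∈-vertexGames Φ e∈ (pairAt-IsNegPos _ x∈) }) ⟩
    _ ≡⟨ +-identityʳ _ ⟩
    _ ∎

  sumOver-games-vertex : ∀ Φ {n} (c : Fin n → Edge n) → vertexGames Φ n ≡ map c (allFin n) → (∀ {i} → ¬ IsNegPos (c i)) →
                         (∀ {i j} → c i ≡ c j → i ≡ j) → (f : Edge n → ℤ) →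
                         ∀ i → (∀ {e} → e ≢ c i → f e ≡ 0ℤ) → sumOver f (games Φ n) ≡ f (c i)
  sumOver-games-vertex Φ {n} c vg≡ c-vertex c-inj f i off = begin
    _ ≡⟨ sumOver-games Φ f ⟩
    _ ≡⟨ cong₂ _+_ (sumOver-zero f _ λ e∈ → off λ { refl → c-vertex (∈-negPosEdges e∈) })
                   (≡-trans (cong (sumOver f) vg≡) (sumOver-allFin-map-single c c-inj f i off)) ⟩
    _ ≡⟨ +-identityˡ _ ⟩
    _ ∎

sumOver-games-single : ∀ Φ {n} {x : Edge n} → InK Φ x → (f : Edge n → ℤ) →
                       (∀ {e} → e ≢ x → f e ≡ 0ℤ) → sumOver f (games Φ n) ≡ f x
sumOver-games-single Φ {x = neg i j p} _ = sumOver-games-negPos Φ (proj₁ (∈-pairAt p))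
sumOver-games-single Φ {x = pos i j p} _ = sumOver-games-negPos Φ (proj₂ (∈-pairAt p))
sumOver-games-single B {x = half i} _ f = sumOver-games-vertex B half refl (λ { (inj₁ ()) ; (inj₂ ()) }) (λ { refl → refl }) f i
sumOver-games-single C {x = loop i} _ f = sumOver-games-vertex C loop refl (λ { (inj₁ ()) ; (inj₂ ()) }) (λ { refl → refl }) f i

_∈ᵇ_ : ∀ {n} → Edge n → List (Edge n) → Bool
e ∈ᵇ L = does (mem? _≟E_ e L)

sumOver-games-restrict : ∀ Φ {n} {A : List (Edge n)} → Unique A → All (InK Φ) A → (h : Edge n → ℤ) →
                         sumOver (λ e → if e ∈ᵇ A then h e else 0ℤ) (games Φ n) ≡ sumOver h A
sumOver-games-restrict Φ {n} {[]} _ _ h = sumOver-zero _ (games Φ n) λ _ → refl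
sumOver-games-restrict Φ {n} {x ∷ A} (x∉A ∷ uA) (xK ∷ AK) h = begin
  sumOver (λ e → if e ∈ᵇ (x ∷ A) then h e else 0ℤ) (games Φ n)
    ≡⟨ sumOver-cong _ _ (games Φ n) (λ {e} _ → split e) ⟩
  sumOver (λ e → at-x e + (if e ∈ᵇ A then h e else 0ℤ)) (games Φ n)
    ≡⟨ sumOver-+ at-x _ (games Φ n) ⟩
  sumOver at-x (games Φ n) + sumOver (λ e → if e ∈ᵇ A then h e else 0ℤ) (games Φ n)
    ≡⟨ cong₂ _+_ (≡-trans (sumOver-games-single Φ xK at-x at-x-off) at-x-x) (sumOver-games-restrict Φ uA AK h) ⟩
  h x + sumOver h A ∎
  where
  at-x : Edge n → ℤ
  at-x e = if does (e ≟E x) then h e else 0ℤ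
  at-x-x : at-x x ≡ h x
  at-x-x rewrite dec-true (x ≟E x) refl = refl
  at-x-off : ∀ {e} → e ≢ x → at-x e ≡ 0ℤ
  at-x-off {e} e≢x rewrite dec-false (e ≟E x) e≢x = refl
  split : ∀ e → (if does (e ≟E x) ∨ e ∈ᵇ A then h e else 0ℤ) ≡ at-x e + (if e ∈ᵇ A then h e else 0ℤ)
  split e with e ≟E x
  ... | yes refl rewrite dec-false (mem? _≟E_ x A) (All¬⇒¬Any x∉A) = sym (+-identityʳ _)
  ... | no _ = sym (+-identityˡ _)

flip-∈ : ∀ {n} (T : Tour n) {L e} → e ∈ L → (T * L ⟨flip⟩) e ≡ not (T e)
flip-∈ T {L} {e} e∈ rewrite dec-true (mem? _≟E_ e L) e∈ = refl

flip-∉ : ∀ {n} (T : Tour n) {L e} → e ∉ L → (T * L ⟨flip⟩) e ≡ T e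
flip-∉ T {L} {e} e∉ rewrite dec-false (mem? _≟E_ e L) e∉ = refl

flip-xor : ∀ {n} (T : Tour n) L e → (T * L ⟨flip⟩) e ≡ T e xor (e ∈ᵇ L)
flip-xor T L e with T e | e ∈ᵇ L
... | true  | true  = refl
... | true  | false = refl
... | false | true  = refl
... | false | false = refl

∈⇒∈ᵇ : ∀ {n} {e : Edge n} {L} → e ∈ L → e ∈ᵇ L ≡ true
∈⇒∈ᵇ {e = e} {L} = dec-true (mem? _≟E_ e L)

∉⇒∈ᵇ : ∀ {n} {e : Edge n} {L} → e ∉ L → e ∈ᵇ L ≡ false
∉⇒∈ᵇ {e = e} {L} = dec-false (mem? _≟E_ e L)

∈ᵇ-↭ : ∀ {n} {L M : List (Edge n)} → L ↭ M → ∀ e → e ∈ᵇ L ≡ e ∈ᵇ M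
∈ᵇ-↭ {L = L} {M} L↭M e with mem? _≟E_ e L | mem? _≟E_ e M
... | yes _   | yes _   = refl
... | no _    | no _    = refl
... | yes e∈L | no e∉M  = ⊥-elim (e∉M (∈-resp-↭ L↭M e∈L))
... | no e∉L  | yes e∈M = ⊥-elim (e∉L (∈-resp-↭ (↭-sym L↭M) e∈M))

≈flip-↭ : ∀ {Φ n} {T T' : Tour n} {L M} → L ↭ M → T' ≈[ Φ ] (T * L ⟨flip⟩) → T' ≈[ Φ ] (T * M ⟨flip⟩)
≈flip-↭ {T = T} L↭M T'≈ e eK = ≡-trans (T'≈ e eK) (cong (λ b → if b then not (T e) else T e) (∈ᵇ-↭ L↭M e))

σ : ∀ {n} → Tour n → Edge n → Fin n → ℤ
σ T e k = sgn (T e) * vec e k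

σ-flip-∈ : ∀ {n} (T : Tour n) {L e} → e ∈ L → ∀ k → σ (T * L ⟨flip⟩) e k ≡ - σ T e k
σ-flip-∈ T {e = e} e∈ k rewrite flip-∈ T e∈ = sgn-not-* (T e) (vec e k)

σ-flip-∉ : ∀ {n} (T : Tour n) {L e} → e ∉ L → ∀ k → σ (T * L ⟨flip⟩) e k ≡ σ T e k
σ-flip-∉ T e∉ k rewrite flip-∉ T e∉ = refl

score2-flip : ∀ Φ {n} {T T' : Tour n} {A} → Unique A → All (InK Φ) A → T' ≈[ Φ ] (T * A ⟨flip⟩) →
              ∀ k → score2 Φ T' k + (wsum2 T A k + wsum2 T A k) ≡ score2 Φ T k
score2-flip Φ {n} {T} {T'} {A} uA AK T'≈ k = begin
  score2 Φ T' k + (sumOver σT A + sumOver σT A)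
    ≡⟨ cong (score2 Φ T' k +_) (sym (sumOver-+ σT σT A)) ⟩
  score2 Φ T' k + sumOver (λ e → σT e + σT e) A
    ≡⟨ cong (score2 Φ T' k +_) (sym (sumOver-games-restrict Φ uA AK _)) ⟩
  score2 Φ T' k + sumOver twiceOnA (games Φ n)
    ≡⟨ sym (sumOver-+ (λ e → σ T' e k) twiceOnA (games Φ n)) ⟩
  sumOver (λ e → σ T' e k + twiceOnA e) (games Φ n)
    ≡⟨ sumOver-cong _ σT (games Φ n) (pointwise ∘ games-InK Φ) ⟩
  score2 Φ T k ∎
  where
  σT : Edge n → ℤ
  σT e = σ T e k
  twiceOnA : Edge n → ℤ
  twiceOnA e = if e ∈ᵇ A then σT e + σT e else 0ℤ
  cancel : ∀ x → - x + (x + x) ≡ x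
  cancel = solve-∀
  pointwise : ∀ {e} → InK Φ e → σ T' e k + twiceOnA e ≡ σT e
  pointwise {e} eK rewrite T'≈ e eK with e ∈ᵇ A
  ... | true  = ≡-trans (cong (_+ (σT e + σT e)) (sgn-not-* (T e) (vec e k))) (cancel (σT e))
  ... | false = +-identityʳ _

Vtx-flip : ∀ Φ {n} {s} {T T' : Tour n} {A} → Vtx Φ s T → Unique A → All (InK Φ) A → Neutral T A →
           T' ≈[ Φ ] (T * A ⟨flip⟩) → Vtx Φ s T'
Vtx-flip Φ {s = s} {T} {T'} {A} vT uA AK nA T'≈ k = begin
  score2 Φ T' k                                   ≡⟨ sym (+-identityʳ _) ⟩
  score2 Φ T' k + (0ℤ + 0ℤ)                       ≡⟨ cong (λ w → score2 Φ T' k + (w + w)) (sym (nA k)) ⟩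
  score2 Φ T' k + (wsum2 T A k + wsum2 T A k)     ≡⟨ score2-flip Φ uA AK T'≈ k ⟩
  score2 Φ T k                                    ≡⟨ vT k ⟩
  s k                                             ∎

Vtx-flip-neutral : ∀ Φ {n} {s} {T T' : Tour n} {A} → Vtx Φ s T → Vtx Φ s T' → Unique A → All (InK Φ) A →
                   T' ≈[ Φ ] (T * A ⟨flip⟩) → Neutral T A
Vtx-flip-neutral Φ {T = T} {T'} {A} vT vT' uA AK T'≈ k =
  x+x≡0⇒x≡0 (wsum2 T A k) (a+b≡a⇒b≡0 (score2 Φ T' k) _
    (≡-trans (score2-flip Φ uA AK T'≈ k) (≡-trans (vT k) (sym (vT' k)))))

Neutral-↭ : ∀ {n} {T : Tour n} {L M} → L ↭ M → Neutral T L → Neutral T M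
Neutral-↭ {T = T} L↭M nL k = ≡-trans (sym (sumOver-↭ (λ e → σ T e k) L↭M)) (nL k)

DiffIs-↭ : ∀ {Φ n} {T₁ T₂ : Tour n} {L M} → L ↭ M → DiffIs Φ T₁ T₂ L → DiffIs Φ T₁ T₂ M
DiffIs-↭ L↭M diff e = ∈-resp-↭ L↭M ∘ proj₁ (diff e) , proj₂ (diff e) ∘ ∈-resp-↭ (↭-sym L↭M)

record Difference (Φ : Ty) {n} (s : Fin n → ℤ) (T₁ T₂ : Tour n) (ds : List (Edge n)) : Set where
  field
    vtx₁   : Vtx Φ s T₁
    vtx₂   : Vtx Φ s T₂
    unique : Unique ds
    inK    : All (InK Φ) ds
    flips  : T₂ ≈[ Φ ] (T₁ * ds ⟨flip⟩)

  neutral : Neutral T₁ ds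
  neutral = Vtx-flip-neutral Φ vtx₁ vtx₂ unique inK flips

Difference-↭ : ∀ {Φ n s} {T₁ T₂ : Tour n} {ds ds'} → ds ↭ ds' → Difference Φ s T₁ T₂ ds → Difference Φ s T₁ T₂ ds'
Difference-↭ ds↭ds' Δ = record
  { vtx₁ = vtx₁ ; vtx₂ = vtx₂ ; unique = Unique-↭ ds↭ds' unique
  ; inK = All-resp-↭ ds↭ds' inK ; flips = ≈flip-↭ ds↭ds' flips }
  where open Difference Δ

DiffIs⇒Difference : ∀ {Φ n s} {T₁ T₂ : Tour n} {ds} → Vtx Φ s T₁ → Vtx Φ s T₂ → Unique ds →
                    DiffIs Φ T₁ T₂ ds → Difference Φ s T₁ T₂ ds
DiffIs⇒Difference {T₁ = T₁} {T₂} {ds} v₁ v₂ uD diff = record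
  { vtx₁ = v₁ ; vtx₂ = v₂ ; unique = uD
  ; inK = All.tabulate (λ e∈ → proj₁ (proj₂ (diff _) e∈)) ; flips = flips }
  where
  flips : T₂ ≈[ _ ] (T₁ * ds ⟨flip⟩)
  flips e eK with mem? _≟E_ e ds
  ... | yes e∈ = ¬-not (proj₂ (proj₂ (diff e) e∈) ∘ sym)
  ... | no e∉ with T₁ e ≟B T₂ e
  ...   | yes eq  = sym eq
  ...   | no e≢   = ⊥-elim (e∉ (proj₁ (diff e) (eK , e≢)))

private
  >⇒≢ : ∀ {n} {i j : Fin n} → .(j < i) → i ≢ j
  >⇒≢ {i = i} {j} j<i i≡j = <⇒≢ (recompute (j <? i) j<i) (sym i≡j)

joins-ends : ∀ {n} {e : Edge n} {a b} → Joins e a b → ends e ≡ (a , b) ⊎ ends e ≡ (b , a)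
joins-ends {e = neg _ _ _} (inj₁ (refl , refl)) = inj₁ refl
joins-ends {e = neg _ _ _} (inj₂ (refl , refl)) = inj₂ refl
joins-ends {e = pos _ _ _} (inj₁ (refl , refl)) = inj₁ refl
joins-ends {e = pos _ _ _} (inj₂ (refl , refl)) = inj₂ refl

joins-≢ : ∀ {n} {e : Edge n} {a b} → Joins e a b → a ≢ b
joins-≢ {e = neg _ _ p} (inj₁ (refl , refl)) = >⇒≢ p
joins-≢ {e = neg _ _ p} (inj₂ (refl , refl)) = >⇒≢ p ∘ sym
joins-≢ {e = pos _ _ p} (inj₁ (refl , refl)) = >⇒≢ p
joins-≢ {e = pos _ _ p} (inj₂ (refl , refl)) = >⇒≢ p ∘ sym

joins-sym : ∀ {n} {e : Edge n} {a b} → Joins e a b → Joins e b a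
joins-sym {e = neg _ _ _} = Sum.swap
joins-sym {e = pos _ _ _} = Sum.swap

joins-unique : ∀ {n} {e : Edge n} {a b c d} → Joins e a b → Joins e c d → (a ≡ c × b ≡ d) ⊎ (a ≡ d × b ≡ c)
joins-unique j j' with joins-ends j | joins-ends j'
... | inj₁ p | inj₁ q = inj₁ (,-injective (≡-trans (sym p) q))
... | inj₁ p | inj₂ q = inj₂ (,-injective (≡-trans (sym p) q))
... | inj₂ p | inj₁ q = inj₂ (Product.swap (,-injective (≡-trans (sym p) q)))
... | inj₂ p | inj₂ q = inj₁ (Product.swap (,-injective (≡-trans (sym p) q)))

joins-edge-≢ : ∀ {n} {e e' : Edge n} {x y u v} → Joins e x y → Joins e' u v → x ≢ u → x ≢ v → e ≢ e'
joins-edge-≢ j j' x≢u x≢v refl with joins-unique j j'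
... | inj₁ (x≡u , _) = x≢u x≡u
... | inj₂ (x≡v , _) = x≢v x≡v

joins-IsNegPos : ∀ {n} {e : Edge n} {a b} → Joins e a b → IsNegPos e
joins-IsNegPos {e = neg _ _ _} _ = inj₁ isNeg
joins-IsNegPos {e = pos _ _ _} _ = inj₂ isPos

joins-InK : ∀ Φ {n} {e : Edge n} {a b} → Joins e a b → InK Φ e
joins-InK Φ = IsNegPos-InK Φ ∘ joins-IsNegPos

joins-≢half : ∀ {n} {e : Edge n} {a b} i → Joins e a b → e ≢ half i
joins-≢half {e = neg _ _ _} _ _ ()
joins-≢half {e = pos _ _ _} _ _ ()

joins-≢loop : ∀ {n} {e : Edge n} {a b} i → Joins e a b → e ≢ loop i
joins-≢loop {e = neg _ _ _} _ _ ()
joins-≢loop {e = pos _ _ _} _ _ ()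

half-injective : ∀ {n} {i j : Fin n} → half i ≡ half j → i ≡ j
half-injective refl = refl

loop-InK : ∀ {Φ n} {i : Fin n} → InK Φ (loop i) → Φ ≡ C
loop-InK {C} _ = refl

δ-self : ∀ {n} (a : Fin n) → δ a a ≡ 1ℤ
δ-self a rewrite dec-true (a ≟F a) refl = refl

δ-≢ : ∀ {n} {a k : Fin n} → a ≢ k → δ a k ≡ 0ℤ
δ-≢ {a = a} {k} a≢k rewrite dec-false (a ≟F k) a≢k = refl

record Signs {n} (T : Tour n) (e : Edge n) (a b : Fin n) : Set where
  field
    at-a at-b : Bool
    σ-≡       : ∀ k → σ T e k ≡ sgn at-a * δ a k + sgn at-b * δ b k
    neg-signs : IsNeg e → at-b ≡ not at-a
    pos-signs : IsPos e → at-b ≡ at-a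

signs : ∀ {n} {e : Edge n} {a b} → Joins e a b → (T : Tour n) → Signs T e a b
signs {e = neg i j p} (inj₁ (refl , refl)) T = record
  { at-a = T (neg i j p) ; at-b = not (T (neg i j p))
  ; σ-≡ = λ k → ≡-trans (distrib (sgn (T (neg i j p))) (δ i k) (δ j k))
                        (cong (λ z → sgn (T (neg i j p)) * δ i k + z * δ j k) (sym (sgn-not (T (neg i j p)))))
  ; neg-signs = λ _ → refl ; pos-signs = λ () }
  where
  distrib : ∀ s x y → s * (x - y) ≡ s * x + - s * y
  distrib = solve-∀
signs {e = neg i j p} (inj₂ (refl , refl)) T = record
  { at-a = not (T (neg i j p)) ; at-b = T (neg i j p)
  ; σ-≡ = λ k → ≡-trans (distrib (sgn (T (neg i j p))) (δ i k) (δ j k))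
                        (cong (λ z → z * δ j k + sgn (T (neg i j p)) * δ i k) (sym (sgn-not (T (neg i j p)))))
  ; neg-signs = λ _ → sym (not-involutive _) ; pos-signs = λ () }
  where
  distrib : ∀ s x y → s * (x - y) ≡ - s * y + s * x
  distrib = solve-∀
signs {e = pos i j p} (inj₁ (refl , refl)) T = record
  { at-a = T (pos i j p) ; at-b = T (pos i j p) ; σ-≡ = λ k → distrib (sgn (T (pos i j p))) (δ i k) (δ j k)
  ; neg-signs = λ () ; pos-signs = λ _ → refl }
  where
  distrib : ∀ s x y → s * (x + y) ≡ s * x + s * y
  distrib = solve-∀
signs {e = pos i j p} (inj₂ (refl , refl)) T = record
  { at-a = T (pos i j p) ; at-b = T (pos i j p) ; σ-≡ = λ k → distrib (sgn (T (pos i j p))) (δ i k) (δ j k)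
  ; neg-signs = λ () ; pos-signs = λ _ → refl }
  where
  distrib : ∀ s x y → s * (x + y) ≡ s * y + s * x
  distrib = solve-∀

module _ {n} {T : Tour n} {e : Edge n} {a b : Fin n} (sg : Signs T e a b) (a≢b : a ≢ b) where
  open Signs sg

  σ-at-a : σ T e a ≡ sgn at-a
  σ-at-a rewrite σ-≡ a | δ-self a | δ-≢ (a≢b ∘ sym) =
    ≡-trans (cong₂ _+_ (*-identityʳ (sgn at-a)) (*-zeroʳ (sgn at-b))) (+-identityʳ (sgn at-a))

  σ-at-b : σ T e b ≡ sgn at-b
  σ-at-b rewrite σ-≡ b | δ-self b | δ-≢ a≢b =
    ≡-trans (cong₂ _+_ (*-zeroʳ (sgn at-a)) (*-identityʳ (sgn at-b))) (+-identityˡ (sgn at-b))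

  σ-off : ∀ {k} → a ≢ k → b ≢ k → σ T e k ≡ 0ℤ
  σ-off {k} a≢k b≢k rewrite σ-≡ k | δ-≢ a≢k | δ-≢ b≢k = cong₂ _+_ (*-zeroʳ (sgn at-a)) (*-zeroʳ (sgn at-b))

negBit : ∀ {n} {e : Edge n} → IsNegPos e → Bool
negBit (inj₁ _) = true
negBit (inj₂ _) = false

Signs-kind : ∀ {n} {T : Tour n} {e a b} (sg : Signs T e a b) (k : IsNegPos e) → Signs.at-b sg ≡ negBit k xor Signs.at-a sg
Signs-kind sg (inj₁ e-neg) = Signs.neg-signs sg e-neg
Signs-kind sg (inj₂ e-pos) = Signs.pos-signs sg e-pos

σ-half-at : ∀ {n} (T : Tour n) i → σ T (half i) i ≡ sgn (T (half i))
σ-half-at T i rewrite δ-self i = *-identityʳ (sgn (T (half i)))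

σ-loop-at : ∀ {n} (T : Tour n) i → σ T (loop i) i ≡ sgn (T (loop i)) + sgn (T (loop i))
σ-loop-at T i rewrite δ-self i =
  ≡-trans (*-distribˡ-+ (sgn (T (loop i))) 1ℤ 1ℤ) (cong₂ _+_ (*-identityʳ (sgn (T (loop i)))) (*-identityʳ (sgn (T (loop i)))))

Endpoint : ∀ {n} → Edge n → Fin n → Set
Endpoint e k = proj₁ (ends e) ≡ k ⊎ proj₂ (ends e) ≡ k

endpoint? : ∀ {n} (e : Edge n) k → Dec (Endpoint e k)
endpoint? e k = (proj₁ (ends e) ≟F k) ⊎-dec (proj₂ (ends e) ≟F k)

σ-zero-off : ∀ {n} (T : Tour n) e {k} → ¬ Endpoint e k → σ T e k ≡ 0ℤ
σ-zero-off T (neg i j p) ¬ek = σ-off (signs (inj₁ (refl , refl)) T) (>⇒≢ p) (¬ek ∘ inj₁) (¬ek ∘ inj₂)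
σ-zero-off T (pos i j p) ¬ek = σ-off (signs (inj₁ (refl , refl)) T) (>⇒≢ p) (¬ek ∘ inj₁) (¬ek ∘ inj₂)
σ-zero-off T (half i) ¬ek rewrite δ-≢ (¬ek ∘ inj₁) = *-zeroʳ (sgn (T (half i)))
σ-zero-off T (loop i) ¬ek rewrite δ-≢ (¬ek ∘ inj₁) = *-zeroʳ (sgn (T (loop i)))

σ-nonzero-at : ∀ {n} (T : Tour n) e {k} → Endpoint e k → σ T e k ≢ 0ℤ
σ-nonzero-at T (neg i j p) (inj₁ refl) = sgn≢0 _ ∘ ≡-trans (sym (σ-at-a (signs (inj₁ (refl , refl)) T) (>⇒≢ p)))
σ-nonzero-at T (neg i j p) (inj₂ refl) = sgn≢0 _ ∘ ≡-trans (sym (σ-at-b (signs (inj₁ (refl , refl)) T) (>⇒≢ p)))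
σ-nonzero-at T (pos i j p) (inj₁ refl) = sgn≢0 _ ∘ ≡-trans (sym (σ-at-a (signs (inj₁ (refl , refl)) T) (>⇒≢ p)))
σ-nonzero-at T (pos i j p) (inj₂ refl) = sgn≢0 _ ∘ ≡-trans (sym (σ-at-b (signs (inj₁ (refl , refl)) T) (>⇒≢ p)))
σ-nonzero-at T (half i) (inj₁ refl) = sgn≢0 _ ∘ ≡-trans (sym (σ-half-at T i))
σ-nonzero-at T (half i) (inj₂ refl) = sgn≢0 _ ∘ ≡-trans (sym (σ-half-at T i))
σ-nonzero-at T (loop i) (inj₁ refl) = sgn+sgn≢0 (T (loop i)) ∘ ≡-trans (sym (σ-loop-at T i))
σ-nonzero-at T (loop i) (inj₂ refl) = sgn+sgn≢0 (T (loop i)) ∘ ≡-trans (sym (σ-loop-at T i))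

σ-nonzero⇒Endpoint : ∀ {n} (T : Tour n) e {k} → σ T e k ≢ 0ℤ → Endpoint e k
σ-nonzero⇒Endpoint T e {k} σ≢0 with endpoint? e k
... | yes ek = ek
... | no ¬ek = ⊥-elim (σ≢0 (σ-zero-off T e ¬ek))

σ-joins-off : ∀ {n} (T : Tour n) {e a b k} → Joins e a b → a ≢ k → b ≢ k → σ T e k ≡ 0ℤ
σ-joins-off T j a≢k b≢k = σ-off (signs j T) (joins-≢ j) a≢k b≢k

σ-joins-≢0 : ∀ {n} (T : Tour n) {e a b} → Joins e a b → σ T e a ≢ 0ℤ
σ-joins-≢0 T j = sgn≢0 _ ∘ ≡-trans (sym (σ-at-a (signs j T) (joins-≢ j)))

σ-half-off : ∀ {n} (T : Tour n) {i k} → i ≢ k → σ T (half i) k ≡ 0ℤ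
σ-half-off T i≢k = σ-zero-off T (half _) [ i≢k , i≢k ]

σ-half-≢0 : ∀ {n} (T : Tour n) i → σ T (half i) i ≢ 0ℤ
σ-half-≢0 T i = σ-nonzero-at T (half i) (inj₁ refl)

σ-support≤2 : ∀ {n} (T : Tour n) g {a b c} → σ T g a ≢ 0ℤ → σ T g b ≢ 0ℤ → σ T g c ≢ 0ℤ → ¬ Distinct3 a b c
σ-support≤2 T g σa σb σc = two-values (σ-nonzero⇒Endpoint T g σa) (σ-nonzero⇒Endpoint T g σb) (σ-nonzero⇒Endpoint T g σc)
  where
  two-values : ∀ {A : Set} {x y a b c : A} → x ≡ a ⊎ y ≡ a → x ≡ b ⊎ y ≡ b → x ≡ c ⊎ y ≡ c → ¬ (a ≢ b × b ≢ c × a ≢ c)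
  two-values (inj₁ refl) (inj₁ refl) _           (a≢b , _)       = a≢b refl
  two-values (inj₁ refl) (inj₂ refl) (inj₁ refl) (_ , _ , a≢c)   = a≢c refl
  two-values (inj₁ refl) (inj₂ refl) (inj₂ refl) (_ , b≢c , _)   = b≢c refl
  two-values (inj₂ refl) (inj₁ refl) (inj₁ refl) (_ , b≢c , _)   = b≢c refl
  two-values (inj₂ refl) (inj₁ refl) (inj₂ refl) (_ , _ , a≢c)   = a≢c refl
  two-values (inj₂ refl) (inj₂ refl) _           (a≢b , _)       = a≢b refl

Endpoint-transfer : ∀ {n} (T T' : Tour n) {e e'} → (∀ k → σ T e k ≡ σ T' e' k) → ∀ {k} → Endpoint e k → Endpoint e' k
Endpoint-transfer T T' {e} {e'} eq {k} ek = σ-nonzero⇒Endpoint T' e' (σ-nonzero-at T e ek ∘ ≡-trans (eq k))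

σ-injective : ∀ {n} (T T' : Tour n) {e e'} → (∀ k → σ T e k ≡ σ T' e' k) → e ≡ e'
σ-injective {n} T T' {e} {e'} eq = go e e' eq (Endpoint-transfer T T' eq) (Endpoint-transfer T' T (sym ∘ eq))
  where
  same-ends : ∀ {i j i' j' : Fin n} → .(j < i) → .(j' < i') → i' ≡ i ⊎ j' ≡ i → i' ≡ j ⊎ j' ≡ j → i' ≡ i × j' ≡ j
  same-ends p p' (inj₁ refl) (inj₂ refl) = refl , refl
  same-ends p p' (inj₁ refl) (inj₁ refl) = ⊥-elim (>⇒≢ p refl)
  same-ends p p' (inj₂ refl) (inj₂ refl) = ⊥-elim (>⇒≢ p refl)
  same-ends {i} {j} p p' (inj₂ refl) (inj₁ refl) = ⊥-elim (<-asym (recompute (j <? i) p) (recompute (i <? j) p'))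

  collapse : ∀ {i j x : Fin n} → .(j < i) → x ≡ i ⊎ x ≡ i → x ≡ j ⊎ x ≡ j → ⊥
  collapse p x≡i x≡j = >⇒≢ p (≡-trans (sym (Sum.reduce x≡i)) (Sum.reduce x≡j))

  neg≢pos : ∀ {t t'} → sgn t ≡ sgn t' → sgn (not t) ≡ sgn t' → ⊥
  neg≢pos {true}  {true}  _ ()
  neg≢pos {true}  {false} ()
  neg≢pos {false} {true}  ()
  neg≢pos {false} {false} _ ()

  half≢loop : ∀ t t' → sgn t ≢ sgn t' + sgn t'
  half≢loop true  true  ()
  half≢loop true  false ()
  half≢loop false true  ()
  half≢loop false false ()

  go : ∀ e e' → (∀ k → σ T e k ≡ σ T' e' k) →
       (∀ {k} → Endpoint e k → Endpoint e' k) → (∀ {k} → Endpoint e' k → Endpoint e k) → e ≡ e'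
  go (neg i j p) (neg i' j' p') _ f _ with same-ends p p' (f (inj₁ refl)) (f (inj₂ refl))
  ... | refl , refl = refl
  go (neg i j p) (pos i' j' p') eq f _ with same-ends p p' (f (inj₁ refl)) (f (inj₂ refl))
  ... | refl , refl = ⊥-elim (neg≢pos
    (≡-trans (sym (σ-at-a (signs (inj₁ (refl , refl)) T) (>⇒≢ p))) (≡-trans (eq i) (σ-at-a (signs (inj₁ (refl , refl)) T') (>⇒≢ p))))
    (≡-trans (sym (σ-at-b (signs (inj₁ (refl , refl)) T) (>⇒≢ p))) (≡-trans (eq j) (σ-at-b (signs (inj₁ (refl , refl)) T') (>⇒≢ p)))))
  go (pos i j p) (neg i' j' p') eq f _ with same-ends p p' (f (inj₁ refl)) (f (inj₂ refl))
  ... | refl , refl = ⊥-elim (neg≢pos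
    (≡-trans (sym (σ-at-a (signs (inj₁ (refl , refl)) T') (>⇒≢ p))) (≡-trans (sym (eq i)) (σ-at-a (signs (inj₁ (refl , refl)) T) (>⇒≢ p))))
    (≡-trans (sym (σ-at-b (signs (inj₁ (refl , refl)) T') (>⇒≢ p))) (≡-trans (sym (eq j)) (σ-at-b (signs (inj₁ (refl , refl)) T) (>⇒≢ p)))))
  go (pos i j p) (pos i' j' p') _ f _ with same-ends p p' (f (inj₁ refl)) (f (inj₂ refl))
  ... | refl , refl = refl
  go (neg i j p) (half _) _ f _ = ⊥-elim (collapse p (f (inj₁ refl)) (f (inj₂ refl)))
  go (neg i j p) (loop _) _ f _ = ⊥-elim (collapse p (f (inj₁ refl)) (f (inj₂ refl)))
  go (pos i j p) (half _) _ f _ = ⊥-elim (collapse p (f (inj₁ refl)) (f (inj₂ refl)))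
  go (pos i j p) (loop _) _ f _ = ⊥-elim (collapse p (f (inj₁ refl)) (f (inj₂ refl)))
  go (half _) (neg i j p) _ _ g = ⊥-elim (collapse p (g (inj₁ refl)) (g (inj₂ refl)))
  go (loop _) (neg i j p) _ _ g = ⊥-elim (collapse p (g (inj₁ refl)) (g (inj₂ refl)))
  go (half _) (pos i j p) _ _ g = ⊥-elim (collapse p (g (inj₁ refl)) (g (inj₂ refl)))
  go (loop _) (pos i j p) _ _ g = ⊥-elim (collapse p (g (inj₁ refl)) (g (inj₂ refl)))
  go (half i) (half _) _ f _ with Sum.reduce (f (inj₁ refl))
  ... | refl = refl
  go (loop i) (loop _) _ f _ with Sum.reduce (f (inj₁ refl))
  ... | refl = refl
  go (half i) (loop _) eq f _ with Sum.reduce (f (inj₁ refl))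
  ... | refl = ⊥-elim (half≢loop _ (T' (loop i)) (≡-trans (sym (σ-half-at T i)) (≡-trans (eq i) (σ-loop-at T' i))))
  go (loop i) (half _) eq f _ with Sum.reduce (f (inj₁ refl))
  ... | refl = ⊥-elim (half≢loop _ (T (loop i)) (≡-trans (sym (σ-half-at T' i)) (≡-trans (sym (eq i)) (σ-loop-at T i))))

σ-anti : ∀ {n} (T : Tour n) {e e'} → (∀ k → σ T e k ≡ - σ T e' k) → ⊥
σ-anti T {e} {e'} eq with σ-injective T (not ∘ T) (λ k → ≡-trans (eq k) (sym (sgn-not-* (T e') (vec e' k))))
... | refl = σ-nonzero-at T e (inj₁ refl) (x≡-x⇒x≡0 _ (eq (proj₁ (ends e))))

private
  oriented : ∀ {n} {i j i' j' x y : Fin n} → .(j < i) → .(j' < i') → (i , j) ≡ (x , y) ⊎ (i , j) ≡ (y , x) →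
             (i' , j') ≡ (x , y) ⊎ (i' , j') ≡ (y , x) → i ≡ i' × j ≡ j'
  oriented _ _ (inj₁ refl) (inj₁ refl) = refl , refl
  oriented _ _ (inj₂ refl) (inj₂ refl) = refl , refl
  oriented {i = i} {j} p p' (inj₁ refl) (inj₂ refl) = ⊥-elim (<-asym (recompute (j <? i) p) (recompute (i <? j) p'))
  oriented {i = i} {j} p p' (inj₂ refl) (inj₁ refl) = ⊥-elim (<-asym (recompute (j <? i) p) (recompute (i <? j) p'))

parallel-kinds : ∀ {n} {e e' : Edge n} {x y} → Joins e x y → Joins e' x y → e ≢ e' →
                 (IsNeg e × IsPos e') ⊎ (IsPos e × IsNeg e')
parallel-kinds {e = neg i j p} {neg i' j' p'} je je' e≢e'
  with oriented p p' (joins-ends {e = neg i j p} je) (joins-ends {e = neg i' j' p'} je')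
... | refl , refl = ⊥-elim (e≢e' refl)
parallel-kinds {e = neg _ _ _} {pos _ _ _} _ _ _ = inj₁ (isNeg , isPos)
parallel-kinds {e = pos _ _ _} {neg _ _ _} _ _ _ = inj₂ (isPos , isNeg)
parallel-kinds {e = pos i j p} {pos i' j' p'} je je' e≢e'
  with oriented p p' (joins-ends {e = pos i j p} je) (joins-ends {e = pos i' j' p'} je')
... | refl , refl = ⊥-elim (e≢e' refl)

parallel-at-a : ∀ {n} {T : Tour n} {e e' x y} → Joins e x y → Joins e' x y → e ≢ e' →
                (s : Signs T e x y) (s' : Signs T e' x y) → Signs.at-b s' ≡ not (Signs.at-b s) → Signs.at-a s' ≡ Signs.at-a s
parallel-at-a je je' e≢e' s s' opp with parallel-kinds je je' e≢e'
... | inj₁ (e-neg , e'-pos) = begin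
  at-a s'            ≡⟨ sym (pos-signs s' e'-pos) ⟩
  at-b s'            ≡⟨ opp ⟩
  not (at-b s)       ≡⟨ cong not (neg-signs s e-neg) ⟩
  not (not (at-a s)) ≡⟨ not-involutive _ ⟩
  at-a s             ∎
  where open Signs
... | inj₂ (e-pos , e'-neg) = not-injective (begin
  not (at-a s')      ≡⟨ sym (neg-signs s' e'-neg) ⟩
  at-b s'            ≡⟨ opp ⟩
  not (at-b s)       ≡⟨ cong not (pos-signs s e-pos) ⟩
  not (at-a s)       ∎)
  where open Signs

_≗±_ : ∀ {n} → (Fin n → ℤ) → (Fin n → ℤ) → Set
f ≗± g = (∀ k → f k ≡ g k) ⊎ (∀ k → f k ≡ - g k)

≗±-respʳ : ∀ {n} {f g h : Fin n → ℤ} → f ≗± g → (∀ k → g k ≡ h k) → f ≗± h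
≗±-respʳ (inj₁ f≗g)  g≗h = inj₁ λ k → ≡-trans (f≗g k) (g≗h k)
≗±-respʳ (inj₂ f≗-g) g≗h = inj₂ λ k → ≡-trans (f≗-g k) (cong -_ (g≗h k))

≗±-neg : ∀ {n} {f g h : Fin n → ℤ} → f ≗± g → (∀ k → g k ≡ - h k) → f ≗± h
≗±-neg (inj₁ f≗g)  g≗-h = inj₂ λ k → ≡-trans (f≗g k) (g≗-h k)
≗±-neg (inj₂ f≗-g) g≗-h = inj₁ λ k → ≡-trans (f≗-g k) (≡-trans (cong -_ (g≗-h k)) (neg-involutive _))

σ-≗± : ∀ {n} (T : Tour n) g {V : Fin n → ℤ} → vec g ≗± V → σ T g ≗± V
σ-≗± T g vg with T g | vg
... | true  | inj₁ eq = inj₁ λ k → ≡-trans (*-identityˡ (vec g k)) (eq k)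
... | true  | inj₂ eq = inj₂ λ k → ≡-trans (*-identityˡ (vec g k)) (eq k)
... | false | inj₁ eq = inj₂ λ k → ≡-trans (-1*i≡-i (vec g k)) (cong -_ (eq k))
... | false | inj₂ eq = inj₁ λ k → ≡-trans (-1*i≡-i (vec g k)) (≡-trans (cong -_ (eq k)) (neg-involutive _))

edge-with-signs : ∀ {n} {u v : Fin n} → u ≢ v → (α β : Bool) →
                  Σ (Edge n) λ g → Joins g u v × vec g ≗± (λ k → sgn α * δ u k + sgn β * δ v k)
edge-with-signs {u = u} {v} u≢v α β with <-cmp u v
... | tri≈ _ u≡v _ = ⊥-elim (u≢v u≡v)
... | tri> _ _ v<u = above α β
  where
  above : ∀ α β → Σ _ λ g → Joins g u v × vec g ≗± (λ k → sgn α * δ u k + sgn β * δ v k)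
  above true  true  = pos u v v<u , inj₁ (refl , refl) , inj₁ λ k → id₁ (δ u k) (δ v k)
    where id₁ : ∀ x y → x + y ≡ 1ℤ * x + 1ℤ * y
          id₁ = solve-∀
  above false false = pos u v v<u , inj₁ (refl , refl) , inj₂ λ k → id₂ (δ u k) (δ v k)
    where id₂ : ∀ x y → x + y ≡ - (-1ℤ * x + -1ℤ * y)
          id₂ = solve-∀
  above true  false = neg u v v<u , inj₁ (refl , refl) , inj₁ λ k → id₃ (δ u k) (δ v k)
    where id₃ : ∀ x y → x - y ≡ 1ℤ * x + -1ℤ * y
          id₃ = solve-∀
  above false true  = neg u v v<u , inj₁ (refl , refl) , inj₂ λ k → id₄ (δ u k) (δ v k)
    where id₄ : ∀ x y → x - y ≡ - (-1ℤ * x + 1ℤ * y)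
          id₄ = solve-∀
... | tri< u<v _ _ = below α β
  where
  below : ∀ α β → Σ _ λ g → Joins g u v × vec g ≗± (λ k → sgn α * δ u k + sgn β * δ v k)
  below true  true  = pos v u u<v , inj₂ (refl , refl) , inj₁ λ k → id₁ (δ u k) (δ v k)
    where id₁ : ∀ x y → y + x ≡ 1ℤ * x + 1ℤ * y
          id₁ = solve-∀
  below false false = pos v u u<v , inj₂ (refl , refl) , inj₂ λ k → id₂ (δ u k) (δ v k)
    where id₂ : ∀ x y → y + x ≡ - (-1ℤ * x + -1ℤ * y)
          id₂ = solve-∀
  below true  false = neg v u u<v , inj₂ (refl , refl) , inj₂ λ k → id₃ (δ u k) (δ v k)
    where id₃ : ∀ x y → y - x ≡ - (1ℤ * x + -1ℤ * y)
          id₃ = solve-∀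
  below false true  = neg v u u<v , inj₂ (refl , refl) , inj₁ λ k → id₄ (δ u k) (δ v k)
    where id₄ : ∀ x y → y - x ≡ -1ℤ * x + 1ℤ * y
          id₄ = solve-∀

genShape-unique : ∀ {n Φ c} {G : List (Edge n)} → GenShape Φ G c → Unique G
genShape-unique (triangle (a≢b , b≢c , a≢c) j₁ j₂ j₃ _) =
  (joins-edge-≢ j₁ j₂ a≢b a≢c ∷ joins-edge-≢ (joins-sym j₁) j₃ (a≢b ∘ sym) b≢c ∷ []) ∷
  (joins-edge-≢ j₂ j₃ (a≢b ∘ sym) b≢c ∷ []) ∷ [] ∷ []
genShape-unique (pair _ j) =
  (joins-≢half _ j ∷ joins-≢half _ j ∷ []) ∷ ((λ { refl → joins-≢ j refl }) ∷ []) ∷ [] ∷ []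
genShape-unique (clover _ j₁ j₂ isNeg isPos) =
  ((λ ()) ∷ joins-≢loop _ j₁ ∷ []) ∷ (joins-≢loop _ j₂ ∷ []) ∷ [] ∷ []

genShape-InK : ∀ {n Φ c} {G : List (Edge n)} → GenShape Φ G c → All (InK Φ) G
genShape-InK {Φ = Φ} (triangle _ j₁ j₂ j₃ _) = joins-InK Φ j₁ ∷ joins-InK Φ j₂ ∷ joins-InK Φ j₃ ∷ []
genShape-InK (pair refl j) = joins-InK B j ∷ tt ∷ tt ∷ []
genShape-InK (clover refl j₁ j₂ _ _) = joins-InK C j₁ ∷ joins-InK C j₂ ∷ tt ∷ []

genShape-loop∉ : ∀ {n Φ} {G : List (Edge n)} → GenShape Φ G false → ∀ i → loop i ∉ G
genShape-loop∉ (triangle _ j₁ j₂ j₃ _) i = All¬⇒¬Any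
  ((joins-≢loop i j₁ ∘ sym) ∷ (joins-≢loop i j₂ ∘ sym) ∷ (joins-≢loop i j₃ ∘ sym) ∷ [])
genShape-loop∉ (pair _ j) i = All¬⇒¬Any ((joins-≢loop i j ∘ sym) ∷ (λ ()) ∷ (λ ()) ∷ [])

genShape-loop∈ : ∀ {n Φ} {G : List (Edge n)} → GenShape Φ G true → Φ ≡ C × ∃ λ i → loop i ∈ G
genShape-loop∈ (clover refl _ _ _ _) = refl , _ , there (there (here refl))

flipped-⊆ : ∀ {Φ n} {T T' : Tour n} {A A' e} → T' ≈[ Φ ] (T * A ⟨flip⟩) → T' ≈[ Φ ] (T * A' ⟨flip⟩) →
            InK Φ e → e ∈ A → e ∈ A'
flipped-⊆ {T = T} {A' = A'} {e} T'≈A T'≈A' eK e∈A with mem? _≟E_ e A'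
... | yes e∈A' = e∈A'
... | no e∉A' = ⊥-elim (not-¬ refl (≡-trans (sym (≡-trans (T'≈A' e eK) (flip-∉ T e∉A')))
                                             (≡-trans (T'≈A e eK) (flip-∈ T e∈A))))

Link : ∀ {n} → Ty → Bool → (Fin n → ℤ) → Tour n → Tour n → Set
Link Φ false = SingleE Φ
Link Φ true  = DoubleE Φ

-- A clover flips a loop and the other generators flip none, so T' determines the kind of edge to T.
generator-Link : ∀ {Φ n c s} {T T' : Tour n} {G} → GenShape Φ G c → Neutral T G → T' ≈[ Φ ] (T * G ⟨flip⟩) →
                 Vtx Φ s T → Vtx Φ s T' → Link Φ c s T T'
generator-Link {c = false} sh nG T'≈ vT vT' = vT , vT' , (_ , (sh , nG) , T'≈) , no-clover
  where
  no-clover : ¬ Joined _ true _ _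
  no-clover (_ , (sh' , _) , T'≈') with genShape-loop∈ sh'
  ... | refl , i , loop∈ = genShape-loop∉ sh i (flipped-⊆ T'≈' T'≈ tt loop∈)
generator-Link {c = true} sh nG T'≈ vT vT' with genShape-loop∈ sh
... | refl , i , loop∈ = vT , vT' , (_ , (sh , nG) , T'≈) , no-triangle
  where
  no-triangle : ¬ Joined C false _ _
  no-triangle (_ , (sh' , _) , T'≈') = genShape-loop∉ sh' i (flipped-⊆ T'≈ T'≈' tt loop∈)

pair-cancels : ∀ {n} (T : Tour n) v {ds} p q {rest} → Neutral T ds → ds ↭ p ∷ q ∷ rest →
               All (λ r → σ T r v ≡ 0ℤ) rest → σ T p v + σ T q v ≡ 0ℤ
pair-cancels T v p q nD ds↭ rest≡0 = ≡-trans (sym (sumOver-two (λ e → σ T e v) ds↭ rest≡0)) (nD v)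

opposite-at : ∀ {n} (T : Tour n) v {ds} p q {rest x y} → Neutral T ds → ds ↭ p ∷ q ∷ rest →
              All (λ r → σ T r v ≡ 0ℤ) rest → σ T p v ≡ sgn x → σ T q v ≡ sgn y → y ≡ not x
opposite-at T v p q nD ds↭ rest≡0 σp σq = sgn+sgn≡0 (≡-trans (sym (cong₂ _+_ σp σq)) (pair-cancels T v p q nD ds↭ rest≡0))

-- Going once around a neutral triangle each vertex reverses the sign and each negative edge reverses it
-- again, so the number of negative edges is odd.
triangle-kinds : ∀ {n} {T : Tour n} {a b c} {e₁ e₂ e₃ : Edge n} → Distinct3 a b c →
                 Joins e₁ a b → Joins e₂ b c → Joins e₃ a c → Neutral T (e₁ ∷ e₂ ∷ e₃ ∷ []) → TriKinds e₁ e₂ e₃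
triangle-kinds {T = T} {a} {b} {c} {e₁} {e₂} {e₃} (a≢b , b≢c , a≢c) j₁ j₂ j₃ nT =
  odd⇒TriKinds k₁ k₂ k₃ (parity (negBit k₁) (negBit k₂) (negBit k₃) (at-a s₁) around)
  where
  open Signs
  s₁ = signs j₁ T
  s₂ = signs j₂ T
  s₃ = signs j₃ T
  k₁ = joins-IsNegPos j₁
  k₂ = joins-IsNegPos j₂
  k₃ = joins-IsNegPos j₃
  at-a' : at-a s₃ ≡ not (at-a s₁)
  at-a' = opposite-at T a e₁ e₃ nT (prep e₁ (swap e₂ e₃ refl)) (σ-joins-off T j₂ (a≢b ∘ sym) (a≢c ∘ sym) ∷ [])
                      (σ-at-a s₁ a≢b) (σ-at-a s₃ a≢c)
  at-b' : at-a s₂ ≡ not (at-b s₁)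
  at-b' = opposite-at T b e₁ e₂ nT refl (σ-joins-off T j₃ a≢b (b≢c ∘ sym) ∷ []) (σ-at-b s₁ a≢b) (σ-at-a s₂ b≢c)
  at-c' : at-b s₃ ≡ not (at-b s₂)
  at-c' = opposite-at T c e₂ e₃ nT (trans (swap e₁ e₂ refl) (prep e₂ (swap e₁ e₃ refl))) (σ-joins-off T j₁ a≢c b≢c ∷ [])
                      (σ-at-b s₂ b≢c) (σ-at-b s₃ a≢c)
  around : negBit k₃ xor not (at-a s₁) ≡ not (negBit k₂ xor not (negBit k₁ xor at-a s₁))
  around = begin
    negBit k₃ xor not (at-a s₁)                    ≡⟨ cong (negBit k₃ xor_) (sym at-a') ⟩
    negBit k₃ xor at-a s₃                          ≡⟨ sym (Signs-kind s₃ k₃) ⟩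
    at-b s₃                                        ≡⟨ at-c' ⟩
    not (at-b s₂)                                  ≡⟨ cong not (Signs-kind s₂ k₂) ⟩
    not (negBit k₂ xor at-a s₂)                    ≡⟨ cong (λ z → not (negBit k₂ xor z)) at-b' ⟩
    not (negBit k₂ xor not (at-b s₁))              ≡⟨ cong (λ z → not (negBit k₂ xor not z)) (Signs-kind s₁ k₁) ⟩
    not (negBit k₂ xor not (negBit k₁ xor at-a s₁)) ∎
  parity : ∀ k₁ k₂ k₃ x → k₃ xor not x ≡ not (k₂ xor not (k₁ xor x)) → k₁ xor (k₂ xor k₃) ≡ true
  parity true  true  true  _ _ = refl
  parity true  false false _ _ = refl
  parity false true  false _ _ = refl
  parity false false true  _ _ = refl
  parity true  true  false true  ()
  parity true  true  false false ()
  parity true  false true  true  ()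
  parity true  false true  false ()
  parity false true  true  true  ()
  parity false true  true  false ()
  parity false false false true  ()
  parity false false false false ()
  odd⇒TriKinds : (k₁ : IsNegPos e₁) (k₂ : IsNegPos e₂) (k₃ : IsNegPos e₃) →
                 negBit k₁ xor (negBit k₂ xor negBit k₃) ≡ true → TriKinds e₁ e₂ e₃
  odd⇒TriKinds (inj₁ n₁) (inj₁ n₂) (inj₁ n₃) _ = inj₁ (n₁ , n₂ , n₃)
  odd⇒TriKinds (inj₁ n₁) (inj₂ p₂) (inj₂ p₃) _ = inj₂ (inj₁ (n₁ , p₂ , p₃))
  odd⇒TriKinds (inj₂ p₁) (inj₁ n₂) (inj₂ p₃) _ = inj₂ (inj₂ (inj₁ (p₁ , n₂ , p₃)))
  odd⇒TriKinds (inj₂ p₁) (inj₂ p₂) (inj₁ n₃) _ = inj₂ (inj₂ (inj₂ (p₁ , p₂ , n₃)))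
  odd⇒TriKinds (inj₁ _) (inj₁ _) (inj₂ _) ()
  odd⇒TriKinds (inj₁ _) (inj₂ _) (inj₁ _) ()
  odd⇒TriKinds (inj₂ _) (inj₁ _) (inj₁ _) ()
  odd⇒TriKinds (inj₂ _) (inj₂ _) (inj₂ _) ()

neutral-triple : ∀ {n} (T : Tour n) {a b g} → (∀ k → σ T g k ≡ - (σ T a k + σ T b k)) → Neutral T (a ∷ b ∷ g ∷ [])
neutral-triple T {a} {b} σg k = ≡-trans (cong (λ z → σ T a k + (σ T b k + (z + 0ℤ))) (σg k)) (cancel (σ T a k) (σ T b k))
  where
  cancel : ∀ x y → x + (y + (- (x + y) + 0ℤ)) ≡ 0ℤ
  cancel = solve-∀

neutral-triple⁻ : ∀ {n} (T : Tour n) {a b g} → Neutral T (a ∷ b ∷ g ∷ []) → ∀ k → σ T g k ≡ - (σ T a k + σ T b k)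
neutral-triple⁻ T {a} {b} {g} nT k = begin
  σ T g k                                                           ≡⟨ sym (isolate (σ T a k) (σ T b k) (σ T g k)) ⟩
  σ T a k + (σ T b k + (σ T g k + 0ℤ)) - (σ T a k + σ T b k)       ≡⟨ cong (_- (σ T a k + σ T b k)) (nT k) ⟩
  0ℤ - (σ T a k + σ T b k)                                          ≡⟨ +-identityˡ _ ⟩
  - (σ T a k + σ T b k)                                             ∎
  where
  isolate : ∀ x y z → x + (y + (z + 0ℤ)) - (x + y) ≡ z
  isolate = solve-∀

-- The witness is T itself or T with g flipped, according to the sign.
≗±⇒neutral : ∀ {n} (T : Tour n) {a b g} → g ∉ a ∷ b ∷ [] → σ T g ≗± (λ k → σ T a k + σ T b k) →
             Σ (Tour n) λ T' → Neutral T' (a ∷ b ∷ g ∷ [])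
≗±⇒neutral T {a} {b} {g} g∉ (inj₂ σg) = T , neutral-triple T {a} {b} {g} σg
≗±⇒neutral T {a} {b} {g} g∉ (inj₁ σg) = T * (g ∷ []) ⟨flip⟩ , neutral-triple (T * (g ∷ []) ⟨flip⟩) {a} {b} {g} λ k → begin
  σ (T * (g ∷ []) ⟨flip⟩) g k ≡⟨ σ-flip-∈ T {g ∷ []} (here refl) k ⟩
  - σ T g k                   ≡⟨ cong -_ (σg k) ⟩
  - (σ T a k + σ T b k)       ≡⟨ sym (cong₂ (λ x y → - (x + y)) (σ-flip-∉ T {g ∷ []} a∉ k) (σ-flip-∉ T {g ∷ []} b∉ k)) ⟩
  - (σ (T * (g ∷ []) ⟨flip⟩) a k + σ (T * (g ∷ []) ⟨flip⟩) b k) ∎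
  where
  a∉ : a ∉ g ∷ []
  a∉ (here a≡g) = g∉ (here (sym a≡g))
  b∉ : b ∉ g ∷ []
  b∉ (here b≡g) = g∉ (there (here (sym b≡g)))

triangle-generator : ∀ {Φ n} (T : Tour n) {a b c e₁ e₂ g} → Distinct3 a b c → Joins e₁ a b → Joins e₂ b c → Joins g a c →
                     σ T g ≗± (λ k → σ T e₁ k + σ T e₂ k) → GenShape Φ (e₁ ∷ e₂ ∷ g ∷ []) false
triangle-generator T {e₁ = e₁} {e₂} {g} d@(a≢b , b≢c , a≢c) j₁ j₂ j₃ σg =
  triangle d j₁ j₂ j₃ (triangle-kinds {T = proj₁ neutral} d j₁ j₂ j₃ (proj₂ neutral))
  where
  neutral = ≗±⇒neutral T {e₁} {e₂} {g}
    (All¬⇒¬Any (joins-edge-≢ (joins-sym j₃) j₁ (a≢c ∘ sym) (b≢c ∘ sym) ∷ joins-edge-≢ j₃ j₂ a≢b a≢c ∷ [])) σg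

clover-shape : ∀ {Φ n} {e e' : Edge n} {x y} → Φ ≡ C → Joins e x y → Joins e' x y → e ≢ e' →
               Σ (List (Edge n)) λ L → GenShape Φ L true × L ↭ e ∷ e' ∷ loop x ∷ []
clover-shape Φ≡C je je' e≢e' with parallel-kinds je je' e≢e'
... | inj₁ (e-neg , e'-pos) = _ , clover Φ≡C je je' e-neg e'-pos , refl
... | inj₂ (e-pos , e'-neg) = _ , clover Φ≡C je' je e'-neg e-pos , swap _ _ refl

record ClosingEdge {n} (T : Tour n) (u w : Fin n) (V : Fin n → ℤ) : Set where
  field
    edge     : Edge n
    joins    : Joins edge u w
    parallel : σ T edge ≗± V

-- p and q cancel at their common vertex v, leaving a vector supported on u and w.
closing-edge : ∀ {n} (T : Tour n) {u v w p q} → Distinct3 u v w → Joins p u v → Joins q v w →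
               σ T p v + σ T q v ≡ 0ℤ → ClosingEdge T u w (λ k → σ T p k + σ T q k)
closing-edge T {u} {v} {w} {p} {q} (u≢v , v≢w , u≢w) jp jq cancel = record
  { edge = proj₁ g ; joins = proj₁ (proj₂ g) ; parallel = ≗±-respʳ (σ-≗± T (proj₁ g) (proj₂ (proj₂ g))) (λ k → sym (sum≡ k)) }
  where
  open Signs
  sp = signs jp T
  sq = signs jq T
  g = edge-with-signs u≢w (at-a sp) (at-b sq)
  at-v : at-a sq ≡ not (at-b sp)
  at-v = sgn+sgn≡0 (≡-trans (cong₂ _+_ (sym (σ-at-b sp u≢v)) (sym (σ-at-a sq v≢w))) cancel)
  collapse : ∀ a b c x y z → a * x + b * y + (- b * y + c * z) ≡ a * x + c * z
  collapse = solve-∀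
  sum≡ : ∀ k → σ T p k + σ T q k ≡ sgn (at-a sp) * δ u k + sgn (at-b sq) * δ w k
  sum≡ k = begin
    σ T p k + σ T q k
      ≡⟨ cong₂ _+_ (σ-≡ sp k) (σ-≡ sq k) ⟩
    sgn (at-a sp) * δ u k + sgn (at-b sp) * δ v k + (sgn (at-a sq) * δ v k + sgn (at-b sq) * δ w k)
      ≡⟨ cong (λ z → sgn (at-a sp) * δ u k + sgn (at-b sp) * δ v k + (z * δ v k + sgn (at-b sq) * δ w k))
              (≡-trans (cong sgn at-v) (sgn-not (at-b sp))) ⟩
    sgn (at-a sp) * δ u k + sgn (at-b sp) * δ v k + (- sgn (at-b sp) * δ v k + sgn (at-b sq) * δ w k)
      ≡⟨ collapse (sgn (at-a sp)) (sgn (at-b sp)) (sgn (at-b sq)) (δ u k) (δ v k) (δ w k) ⟩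
    sgn (at-a sp) * δ u k + sgn (at-b sq) * δ w k ∎

loop-closing-edge : ∀ {n} (T : Tour n) {x y e} (j : Joins e x y) → Signs.at-a (signs j T) ≡ not (T (loop x)) →
                    ClosingEdge T x y (λ k → σ T e k + σ T (loop x) k)
loop-closing-edge T {x} {y} {e} j a≡¬L = record
  { edge = proj₁ g ; joins = proj₁ (proj₂ g) ; parallel = ≗±-respʳ (σ-≗± T (proj₁ g) (proj₂ (proj₂ g))) (λ k → sym (sum≡ k)) }
  where
  open Signs (signs j T)
  L = T (loop x)
  g = edge-with-signs (joins-≢ j) L at-b
  collapse : ∀ l b u v → - l * u + b * v + l * (u + u) ≡ l * u + b * v
  collapse = solve-∀
  sum≡ : ∀ k → σ T e k + σ T (loop x) k ≡ sgn L * δ x k + sgn at-b * δ y k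
  sum≡ k = begin
    σ T e k + σ T (loop x) k
      ≡⟨ cong (_+ σ T (loop x) k) (σ-≡ k) ⟩
    sgn at-a * δ x k + sgn at-b * δ y k + sgn L * (δ x k + δ x k)
      ≡⟨ cong (λ z → z * δ x k + sgn at-b * δ y k + sgn L * (δ x k + δ x k)) (≡-trans (cong sgn a≡¬L) (sgn-not L)) ⟩
    - sgn L * δ x k + sgn at-b * δ y k + sgn L * (δ x k + δ x k)
      ≡⟨ collapse (sgn L) (sgn at-b) (δ x k) (δ y k) ⟩
    sgn L * δ x k + sgn at-b * δ y k ∎

-- The half edge at x cancels e there, leaving a vector supported on y.
half-closing : ∀ {n} (T : Tour n) {e x y} → Joins e x y → σ T e x + σ T (half x) x ≡ 0ℤ →
               σ T (half y) ≗± (λ k → σ T e k + σ T (half x) k)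
half-closing T {e} {x} {y} j cancel = ≗±-respʳ (σ-≗± T (half y) (unit at-b)) (λ k → sym (sum≡ k))
  where
  open Signs (signs j T)
  H = T (half x)
  H≡¬a : H ≡ not at-a
  H≡¬a = sgn+sgn≡0 (≡-trans (cong₂ _+_ (sym (σ-at-a (signs j T) (joins-≢ j))) (sym (σ-half-at T x))) cancel)
  unit : ∀ b → vec (half y) ≗± (λ k → sgn b * δ y k)
  unit true  = inj₁ λ k → sym (*-identityˡ _)
  unit false = inj₂ λ k → sym (≡-trans (cong -_ (-1*i≡-i _)) (neg-involutive _))
  collapse : ∀ a b u v → a * u + b * v + - a * u ≡ b * v
  collapse = solve-∀
  sum≡ : ∀ k → σ T e k + σ T (half x) k ≡ sgn at-b * δ y k
  sum≡ k = begin
    σ T e k + σ T (half x) k                              ≡⟨ cong₂ _+_ (σ-≡ k) (cong (_* δ x k) (≡-trans (cong sgn H≡¬a) (sgn-not at-a))) ⟩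
    sgn at-a * δ x k + sgn at-b * δ y k + - sgn at-a * δ x k ≡⟨ collapse (sgn at-a) (sgn at-b) (δ x k) (δ y k) ⟩
    sgn at-b * δ y k                                      ∎

-- g cannot be e: the sum differs from ±σ e where l is seen (u) or where e is seen but l is not (v).
≗±-sum-≢ : ∀ {n} (T : Tour n) {e l g u v} → σ T g ≗± (λ k → σ T e k + σ T l k) →
           σ T l u ≢ 0ℤ → σ T e v ≢ 0ℤ → σ T l v ≡ 0ℤ → g ≢ e
≗±-sum-≢ T {e} {l} {u = u} (inj₁ eq) σlu≢0 _ _ refl = σlu≢0 (a+b≡a⇒b≡0 (σ T e u) (σ T l u) (sym (eq u)))
≗±-sum-≢ T {e} {l} {v = v} (inj₂ eq) _ σev≢0 σlv≡0 refl =
  σev≢0 (x≡-x⇒x≡0 (σ T e v) (≡-trans (eq v) (cong -_ (≡-trans (cong (σ T e v +_) σlv≡0) (+-identityʳ _)))))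

record SymDiff (Φ : Ty) {n} (ds G₁ G₂ : List (Edge n)) : Set where
  constructor symDiff
  field ∈ᵇ-xor : ∀ {e} → InK Φ e → e ∈ᵇ ds ≡ e ∈ᵇ G₁ xor e ∈ᵇ G₂

flips-SymDiff : ∀ {Φ n} {T₁ Z T₂ : Tour n} {ds G₁ G₂} → T₂ ≈[ Φ ] (T₁ * ds ⟨flip⟩) →
                Z ≈[ Φ ] (T₁ * G₁ ⟨flip⟩) → T₂ ≈[ Φ ] (Z * G₂ ⟨flip⟩) → SymDiff Φ ds G₁ G₂
flips-SymDiff {T₁ = T₁} {Z} {T₂} {ds} {G₁} {G₂} T₂≈ Z≈ T₂≈' = symDiff λ {e} eK → xor-cancelˡ (T₁ e) (begin
  T₁ e xor e ∈ᵇ ds              ≡⟨ sym (flip-xor T₁ ds e) ⟩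
  (T₁ * ds ⟨flip⟩) e            ≡⟨ sym (T₂≈ e eK) ⟩
  T₂ e                          ≡⟨ T₂≈' e eK ⟩
  (Z * G₂ ⟨flip⟩) e              ≡⟨ flip-xor Z G₂ e ⟩
  Z e xor e ∈ᵇ G₂                ≡⟨ cong (_xor e ∈ᵇ G₂) (≡-trans (Z≈ e eK) (flip-xor T₁ G₁ e)) ⟩
  (T₁ e xor e ∈ᵇ G₁) xor e ∈ᵇ G₂  ≡⟨ xor-assoc (T₁ e) _ _ ⟩
  T₁ e xor (e ∈ᵇ G₁ xor e ∈ᵇ G₂)  ∎)

SymDiff-flips : ∀ {Φ n} {T₁ T₂ : Tour n} {ds G₁ G₂} → SymDiff Φ ds G₁ G₂ → T₂ ≈[ Φ ] (T₁ * ds ⟨flip⟩) →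
                T₂ ≈[ Φ ] ((T₁ * G₁ ⟨flip⟩) * G₂ ⟨flip⟩)
SymDiff-flips {T₁ = T₁} {T₂} {ds} {G₁} {G₂} Δ T₂≈ e eK = begin
  T₂ e                                ≡⟨ T₂≈ e eK ⟩
  (T₁ * ds ⟨flip⟩) e                  ≡⟨ flip-xor T₁ ds e ⟩
  T₁ e xor e ∈ᵇ ds                    ≡⟨ cong (T₁ e xor_) (SymDiff.∈ᵇ-xor Δ eK) ⟩
  T₁ e xor (e ∈ᵇ G₁ xor e ∈ᵇ G₂)        ≡⟨ sym (xor-assoc (T₁ e) _ _) ⟩
  (T₁ e xor e ∈ᵇ G₁) xor e ∈ᵇ G₂        ≡⟨ cong (_xor e ∈ᵇ G₂) (sym (flip-xor T₁ G₁ e)) ⟩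
  (T₁ * G₁ ⟨flip⟩) e xor e ∈ᵇ G₂        ≡⟨ sym (flip-xor (T₁ * G₁ ⟨flip⟩) G₂ e) ⟩
  ((T₁ * G₁ ⟨flip⟩) * G₂ ⟨flip⟩) e      ∎

module SymDiffProperties {Φ n} {ds G₁ G₂ : List (Edge n)} (Δ : SymDiff Φ ds G₁ G₂) where

  private
    true≢false : true ≢ false
    true≢false ()

  ∈-both⇒∉ : ∀ {e} → InK Φ e → e ∈ G₁ → e ∈ G₂ → e ∉ ds
  ∈-both⇒∉ eK e∈G₁ e∈G₂ e∈ds =
    true≢false (≡-trans (sym (∈⇒∈ᵇ e∈ds)) (≡-trans (SymDiff.∈ᵇ-xor Δ eK) (cong₂ _xor_ (∈⇒∈ᵇ e∈G₁) (∈⇒∈ᵇ e∈G₂))))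

  ∈-∉⇒∈ : ∀ {e} → InK Φ e → e ∈ ds → e ∉ G₁ → e ∈ G₂
  ∈-∉⇒∈ {e} eK e∈ds e∉G₁ with mem? _≟E_ e G₂
  ... | yes e∈G₂ = e∈G₂
  ... | no e∉G₂ = ⊥-elim (true≢false
    (≡-trans (sym (∈⇒∈ᵇ e∈ds)) (≡-trans (SymDiff.∈ᵇ-xor Δ eK) (cong₂ _xor_ (∉⇒∈ᵇ e∉G₁) (∉⇒∈ᵇ e∉G₂)))))

  ∈-∉⇒∈ds : ∀ {e} → InK Φ e → e ∈ G₁ → e ∉ G₂ → e ∈ ds
  ∈-∉⇒∈ds {e} eK e∈G₁ e∉G₂ with mem? _≟E_ e ds
  ... | yes e∈ds = e∈ds
  ... | no e∉ds = ⊥-elim (true≢false (sym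
    (≡-trans (sym (∉⇒∈ᵇ e∉ds)) (≡-trans (SymDiff.∈ᵇ-xor Δ eK) (cong₂ _xor_ (∈⇒∈ᵇ e∈G₁) (∉⇒∈ᵇ e∉G₂))))))

SymDiff-comm : ∀ {Φ n} {ds G₁ G₂ : List (Edge n)} → SymDiff Φ ds G₁ G₂ → SymDiff Φ ds G₂ G₁
SymDiff-comm {G₁ = G₁} {G₂} Δ = symDiff λ {e} eK → ≡-trans (SymDiff.∈ᵇ-xor Δ eK) (xor-comm (e ∈ᵇ G₁) (e ∈ᵇ G₂))

record Hit (Φ : Ty) {n} (T₁ Z : Tour n) (a b : Edge n) : Set where
  field
    third   : Edge n
    inK     : InK Φ third
    neutral : Neutral T₁ (a ∷ b ∷ third ∷ [])
    reaches : Z ≈[ Φ ] (T₁ * (a ∷ b ∷ third ∷ []) ⟨flip⟩)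

SplitHit : ∀ {n} → Ty → Tour n → Tour n → Edge n → Edge n → Edge n → Edge n → Set
SplitHit Φ T₁ Z a b c d = Hit Φ T₁ Z a b ⊎ Hit Φ T₁ Z c d

record Step (Φ : Ty) {n} (T W : Tour n) : Set where
  field
    x y z   : Edge n
    unique  : Unique (x ∷ y ∷ z ∷ [])
    inK     : All (InK Φ) (x ∷ y ∷ z ∷ [])
    neutral : Neutral T (x ∷ y ∷ z ∷ [])
    flips   : W ≈[ Φ ] (T * (x ∷ y ∷ z ∷ []) ⟨flip⟩)

  triple : List (Edge n)
  triple = x ∷ y ∷ z ∷ []

Joined⇒Step : ∀ {Φ n c} {T W : Tour n} → Joined Φ c T W → Step Φ T W
Joined⇒Step (_ , (sh@(triangle _ _ _ _ _) , nG) , W≈) =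
  record { x = _ ; y = _ ; z = _ ; unique = genShape-unique sh ; inK = genShape-InK sh ; neutral = nG ; flips = W≈ }
Joined⇒Step (_ , (sh@(pair _ _) , nG) , W≈) =
  record { x = _ ; y = _ ; z = _ ; unique = genShape-unique sh ; inK = genShape-InK sh ; neutral = nG ; flips = W≈ }
Joined⇒Step (_ , (sh@(clover _ _ _ _ _) , nG) , W≈) =
  record { x = _ ; y = _ ; z = _ ; unique = genShape-unique sh ; inK = genShape-InK sh ; neutral = nG ; flips = W≈ }

Adj⇒Step : ∀ {Φ n s} {T W : Tour n} → Adj Φ s T W → Step Φ T W
Adj⇒Step (_ , _ , joined) = Sum.[ Joined⇒Step , Joined⇒Step ] joined

Step⇒Hit : ∀ {Φ n} {T₁ Z : Tour n} (S : Step Φ T₁ Z) {a b} → a ∈ Step.triple S → b ∈ Step.triple S → a ≢ b → Hit Φ T₁ Z a b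
Step⇒Hit {T₁ = T₁} S a∈ b∈ a≢b with triple-↭ a∈ b∈ a≢b
... | g , S↭ = record
  { third = g ; inK = All.lookup (All-resp-↭ S↭ (Step.inK S)) (there (there (here refl)))
  ; neutral = Neutral-↭ {T = T₁} S↭ (Step.neutral S) ; reaches = ≈flip-↭ S↭ (Step.flips S) }

-- With a four-game difference, a step of three games cannot flip three of them: the other step would then
-- have to consist of the remaining game alone.
three-in-first-step : ∀ {Φ n} {ds : List (Edge n)} {x y z x' y' z'} → Unique ds → length ds ≡ 4 →
                      Unique (x' ∷ y' ∷ z' ∷ []) → All (InK Φ) (x' ∷ y' ∷ z' ∷ []) →
                      SymDiff Φ ds (x ∷ y ∷ z ∷ []) (x' ∷ y' ∷ z' ∷ []) →
                      ∀ {p q r} → Unique (p ∷ q ∷ r ∷ []) → All (_∈ ds) (p ∷ q ∷ r ∷ []) →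
                      All (_∈ x ∷ y ∷ z ∷ []) (p ∷ q ∷ r ∷ []) → ⊥
three-in-first-step {ds = ds} {x} {y} {z} {x'} {y'} {z'} uds len4 ((x'≢y' ∷ _) ∷ _) G₂K Δ {p} {q} {r} upqr pqr∈ds pqr∈G₁ =
  ¬5≤4 (subst (5 ≤_) len4 (unique-⊆⇒length≤ ((x'≢y' ∷ proj₂ (outside x'∈)) ∷ proj₂ (outside y'∈) ∷ upqr)
                                            (All.lookup (proj₁ (outside x'∈) ∷ proj₁ (outside y'∈) ∷ pqr∈ds))))
  where
  open SymDiffProperties (SymDiff-comm Δ)
  ¬4≤3 : ¬ (4 ≤ 3)
  ¬4≤3 (s≤s (s≤s (s≤s ())))
  ¬5≤4 : ¬ (5 ≤ 4)
  ¬5≤4 (s≤s (s≤s (s≤s (s≤s ()))))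
  x'∈ : x' ∈ x' ∷ y' ∷ z' ∷ []
  x'∈ = here refl
  y'∈ : y' ∈ x' ∷ y' ∷ z' ∷ []
  y'∈ = there (here refl)
  G₁⊆pqr : x ∷ y ∷ z ∷ [] ⊆ p ∷ q ∷ r ∷ []
  G₁⊆pqr {h} h∈G₁ with mem? _≟E_ h (p ∷ q ∷ r ∷ [])
  ... | yes h∈pqr = h∈pqr
  ... | no h∉pqr = ⊥-elim (¬4≤3 (unique-⊆⇒length≤ (¬Any⇒All¬ _ h∉pqr ∷ upqr) (All.lookup (h∈G₁ ∷ pqr∈G₁))))
  outside : ∀ {h} → h ∈ x' ∷ y' ∷ z' ∷ [] → h ∈ ds × All (h ≢_) (p ∷ q ∷ r ∷ [])
  outside h∈G₂ = ∈-∉⇒∈ds hK h∈G₂ h∉G₁ , ¬Any⇒All¬ _ (h∉G₁ ∘ All.lookup pqr∈G₁)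
    where
    hK = All.lookup G₂K h∈G₂
    h∉G₁ = λ h∈G₁ → SymDiffProperties.∈-both⇒∉ Δ hK h∈G₁ h∈G₂ (All.lookup pqr∈ds (G₁⊆pqr h∈G₁))

middle-hits : ∀ {Φ n s} {T₁ T₂ Z : Tour n} {a b c d} → Difference Φ s T₁ T₂ (a ∷ b ∷ c ∷ d ∷ []) → Mid Φ s T₁ T₂ Z →
              SplitHit Φ T₁ Z a b c d ⊎ SplitHit Φ T₁ Z a c b d ⊎ SplitHit Φ T₁ Z a d b c
middle-hits {Φ} {a = a} {b} {c} {d} Δ (T₁→Z , Z→T₂) =
  table (mem? _≟E_ a G₁) (mem? _≟E_ b G₁) (mem? _≟E_ c G₁) (mem? _≟E_ d G₁)
  where
  open Difference Δ
  ds = a ∷ b ∷ c ∷ d ∷ []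
  S₁ = Adj⇒Step T₁→Z
  S₂ = Adj⇒Step Z→T₂
  G₁ = Step.triple S₁
  Δ₁₂ : SymDiff Φ ds G₁ (Step.triple S₂)
  Δ₁₂ = flips-SymDiff flips (Step.flips S₁) (Step.flips S₂)
  a≢b = All.head (AllPairs.head unique)
  a≢c = All.head (All.tail (AllPairs.head unique))
  a≢d = All.head (All.tail (All.tail (AllPairs.head unique)))
  b≢c = All.head (AllPairs.head (AllPairs.tail unique))
  b≢d = All.head (All.tail (AllPairs.head (AllPairs.tail unique)))
  c≢d = All.head (AllPairs.head (AllPairs.tail (AllPairs.tail unique)))
  a∈ : a ∈ ds
  a∈ = here refl
  b∈ : b ∈ ds
  b∈ = there (here refl)
  c∈ : c ∈ ds
  c∈ = there (there (here refl))
  d∈ : d ∈ ds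
  d∈ = there (there (there (here refl)))
  three-in : ∀ {p q r} → Unique (p ∷ q ∷ r ∷ []) → All (_∈ ds) (p ∷ q ∷ r ∷ []) → All (_∈ G₁) (p ∷ q ∷ r ∷ []) → ⊥
  three-in = three-in-first-step unique refl (Step.unique S₂) (Step.inK S₂) Δ₁₂
  three-out : ∀ {p q r} → Unique (p ∷ q ∷ r ∷ []) → All (_∈ ds) (p ∷ q ∷ r ∷ []) → All (_∉ G₁) (p ∷ q ∷ r ∷ []) → ⊥
  three-out u pqr∈@(p∈ ∷ q∈ ∷ r∈ ∷ []) (p∉ ∷ q∉ ∷ r∉ ∷ []) =
    three-in-first-step unique refl (Step.unique S₁) (Step.inK S₁) (SymDiff-comm Δ₁₂) u pqr∈ (in₂ p∈ p∉ ∷ in₂ q∈ q∉ ∷ in₂ r∈ r∉ ∷ [])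
    where
    in₂ : ∀ {e} → e ∈ ds → e ∉ G₁ → e ∈ Step.triple S₂
    in₂ e∈ e∉ = SymDiffProperties.∈-∉⇒∈ Δ₁₂ (All.lookup inK e∈) e∈ e∉
  hit = Step⇒Hit S₁
  table : Dec (a ∈ G₁) → Dec (b ∈ G₁) → Dec (c ∈ G₁) → Dec (d ∈ G₁) → _
  table (yes a₁) (yes b₁) (yes c₁) _        = ⊥-elim (three-in (unique₃ a≢b a≢c b≢c) (a∈ ∷ b∈ ∷ c∈ ∷ []) (a₁ ∷ b₁ ∷ c₁ ∷ []))
  table (yes a₁) (yes b₁) (no _)   (yes d₁) = ⊥-elim (three-in (unique₃ a≢b a≢d b≢d) (a∈ ∷ b∈ ∷ d∈ ∷ []) (a₁ ∷ b₁ ∷ d₁ ∷ []))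
  table (yes a₁) (yes b₁) (no _)   (no _)   = inj₁ (inj₁ (hit a₁ b₁ a≢b))
  table (yes a₁) (no _)   (yes c₁) (yes d₁) = ⊥-elim (three-in (unique₃ a≢c a≢d c≢d) (a∈ ∷ c∈ ∷ d∈ ∷ []) (a₁ ∷ c₁ ∷ d₁ ∷ []))
  table (yes a₁) (no _)   (yes c₁) (no _)   = inj₂ (inj₁ (inj₁ (hit a₁ c₁ a≢c)))
  table (yes a₁) (no _)   (no _)   (yes d₁) = inj₂ (inj₂ (inj₁ (hit a₁ d₁ a≢d)))
  table (yes _)  (no b₀)  (no c₀)  (no d₀)  = ⊥-elim (three-out (unique₃ b≢c b≢d c≢d) (b∈ ∷ c∈ ∷ d∈ ∷ []) (b₀ ∷ c₀ ∷ d₀ ∷ []))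
  table (no _)   (yes b₁) (yes c₁) (yes d₁) = ⊥-elim (three-in (unique₃ b≢c b≢d c≢d) (b∈ ∷ c∈ ∷ d∈ ∷ []) (b₁ ∷ c₁ ∷ d₁ ∷ []))
  table (no _)   (yes b₁) (yes c₁) (no _)   = inj₂ (inj₂ (inj₂ (hit b₁ c₁ b≢c)))
  table (no _)   (yes b₁) (no _)   (yes d₁) = inj₂ (inj₁ (inj₂ (hit b₁ d₁ b≢d)))
  table (no a₀)  (yes _)  (no c₀)  (no d₀)  = ⊥-elim (three-out (unique₃ a≢c a≢d c≢d) (a∈ ∷ c∈ ∷ d∈ ∷ []) (a₀ ∷ c₀ ∷ d₀ ∷ []))
  table (no _)   (no _)   (yes c₁) (yes d₁) = inj₁ (inj₂ (hit c₁ d₁ c≢d))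
  table (no a₀)  (no b₀)  (yes _)  (no d₀)  = ⊥-elim (three-out (unique₃ a≢b a≢d b≢d) (a∈ ∷ b∈ ∷ d∈ ∷ []) (a₀ ∷ b₀ ∷ d₀ ∷ []))
  table (no a₀)  (no b₀)  (no c₀)  _        = ⊥-elim (three-out (unique₃ a≢b a≢c b≢c) (a∈ ∷ b∈ ∷ c∈ ∷ []) (a₀ ∷ b₀ ∷ c₀ ∷ []))

∈ᵇ-split : ∀ {n} {a b c d g : Edge n} → Unique (a ∷ b ∷ c ∷ d ∷ []) → g ∉ a ∷ b ∷ c ∷ d ∷ [] → ∀ e →
           e ∈ᵇ (a ∷ b ∷ c ∷ d ∷ []) ≡ e ∈ᵇ (a ∷ b ∷ g ∷ []) xor e ∈ᵇ (c ∷ d ∷ g ∷ [])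
∈ᵇ-split {a = a} {b} {c} {d} {g} u g∉ e = go (mem? _≟E_ e (a ∷ b ∷ [])) (mem? _≟E_ e (c ∷ d ∷ [])) (e ≟E g)
  where
  go : Dec (e ∈ a ∷ b ∷ []) → Dec (e ∈ c ∷ d ∷ []) → Dec (e ≡ g) →
       e ∈ᵇ (a ∷ b ∷ c ∷ d ∷ []) ≡ e ∈ᵇ (a ∷ b ∷ g ∷ []) xor e ∈ᵇ (c ∷ d ∷ g ∷ [])
  go (yes e∈ab) _ _ = ≡-trans (∈⇒∈ᵇ (∈-++⁺ˡ {ys = c ∷ d ∷ []} e∈ab)) (sym (cong₂ _xor_ (∈⇒∈ᵇ (∈-++⁺ˡ {ys = g ∷ []} e∈ab))
    (∉⇒∈ᵇ (∉-++-∷ (c ∷ d ∷ []) (Unique-++-disjoint (a ∷ b ∷ []) u e∈ab) (λ { refl → g∉ (∈-++⁺ˡ {ys = c ∷ d ∷ []} e∈ab) })))))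
  go (no e∉ab) (yes e∈cd) _ = ≡-trans (∈⇒∈ᵇ (∈-++⁺ʳ (a ∷ b ∷ []) e∈cd)) (sym (cong₂ _xor_
    (∉⇒∈ᵇ (∉-++-∷ (a ∷ b ∷ []) e∉ab (λ { refl → g∉ (∈-++⁺ʳ (a ∷ b ∷ []) e∈cd) }))) (∈⇒∈ᵇ (∈-++⁺ˡ {ys = g ∷ []} e∈cd))))
  go (no e∉ab) (no e∉cd) (yes e≡g) = ≡-trans (∉⇒∈ᵇ (g∉ ∘ subst (_∈ a ∷ b ∷ c ∷ d ∷ []) e≡g)) (sym (cong₂ _xor_
    (∈⇒∈ᵇ (∈-++⁺ʳ (a ∷ b ∷ []) (here {xs = []} e≡g))) (∈⇒∈ᵇ (∈-++⁺ʳ (c ∷ d ∷ []) (here {xs = []} e≡g)))))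
  go (no e∉ab) (no e∉cd) (no e≢g) = ≡-trans (∉⇒∈ᵇ (Sum.[ e∉ab , e∉cd ] ∘ ∈-++⁻ (a ∷ b ∷ []))) (sym (cong₂ _xor_
    (∉⇒∈ᵇ (∉-++-∷ (a ∷ b ∷ []) e∉ab e≢g)) (∉⇒∈ᵇ (∉-++-∷ (c ∷ d ∷ []) e∉cd e≢g))))

pairs-opposite : ∀ {n} (T : Tour n) {a b c d} → Neutral T (a ∷ b ∷ c ∷ d ∷ []) →
                 ∀ k → σ T a k + σ T b k ≡ - (σ T c k + σ T d k)
pairs-opposite T {a} {b} {c} {d} nT k = begin
  σ T a k + σ T b k                                                        ≡⟨ sym (isolate (σ T a k) (σ T b k) (σ T c k) (σ T d k)) ⟩
  σ T a k + (σ T b k + (σ T c k + (σ T d k + 0ℤ))) - (σ T c k + σ T d k)   ≡⟨ cong (_- (σ T c k + σ T d k)) (nT k) ⟩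
  0ℤ - (σ T c k + σ T d k)                                                 ≡⟨ +-identityˡ _ ⟩
  - (σ T c k + σ T d k)                                                    ∎
  where
  isolate : ∀ x y z w → x + (y + (z + (w + 0ℤ))) - (z + w) ≡ x + y
  isolate = solve-∀

FlipsPair : ∀ {n} → Tour n → Tour n → Edge n → Edge n → Edge n → Edge n → Set
FlipsPair T W a b c d = W a ≡ not (T a) × W b ≡ not (T b) × W c ≡ T c × W d ≡ T d

data Splits {n} (T W : Tour n) (a b c d : Edge n) : Set where
  first  : FlipsPair T W a b c d → Splits T W a b c d
  second : FlipsPair T W c d a b → Splits T W a b c d

Splits-swap : ∀ {n} {T W : Tour n} {a b c d} → Splits T W c d a b → Splits T W a b c d
Splits-swap (first f)  = second f
Splits-swap (second f) = first f

Splits-swap₃₄ : ∀ {n} {T W : Tour n} {a b c d} → Splits T W a b c d → Splits T W a b d c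
Splits-swap₃₄ (first (fa , fb , fc , fd))  = first (fa , fb , fd , fc)
Splits-swap₃₄ (second (fc , fd , fa , fb)) = second (fd , fc , fa , fb)

record Middle (Φ : Ty) {n} (s : Fin n → ℤ) (T₁ T₂ : Tour n) (c₁ c₂ : Bool) (a b c d : Edge n) : Set where
  field
    W       : Tour n
    link₁   : Link Φ c₁ s T₁ W
    link₂   : Link Φ c₂ s W T₂
    flipped : Splits T₁ W a b c d
    catches : ∀ {Z} → SplitHit Φ T₁ Z a b c d → Z ≈[ Φ ] W

Hit-swap : ∀ {Φ n} {T₁ Z : Tour n} {a b} → Hit Φ T₁ Z a b → Hit Φ T₁ Z b a
Hit-swap {T₁ = T₁} {a = a} {b} h = record
  { third = third ; inK = inK ; neutral = Neutral-↭ {T = T₁} ab↭ba neutral ; reaches = ≈flip-↭ ab↭ba reaches }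
  where
  open Hit h
  ab↭ba : a ∷ b ∷ third ∷ [] ↭ b ∷ a ∷ third ∷ []
  ab↭ba = swap a b refl

Middle-swap₃₄ : ∀ {Φ n s} {T₁ T₂ : Tour n} {c₁ c₂ a b c d} → Middle Φ s T₁ T₂ c₁ c₂ a b c d → Middle Φ s T₁ T₂ c₁ c₂ a b d c
Middle-swap₃₄ M = record
  { W = W ; link₁ = link₁ ; link₂ = link₂ ; flipped = Splits-swap₃₄ flipped ; catches = catches ∘ Sum.map₂ Hit-swap }
  where open Middle M

Middle-swap : ∀ {Φ n s} {T₁ T₂ : Tour n} {c₁ c₂ a b c d} → Middle Φ s T₁ T₂ c₁ c₂ c d a b → Middle Φ s T₁ T₂ c₁ c₂ a b c d
Middle-swap M = record
  { W = W ; link₁ = link₁ ; link₂ = link₂ ; flipped = Splits-swap flipped ; catches = catches ∘ Sum.swap }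
  where open Middle M

-- The middle vertex W = T₁ * {a,b,g}; the third game g is forced by σ g = -(σ a + σ b), and with that
-- sign no step from T₁ can start with {c,d}.
split-middle : ∀ {Φ n s} {T₁ T₂ : Tour n} {a b c d g L₁ L₂ c₁ c₂} →
               Difference Φ s T₁ T₂ (a ∷ b ∷ c ∷ d ∷ []) → g ∉ a ∷ b ∷ c ∷ d ∷ [] →
               GenShape Φ L₁ c₁ → L₁ ↭ a ∷ b ∷ g ∷ [] → GenShape Φ L₂ c₂ → L₂ ↭ c ∷ d ∷ g ∷ [] →
               (∀ k → σ T₁ g k ≡ - (σ T₁ a k + σ T₁ b k)) → Middle Φ s T₁ T₂ c₁ c₂ a b c d
split-middle {Φ} {T₁ = T₁} {T₂} {a} {b} {c} {d} {g} {L₁} {L₂} Δ g∉ sh₁ L₁↭ sh₂ L₂↭ σg = record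
  { W = W ; link₁ = generator-Link sh₁ nL₁ (λ _ _ → refl) vtx₁ vW ; link₂ = generator-Link sh₂ nL₂ T₂≈ vW vtx₂
  ; flipped = first (flip-∈ T₁ (∈L₁ (here refl)) , flip-∈ T₁ (∈L₁ (there (here refl))) , flip-∉ T₁ c∉L₁ , flip-∉ T₁ d∉L₁)
  ; catches = catches }
  where
  open Difference Δ
  W = T₁ * L₁ ⟨flip⟩
  ∈L₁ : ∀ {e} → e ∈ a ∷ b ∷ g ∷ [] → e ∈ L₁
  ∈L₁ = ∈-resp-↭ (↭-sym L₁↭)
  cd∉abg : ∀ {e} → e ∈ c ∷ d ∷ [] → e ∉ a ∷ b ∷ g ∷ []
  cd∉abg e∈cd = ∉-++-∷ (a ∷ b ∷ []) (λ e∈ab → Unique-++-disjoint (a ∷ b ∷ []) unique e∈ab e∈cd)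
                                      (λ { refl → g∉ (∈-++⁺ʳ (a ∷ b ∷ []) e∈cd) })
  c∉L₁ : c ∉ L₁
  c∉L₁ = cd∉abg (here refl) ∘ ∈-resp-↭ L₁↭
  d∉L₁ : d ∉ L₁
  d∉L₁ = cd∉abg (there (here refl)) ∘ ∈-resp-↭ L₁↭
  nL₁ : Neutral T₁ L₁
  nL₁ = Neutral-↭ {T = T₁} (↭-sym L₁↭) (neutral-triple T₁ {a} {b} {g} σg)
  vW : Vtx Φ _ W
  vW = Vtx-flip Φ vtx₁ (genShape-unique sh₁) (genShape-InK sh₁) nL₁ (λ _ _ → refl)
  nL₂ : Neutral W L₂
  nL₂ = Neutral-↭ {T = W} (↭-sym L₂↭) (neutral-triple W {c} {d} {g} λ k → begin
    σ W g k                       ≡⟨ σ-flip-∈ T₁ (∈L₁ (there (there (here refl)))) k ⟩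
    - σ T₁ g k                    ≡⟨ cong -_ (σg k) ⟩
    - - (σ T₁ a k + σ T₁ b k)     ≡⟨ neg-involutive _ ⟩
    σ T₁ a k + σ T₁ b k           ≡⟨ pairs-opposite T₁ neutral k ⟩
    - (σ T₁ c k + σ T₁ d k)       ≡⟨ sym (cong₂ (λ x y → - (x + y)) (σ-flip-∉ T₁ c∉L₁ k) (σ-flip-∉ T₁ d∉L₁ k)) ⟩
    - (σ W c k + σ W d k)         ∎)
  T₂≈ : T₂ ≈[ Φ ] (W * L₂ ⟨flip⟩)
  T₂≈ = SymDiff-flips {T₁ = T₁} {ds = a ∷ b ∷ c ∷ d ∷ []} {G₁ = L₁} {G₂ = L₂} (symDiff λ {e} _ → ≡-trans (∈ᵇ-split unique g∉ e)
                                 (cong₂ _xor_ (∈ᵇ-↭ (↭-sym L₁↭) e) (∈ᵇ-↭ (↭-sym L₂↭) e))) flips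
  catches : ∀ {Z} → SplitHit Φ T₁ Z a b c d → Z ≈[ Φ ] W
  catches (inj₁ h) with σ-injective T₁ T₁ {Hit.third h} {g} (λ k →
    ≡-trans (neutral-triple⁻ T₁ {a} {b} (Hit.neutral h) k) (sym (σg k)))
  ... | refl = ≈flip-↭ (↭-sym L₁↭) (Hit.reaches h)
  catches (inj₂ h) = ⊥-elim (σ-anti T₁ {Hit.third h} {g} λ k → begin
    σ T₁ (Hit.third h) k          ≡⟨ neutral-triple⁻ T₁ {c} {d} (Hit.neutral h) k ⟩
    - (σ T₁ c k + σ T₁ d k)       ≡⟨ sym (pairs-opposite T₁ neutral k) ⟩
    σ T₁ a k + σ T₁ b k           ≡⟨ sym (neg-involutive _) ⟩
    - - (σ T₁ a k + σ T₁ b k)     ≡⟨ cong -_ (sym (σg k)) ⟩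
    - σ T₁ g k                    ∎)

split-middle± : ∀ {Φ n s} {T₁ T₂ : Tour n} {a b c d g L₁ L₂ c₁ c₂} →
                Difference Φ s T₁ T₂ (a ∷ b ∷ c ∷ d ∷ []) → g ∉ a ∷ b ∷ c ∷ d ∷ [] →
                GenShape Φ L₁ c₁ → L₁ ↭ a ∷ b ∷ g ∷ [] → GenShape Φ L₂ c₂ → L₂ ↭ c ∷ d ∷ g ∷ [] →
                σ T₁ g ≗± (λ k → σ T₁ a k + σ T₁ b k) →
                Middle Φ s T₁ T₂ c₁ c₂ a b c d ⊎ Middle Φ s T₁ T₂ c₂ c₁ a b c d
split-middle± Δ g∉ sh₁ L₁↭ sh₂ L₂↭ (inj₂ σg) = inj₁ (split-middle Δ g∉ sh₁ L₁↭ sh₂ L₂↭ σg)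
split-middle± {T₁ = T₁} {a = a} {b} {c} {d} Δ g∉ sh₁ L₁↭ sh₂ L₂↭ (inj₁ σg) =
  inj₂ (Middle-swap (split-middle (Difference-↭ abcd↭cdab Δ) (g∉ ∘ ∈-resp-↭ (↭-sym abcd↭cdab)) sh₂ L₂↭ sh₁ L₁↭
                       λ k → ≡-trans (σg k) (pairs-opposite T₁ (Difference.neutral Δ) k)))
  where
  abcd↭cdab : a ∷ b ∷ c ∷ d ∷ [] ↭ c ∷ d ∷ a ∷ b ∷ []
  abcd↭cdab = ++-comm (a ∷ b ∷ []) (c ∷ d ∷ [])

-- p, q and r, t form two triangles sharing the closing edge u–w.
triangle-split : ∀ {Φ n s} {T₁ T₂ : Tour n} {p q r t u v w x} → Difference Φ s T₁ T₂ (p ∷ q ∷ r ∷ t ∷ []) →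
                 Distinct3 u v w → Distinct3 w x u → Joins p u v → Joins q v w → Joins r w x → Joins t x u →
                 σ T₁ p v + σ T₁ q v ≡ 0ℤ → Middle Φ s T₁ T₂ false false p q r t
triangle-split {T₁ = T₁} {p = p} {q} {r} {t} Δ uvw@(u≢v , v≢w , u≢w) wxu@(w≢x , x≢u , w≢u) jp jq jr jt cancel =
  Sum.reduce (split-middle± Δ g∉ (triangle-generator T₁ uvw jp jq joins parallel) refl
                             (triangle-generator T₁ wxu jr jt (joins-sym joins) parallel′) refl parallel)
  where
  open ClosingEdge (closing-edge T₁ uvw jp jq cancel)
  parallel′ : σ T₁ edge ≗± (λ k → σ T₁ r k + σ T₁ t k)
  parallel′ = ≗±-neg parallel (pairs-opposite T₁ (Difference.neutral Δ))
  g∉ : edge ∉ p ∷ q ∷ r ∷ t ∷ []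
  g∉ = All¬⇒¬Any (joins-edge-≢ (joins-sym joins) jp (u≢w ∘ sym) (v≢w ∘ sym) ∷ joins-edge-≢ joins jq u≢v u≢w ∷
                  joins-edge-≢ joins jr (w≢u ∘ sym) (x≢u ∘ sym) ∷ joins-edge-≢ (joins-sym joins) jt w≢x w≢u ∷ [])

-- A hit of either pair would need a game whose vector is ±(σ a + σ b), which has three points of support.
no-split-hit : ∀ {Φ n} (T₁ : Tour n) {Z a b c d u v w} → Neutral T₁ (a ∷ b ∷ c ∷ d ∷ []) →
               σ T₁ a u + σ T₁ b u ≢ 0ℤ → σ T₁ a v + σ T₁ b v ≢ 0ℤ → σ T₁ a w + σ T₁ b w ≢ 0ℤ →
               Distinct3 u v w → ¬ SplitHit Φ T₁ Z a b c d
no-split-hit T₁ {a = a} {b} nD σu σv σw uvw (inj₁ h) = σ-support≤2 T₁ (Hit.third h) (nz σu) (nz σv) (nz σw) uvw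
  where
  nz : ∀ {k} → σ T₁ a k + σ T₁ b k ≢ 0ℤ → σ T₁ (Hit.third h) k ≢ 0ℤ
  nz {k} ne = neg-≢0 ne ∘ ≡-trans (sym (neutral-triple⁻ T₁ {a} {b} (Hit.neutral h) k))
no-split-hit T₁ {a = a} {b} {c} {d} nD σu σv σw uvw (inj₂ h) = σ-support≤2 T₁ (Hit.third h) (nz σu) (nz σv) (nz σw) uvw
  where
  nz : ∀ {k} → σ T₁ a k + σ T₁ b k ≢ 0ℤ → σ T₁ (Hit.third h) k ≢ 0ℤ
  nz {k} ne = ne ∘ ≡-trans (pairs-opposite T₁ nD k) ∘ ≡-trans (sym (neutral-triple⁻ T₁ {c} {d} (Hit.neutral h) k))

-- {a,b} is flipped together by X and separated by Y.
splits-≉ : ∀ {Φ n} {T X Y : Tour n} {a b c d} → InK Φ a → InK Φ b →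
           Splits T X a b c d → Splits T Y a c b d → ¬ (X ≈[ Φ ] Y)
splits-≉ {X = X} {Y} {a} {b} {c} {d} aK bK sX sY X≈Y = differ sX sY (X≈Y a aK) (X≈Y b bK)
  where
  differ : Splits _ X a b c d → Splits _ Y a c b d → X a ≡ Y a → X b ≡ Y b → ⊥
  differ (first (_ , Xb , _ , _))  (first (_ , _ , Yb , _))  _ eb = not-¬ refl (≡-trans (sym Yb) (≡-trans (sym eb) Xb))
  differ (first (Xa , _ , _ , _))  (second (_ , _ , Ya , _)) ea _ = not-¬ refl (≡-trans (sym Ya) (≡-trans (sym ea) Xa))
  differ (second (_ , _ , Xa , _)) (first (Ya , _ , _ , _))  ea _ = not-¬ refl (≡-trans (sym Xa) (≡-trans ea Ya))
  differ (second (_ , _ , _ , Xb)) (second (Yb , _ , _ , _)) _ eb = not-¬ refl (≡-trans (sym Xb) (≡-trans eb Yb))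

module TwoMiddles {Φ n s} {T₁ T₂ : Tour n} {a b c d c₁ c₂ c₃ c₄} (Δ : Difference Φ s T₁ T₂ (a ∷ b ∷ c ∷ d ∷ []))
                  (X : Middle Φ s T₁ T₂ c₁ c₂ a b c d) (Y : Middle Φ s T₁ T₂ c₃ c₄ a c b d)
                  (no-ad : ∀ {Z} → ¬ SplitHit Φ T₁ Z a d b c) where

  differ : ¬ (Middle.W X ≈[ Φ ] Middle.W Y)
  differ = splits-≉ (All.lookup inK (here refl)) (All.lookup inK (there (here refl))) (Middle.flipped X) (Middle.flipped Y)
    where open Difference Δ

  catch : ∀ Z → Mid Φ s T₁ T₂ Z → (Z ≈[ Φ ] Middle.W X) ⊎ (Z ≈[ Φ ] Middle.W Y)
  catch Z mid with middle-hits Δ mid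
  ... | inj₁ h        = inj₁ (Middle.catches X h)
  ... | inj₂ (inj₁ h) = inj₂ (Middle.catches Y h)
  ... | inj₂ (inj₂ h) = ⊥-elim (no-ad h)

single-diamond : ∀ {Φ n s} {T₁ T₂ : Tour n} {a b c d} → Difference Φ s T₁ T₂ (a ∷ b ∷ c ∷ d ∷ []) →
                 Middle Φ s T₁ T₂ false false a b c d → Middle Φ s T₁ T₂ false false a c b d →
                 (∀ {Z} → ¬ SplitHit Φ T₁ Z a d b c) → SingleDiamond Φ s T₁ T₂
single-diamond Δ X Y no-ad =
  Middle.W X , Middle.W Y , differ , catch , Middle.link₁ X , Middle.link₂ X , Middle.link₁ Y , Middle.link₂ Y
  where open TwoMiddles Δ X Y no-ad

double-or-heavy-diamond : ∀ {Φ n s} {T₁ T₂ : Tour n} {a b c d} → Difference Φ s T₁ T₂ (a ∷ b ∷ c ∷ d ∷ []) →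
                          Middle Φ s T₁ T₂ true false a b c d ⊎ Middle Φ s T₁ T₂ false true a b c d →
                          Middle Φ s T₁ T₂ true false a c b d ⊎ Middle Φ s T₁ T₂ false true a c b d →
                          (∀ {Z} → ¬ SplitHit Φ T₁ Z a d b c) → DoubleDiamond Φ s T₁ T₂ ⊎ HeavyDiamond Φ s T₁ T₂
double-or-heavy-diamond Δ (inj₁ X) (inj₁ Y) no-ad = inj₂ (_ , _ , differ , catch ,
  inj₁ (Middle.link₁ X , Middle.link₁ Y , Middle.link₂ X , Middle.link₂ Y))
  where open TwoMiddles Δ X Y no-ad
double-or-heavy-diamond Δ (inj₂ X) (inj₂ Y) no-ad = inj₂ (_ , _ , differ , catch ,
  inj₂ (Middle.link₁ X , Middle.link₁ Y , Middle.link₂ X , Middle.link₂ Y))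
  where open TwoMiddles Δ X Y no-ad
double-or-heavy-diamond Δ (inj₁ X) (inj₂ Y) no-ad = inj₁ (_ , _ , differ , catch ,
  Middle.link₁ X , Middle.link₂ X , Middle.link₁ Y , Middle.link₂ Y)
  where open TwoMiddles Δ X Y no-ad
double-or-heavy-diamond {Φ} Δ (inj₂ X) (inj₁ Y) no-ad = inj₁ (_ , _ , differ ∘ ≈-sym , Sum.swap ∘₂ catch ,
  Middle.link₁ Y , Middle.link₂ Y , Middle.link₁ X , Middle.link₂ X)
  where
  open TwoMiddles Δ X Y no-ad
  ≈-sym : ∀ {n} {U V : Tour n} → U ≈[ Φ ] V → V ≈[ Φ ] U
  ≈-sym U≈V e eK = sym (U≈V e eK)

split-diamond : ∀ {Φ n s} {T₁ T₂ : Tour n} {a b c d} → Difference Φ s T₁ T₂ (a ∷ b ∷ c ∷ d ∷ []) →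
                Middle Φ s T₁ T₂ true true a b c d → Middle Φ s T₁ T₂ false false a c b d →
                Middle Φ s T₁ T₂ false false a d b c → SplitDiamond Φ s T₁ T₂
split-diamond {Φ} {T₁ = T₁} {a = a} {b} {c} {d} Δ Z X Y =
  Middle.W X , Middle.W Y , Middle.W Z ,
  splits-≉ aK cK (Splits-swap₃₄ (Middle.flipped X)) (Splits-swap₃₄ (Middle.flipped Y)) ,
  splits-≉ aK cK (Middle.flipped X) (Middle.flipped Z) ,
  splits-≉ aK dK (Middle.flipped Y) (Splits-swap₃₄ (Middle.flipped Z)) ,
  catch , Middle.link₁ X , Middle.link₂ X , Middle.link₁ Y , Middle.link₂ Y , Middle.link₁ Z , Middle.link₂ Z
  where
  open Difference Δ
  aK = All.lookup inK (here refl)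
  cK = All.lookup inK (there (there (here refl)))
  dK = All.lookup inK (there (there (there (here refl))))
  catch : ∀ W → Mid Φ _ T₁ _ W → (W ≈[ Φ ] Middle.W X) ⊎ (W ≈[ Φ ] Middle.W Y) ⊎ (W ≈[ Φ ] Middle.W Z)
  catch W mid with middle-hits Δ mid
  ... | inj₁ h        = inj₂ (inj₂ (Middle.catches Z h))
  ... | inj₂ (inj₁ h) = inj₁ (Middle.catches X h)
  ... | inj₂ (inj₂ h) = inj₂ (inj₁ (Middle.catches Y h))

square-diamond : ∀ {Φ n s} {T₁ T₂ : Tour n} {a b c d e₁ e₂ e₃ e₄} → Vtx Φ s T₁ → Vtx Φ s T₂ →
                 Distinct4 a b c d → Joins e₁ a b → Joins e₂ b c → Joins e₃ c d → Joins e₄ d a →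
                 DiffIs Φ T₁ T₂ (e₁ ∷ e₂ ∷ e₃ ∷ e₄ ∷ []) → SingleDiamond Φ s T₁ T₂
square-diamond {T₁ = T₁} {a = a} {b} {c} {d} {e₁} {e₂} {e₃} {e₄} v₁ v₂ (a≢b , a≢c , a≢d , b≢c , b≢d , c≢d) j₁ j₂ j₃ j₄ diff =
  single-diamond (Difference-↭ (prep e₁ (prep e₂ (swap e₃ e₄ refl))) Δ)
    (Middle-swap₃₄ (triangle-split Δ (a≢b , b≢c , a≢c) (c≢d , a≢d ∘ sym , a≢c ∘ sym) j₁ j₂ j₃ j₄
      (pair-cancels T₁ b e₁ e₂ (Difference.neutral Δ) refl
        (σ-joins-off T₁ j₃ (b≢c ∘ sym) (b≢d ∘ sym) ∷ σ-joins-off T₁ j₄ (b≢d ∘ sym) a≢b ∷ []))))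
    (Middle-swap₃₄ (triangle-split Δ′ (a≢b ∘ sym , a≢d , b≢d) (c≢d ∘ sym , b≢c ∘ sym , b≢d ∘ sym)
      (joins-sym j₁) (joins-sym j₄) (joins-sym j₃) (joins-sym j₂)
      (pair-cancels T₁ a e₁ e₄ (Difference.neutral Δ′) refl
        (σ-joins-off T₁ j₃ (a≢c ∘ sym) (a≢d ∘ sym) ∷ σ-joins-off T₁ j₂ (a≢b ∘ sym) (a≢c ∘ sym) ∷ []))))
    (no-split-hit T₁ (Neutral-↭ {T = T₁} (prep e₁ (swap e₂ e₃ (refl {xs = e₄ ∷ []}))) (Difference.neutral Δ))
      (+0-≢0 (σ-joins-off T₁ j₃ (a≢c ∘ sym) (a≢d ∘ sym)) (σ-joins-≢0 T₁ j₁))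
      (+0-≢0 (σ-joins-off T₁ j₃ (b≢c ∘ sym) (b≢d ∘ sym)) (σ-joins-≢0 T₁ (joins-sym j₁)))
      (0+-≢0 (σ-joins-off T₁ j₁ a≢c b≢c) (σ-joins-≢0 T₁ j₃))
      (a≢b , b≢c , a≢c))
  where
  Δ = DiffIs⇒Difference v₁ v₂
        (unique₄ (joins-edge-≢ j₁ j₂ a≢b a≢c) (joins-edge-≢ j₁ j₃ a≢c a≢d) (joins-edge-≢ (joins-sym j₁) j₄ b≢d (a≢b ∘ sym))
                  (joins-edge-≢ j₂ j₃ b≢c b≢d) (joins-edge-≢ j₂ j₄ b≢d (a≢b ∘ sym)) (joins-edge-≢ j₃ j₄ c≢d (a≢c ∘ sym)))
        diff
  Δ′ = Difference-↭ (prep e₁ (trans (swap e₂ e₃ refl) (trans (prep e₃ (swap e₂ e₄ refl)) (swap e₃ e₄ refl)))) Δ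

module Tent {Φ n s} {T₁ T₂ : Tour n} {x y z : Fin n} {e₁ e₂ e₃ e₄ : Edge n} (v₁ : Vtx Φ s T₁) (v₂ : Vtx Φ s T₂)
            (d : Distinct3 x y z) (j₁ : Joins e₁ x y) (j₂ : Joins e₂ x y) (e₁≢e₂ : e₁ ≢ e₂)
            (j₃ : Joins e₃ x z) (j₄ : Joins e₄ x z) (e₃≢e₄ : e₃ ≢ e₄) (diff : DiffIs Φ T₁ T₂ (e₁ ∷ e₂ ∷ e₃ ∷ e₄ ∷ [])) where

  open Signs

  private
    x≢y = proj₁ d
    y≢z = proj₁ (proj₂ d)
    x≢z = proj₂ (proj₂ d)

    xy≢xz : ∀ {e e'} → Joins e x y → Joins e' x z → e ≢ e'
    xy≢xz j j' = joins-edge-≢ (joins-sym j) j' (x≢y ∘ sym) y≢z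

  Δ : Difference Φ s T₁ T₂ (e₁ ∷ e₂ ∷ e₃ ∷ e₄ ∷ [])
  Δ = DiffIs⇒Difference v₁ v₂ (unique₄ e₁≢e₂ (xy≢xz j₁ j₃) (xy≢xz j₁ j₄) (xy≢xz j₂ j₃) (xy≢xz j₂ j₄) e₃≢e₄) diff

  s₁ = signs j₁ T₁
  s₂ = signs j₂ T₁
  s₃ = signs j₃ T₁
  s₄ = signs j₄ T₁

  b₂≡¬b₁ : at-b s₂ ≡ not (at-b s₁)
  b₂≡¬b₁ = opposite-at T₁ y e₁ e₂ (Difference.neutral Δ) refl
    (σ-joins-off T₁ j₃ x≢y (y≢z ∘ sym) ∷ σ-joins-off T₁ j₄ x≢y (y≢z ∘ sym) ∷ []) (σ-at-b s₁ x≢y) (σ-at-b s₂ x≢y)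

  -- Parallel edges leave x with the same sign, and the two pairs leave x with opposite signs.
  a₂≡a₁ : at-a s₂ ≡ at-a s₁
  a₂≡a₁ = parallel-at-a j₁ j₂ e₁≢e₂ s₁ s₂ b₂≡¬b₁

  a₄≡a₃ : at-a s₄ ≡ at-a s₃
  a₄≡a₃ = parallel-at-a j₃ j₄ e₃≢e₄ s₃ s₄ (opposite-at T₁ z e₃ e₄ (Difference.neutral Δ) (++-comm (e₁ ∷ e₂ ∷ []) (e₃ ∷ e₄ ∷ []))
    (σ-joins-off T₁ j₁ x≢z y≢z ∷ σ-joins-off T₁ j₂ x≢z y≢z ∷ []) (σ-at-b s₃ x≢z) (σ-at-b s₄ x≢z))

  a₃≡¬a₁ : at-a s₃ ≡ not (at-a s₁)
  a₃≡¬a₁ = double-sgn (begin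
    sgn (at-a s₁) + (sgn (at-a s₁) + (sgn (at-a s₃) + (sgn (at-a s₃) + 0ℤ)))
      ≡⟨ sym (cong₂ _+_ (σ-at-a s₁ x≢y) (cong₂ _+_ (≡-trans (σ-at-a s₂ x≢y) (cong sgn a₂≡a₁))
               (cong₂ _+_ (σ-at-a s₃ x≢z) (cong (_+ 0ℤ) (≡-trans (σ-at-a s₄ x≢z) (cong sgn a₄≡a₃)))))) ⟩
    wsum2 T₁ (e₁ ∷ e₂ ∷ e₃ ∷ e₄ ∷ []) x
      ≡⟨ Difference.neutral Δ x ⟩
    0ℤ ∎)
    where
    double-sgn : ∀ {p q} → sgn p + (sgn p + (sgn q + (sgn q + 0ℤ))) ≡ 0ℤ → q ≡ not p
    double-sgn {true}  {false} _ = refl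
    double-sgn {false} {true}  _ = refl
    double-sgn {true}  {true}  ()
    double-sgn {false} {false} ()

  middle₁₃ : Middle Φ s T₁ T₂ false false e₁ e₃ e₄ e₂
  middle₁₃ = triangle-split (Difference-↭ (prep e₁ (trans (swap e₂ e₃ refl) (prep e₃ (swap e₂ e₄ refl)))) Δ)
    (x≢y ∘ sym , x≢z , y≢z) (x≢z ∘ sym , x≢y , y≢z ∘ sym) (joins-sym j₁) j₃ (joins-sym j₄) j₂
    (≡-trans (cong₂ _+_ (σ-at-a s₁ x≢y) (≡-trans (σ-at-a s₃ x≢z) (cong sgn a₃≡¬a₁))) (sgn+sgn-not (at-a s₁)))

  middle₁₄ : Middle Φ s T₁ T₂ false false e₁ e₄ e₃ e₂
  middle₁₄ = triangle-split (Difference-↭ (prep e₁ (trans (swap e₂ e₃ refl) (trans (prep e₃ (swap e₂ e₄ refl)) (swap e₃ e₄ refl)))) Δ)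
    (x≢y ∘ sym , x≢z , y≢z) (x≢z ∘ sym , x≢y , y≢z ∘ sym) (joins-sym j₁) j₄ (joins-sym j₃) j₂
    (≡-trans (cong₂ _+_ (σ-at-a s₁ x≢y) (≡-trans (σ-at-a s₄ x≢z) (cong sgn (≡-trans a₄≡a₃ a₃≡¬a₁)))) (sgn+sgn-not (at-a s₁)))

  loop-sum : ∀ k → σ T₁ e₁ k + σ T₁ e₂ k ≡ sgn (at-a s₁) * vec (loop x) k
  loop-sum k = begin
    σ T₁ e₁ k + σ T₁ e₂ k
      ≡⟨ cong₂ _+_ (σ-≡ s₁ k) (σ-≡ s₂ k) ⟩
    sgn (at-a s₁) * δ x k + sgn (at-b s₁) * δ y k + (sgn (at-a s₂) * δ x k + sgn (at-b s₂) * δ y k)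
      ≡⟨ cong₂ (λ p q → sgn (at-a s₁) * δ x k + sgn (at-b s₁) * δ y k + (sgn p * δ x k + q * δ y k))
               a₂≡a₁ (≡-trans (cong sgn b₂≡¬b₁) (sgn-not (at-b s₁))) ⟩
    sgn (at-a s₁) * δ x k + sgn (at-b s₁) * δ y k + (sgn (at-a s₁) * δ x k + - sgn (at-b s₁) * δ y k)
      ≡⟨ collapse (sgn (at-a s₁)) (sgn (at-b s₁)) (δ x k) (δ y k) ⟩
    sgn (at-a s₁) * vec (loop x) k ∎
    where
    collapse : ∀ a b u v → a * u + b * v + (a * u + - b * v) ≡ a * (u + u)
    collapse = solve-∀

  loop-hit : ∀ {Z} → SplitHit Φ T₁ Z e₁ e₂ e₃ e₄ → InK Φ (loop x)
  loop-hit (inj₁ h) = subst (InK Φ) (σ-injective T₁ (λ _ → not (at-a s₁)) {Hit.third h} {loop x} λ k →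
    ≡-trans (neutral-triple⁻ T₁ {e₁} {e₂} (Hit.neutral h) k)
            (≡-trans (cong -_ (loop-sum k)) (sym (sgn-not-* (at-a s₁) (vec (loop x) k))))) (Hit.inK h)
  loop-hit (inj₂ h) = subst (InK Φ) (σ-injective T₁ (λ _ → at-a s₁) {Hit.third h} {loop x} λ k →
    ≡-trans (neutral-triple⁻ T₁ {e₃} {e₄} (Hit.neutral h) k)
            (≡-trans (sym (pairs-opposite T₁ (Difference.neutral Δ) k)) (loop-sum k))) (Hit.inK h)

  middle₁₂ : Φ ≡ C → Middle Φ s T₁ T₂ true true e₁ e₂ e₃ e₄
  middle₁₂ Φ≡C = Sum.reduce (split-middle± Δ loop∉ (proj₁ (proj₂ cl₁)) (proj₂ (proj₂ cl₁)) (proj₁ (proj₂ cl₂)) (proj₂ (proj₂ cl₂))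
                                           (≗±-respʳ loop≗± (sym ∘ loop-sum)))
    where
    cl₁ = clover-shape Φ≡C j₁ j₂ e₁≢e₂
    cl₂ = clover-shape Φ≡C j₃ j₄ e₃≢e₄
    loop∉ : loop x ∉ e₁ ∷ e₂ ∷ e₃ ∷ e₄ ∷ []
    loop∉ = All¬⇒¬Any ((joins-≢loop x j₁ ∘ sym) ∷ (joins-≢loop x j₂ ∘ sym) ∷ (joins-≢loop x j₃ ∘ sym) ∷ (joins-≢loop x j₄ ∘ sym) ∷ [])
    loop≗± : σ T₁ (loop x) ≗± (λ k → sgn (at-a s₁) * vec (loop x) k)
    loop≗± = σ-≗± T₁ (loop x) (unit (at-a s₁))
      where
      unit : ∀ b → vec (loop x) ≗± (λ k → sgn b * vec (loop x) k)
      unit true  = inj₁ λ k → sym (*-identityˡ _)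
      unit false = inj₂ λ k → sym (≡-trans (cong -_ (-1*i≡-i _)) (neg-involutive _))

tent-single-diamond : ∀ {Φ n s} {T₁ T₂ : Tour n} {x y z e₁ e₂ e₃ e₄} → Φ ≢ C → Vtx Φ s T₁ → Vtx Φ s T₂ →
                      Distinct3 x y z → Joins e₁ x y → Joins e₂ x y → e₁ ≢ e₂ → Joins e₃ x z → Joins e₄ x z → e₃ ≢ e₄ →
                      DiffIs Φ T₁ T₂ (e₁ ∷ e₂ ∷ e₃ ∷ e₄ ∷ []) → SingleDiamond Φ s T₁ T₂
tent-single-diamond Φ≢C v₁ v₂ d j₁ j₂ e₁≢e₂ j₃ j₄ e₃≢e₄ diff =
  single-diamond (Difference-↭ (prep _ (trans (swap _ _ refl) (prep _ (swap _ _ refl)))) Δ) middle₁₃ middle₁₄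
    (Φ≢C ∘ loop-InK ∘ loop-hit)
  where open Tent v₁ v₂ d j₁ j₂ e₁≢e₂ j₃ j₄ e₃≢e₄ diff

tent-split-diamond : ∀ {Φ n s} {T₁ T₂ : Tour n} {x y z e₁ e₂ e₃ e₄} → Φ ≡ C → Vtx Φ s T₁ → Vtx Φ s T₂ →
                     Distinct3 x y z → Joins e₁ x y → Joins e₂ x y → e₁ ≢ e₂ → Joins e₃ x z → Joins e₄ x z → e₃ ≢ e₄ →
                     DiffIs Φ T₁ T₂ (e₁ ∷ e₂ ∷ e₃ ∷ e₄ ∷ []) → SplitDiamond Φ s T₁ T₂
tent-split-diamond Φ≡C v₁ v₂ d j₁ j₂ e₁≢e₂ j₃ j₄ e₃≢e₄ diff =
  split-diamond Δ (middle₁₂ Φ≡C) (Middle-swap₃₄ middle₁₃) (Middle-swap₃₄ middle₁₄)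
  where open Tent v₁ v₂ d j₁ j₂ e₁≢e₂ j₃ j₄ e₃≢e₄ diff

module Hanger {n s} {T₁ T₂ : Tour n} {x y z : Fin n} {e₁ e₂ e₃ : Edge n} (v₁ : Vtx C s T₁) (v₂ : Vtx C s T₂)
              (d : Distinct3 x y z) (j₁ : Joins e₁ x y) (j₂ : Joins e₂ y z) (j₃ : Joins e₃ x z)
              (diff : DiffIs C T₁ T₂ (e₁ ∷ e₂ ∷ e₃ ∷ loop x ∷ [])) where

  open Signs

  private
    x≢y = proj₁ d
    y≢z = proj₁ (proj₂ d)
    x≢z = proj₂ (proj₂ d)

  ℓ = loop x

  Δ₀ : Difference C s T₁ T₂ (e₁ ∷ e₂ ∷ e₃ ∷ ℓ ∷ [])
  Δ₀ = DiffIs⇒Difference v₁ v₂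
    (unique₄ (joins-edge-≢ j₁ j₂ x≢y x≢z) (joins-edge-≢ (joins-sym j₁) j₃ (x≢y ∘ sym) y≢z) (joins-≢loop x j₁)
             (joins-edge-≢ j₂ j₃ (x≢y ∘ sym) y≢z) (joins-≢loop x j₂) (joins-≢loop x j₃)) diff

  Δ : Difference C s T₁ T₂ (e₁ ∷ ℓ ∷ e₂ ∷ e₃ ∷ [])
  Δ = Difference-↭ (prep e₁ (trans (prep e₂ (swap e₃ ℓ refl)) (swap e₂ ℓ refl))) Δ₀

  s₁ = signs j₁ T₁
  s₃ = signs j₃ T₁

  at-x : at-a s₁ ≡ not (T₁ ℓ) × at-a s₃ ≡ not (T₁ ℓ)
  at-x = signs-at-x (≡-trans (sym (cong₂ _+_ (σ-at-a s₁ x≢y) (cong₂ _+_ (σ-joins-off T₁ j₂ (x≢y ∘ sym) (x≢z ∘ sym))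
                                  (cong₂ _+_ (σ-at-a s₃ x≢z) (cong (_+ 0ℤ) (σ-loop-at T₁ x))))))
                              (Difference.neutral Δ₀ x))
    where
    signs-at-x : ∀ {p q l} → sgn p + (0ℤ + (sgn q + ((sgn l + sgn l) + 0ℤ))) ≡ 0ℤ → (p ≡ not l) × (q ≡ not l)
    signs-at-x {true}  {true}  {false} _ = refl , refl
    signs-at-x {false} {false} {true}  _ = refl , refl
    signs-at-x {true}  {true}  {true}  ()
    signs-at-x {true}  {false} {true}  ()
    signs-at-x {true}  {false} {false} ()
    signs-at-x {false} {true}  {true}  ()
    signs-at-x {false} {true}  {false} ()
    signs-at-x {false} {false} {false} ()

  σℓx≢0 : σ T₁ ℓ x ≢ 0ℤ
  σℓx≢0 = σ-nonzero-at T₁ ℓ (inj₁ refl)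

  middle₁ : Middle C s T₁ T₂ true false e₁ ℓ e₂ e₃ ⊎ Middle C s T₁ T₂ false true e₁ ℓ e₂ e₃
  middle₁ = split-middle± Δ g∉ (proj₁ (proj₂ cl)) (trans (proj₂ (proj₂ cl)) (prep e₁ (swap edge ℓ refl)))
                          (triangle-generator T₁ (y≢z , x≢z ∘ sym , x≢y ∘ sym) j₂ (joins-sym j₃) (joins-sym joins) parallel′)
                          refl parallel
    where
    open ClosingEdge (loop-closing-edge T₁ j₁ (proj₁ at-x))
    parallel′ : σ T₁ edge ≗± (λ k → σ T₁ e₂ k + σ T₁ e₃ k)
    parallel′ = ≗±-neg parallel (pairs-opposite T₁ (Difference.neutral Δ))
    g≢e₁ : edge ≢ e₁
    g≢e₁ = ≗±-sum-≢ T₁ parallel σℓx≢0 (σ-joins-≢0 T₁ (joins-sym j₁)) (σ-zero-off T₁ ℓ [ x≢y , x≢y ])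
    cl = clover-shape refl j₁ joins (g≢e₁ ∘ sym)
    g∉ : edge ∉ e₁ ∷ ℓ ∷ e₂ ∷ e₃ ∷ []
    g∉ = All¬⇒¬Any (g≢e₁ ∷ joins-≢loop x joins ∷ joins-edge-≢ joins j₂ x≢y x≢z ∷
                    joins-edge-≢ (joins-sym joins) j₃ (x≢y ∘ sym) y≢z ∷ [])

  middle₃ : Middle C s T₁ T₂ true false e₃ ℓ e₁ e₂ ⊎ Middle C s T₁ T₂ false true e₃ ℓ e₁ e₂
  middle₃ = split-middle± (Difference-↭ (++-comm (e₁ ∷ e₂ ∷ []) (e₃ ∷ ℓ ∷ [])) Δ₀) g∉
                          (proj₁ (proj₂ cl)) (trans (proj₂ (proj₂ cl)) (prep e₃ (swap edge ℓ refl)))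
                          (triangle-generator T₁ (x≢y , y≢z , x≢z) j₁ j₂ joins parallel′) refl parallel
    where
    open ClosingEdge (loop-closing-edge T₁ j₃ (proj₂ at-x))
    parallel′ : σ T₁ edge ≗± (λ k → σ T₁ e₁ k + σ T₁ e₂ k)
    parallel′ = ≗±-neg parallel (pairs-opposite T₁ (Neutral-↭ {T = T₁} (++-comm (e₁ ∷ e₂ ∷ []) (e₃ ∷ ℓ ∷ [])) (Difference.neutral Δ₀)))
    g≢e₃ : edge ≢ e₃
    g≢e₃ = ≗±-sum-≢ T₁ parallel σℓx≢0 (σ-joins-≢0 T₁ (joins-sym j₃)) (σ-zero-off T₁ ℓ [ x≢z , x≢z ])
    cl = clover-shape refl j₃ joins (g≢e₃ ∘ sym)
    g∉ : edge ∉ e₃ ∷ ℓ ∷ e₁ ∷ e₂ ∷ []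
    g∉ = All¬⇒¬Any (g≢e₃ ∷ joins-≢loop x joins ∷ joins-edge-≢ (joins-sym joins) j₁ (x≢z ∘ sym) (y≢z ∘ sym) ∷
                    joins-edge-≢ joins j₂ (x≢y) (x≢z) ∷ [])

  no-hit₁₃ : ∀ {Z} → ¬ SplitHit C T₁ Z e₁ e₃ ℓ e₂
  no-hit₁₃ = no-split-hit T₁
    (Neutral-↭ {T = T₁} (prep e₁ (trans (swap e₂ e₃ (refl {xs = ℓ ∷ []})) (prep e₃ (swap e₂ ℓ (refl {xs = []})))))
                        (Difference.neutral Δ₀))
    (λ eq → sgn+sgn≢0 (not (T₁ ℓ)) (≡-trans (sym (cong₂ _+_ (≡-trans (σ-at-a s₁ x≢y) (cong sgn (proj₁ at-x)))
                                                             (≡-trans (σ-at-a s₃ x≢z) (cong sgn (proj₂ at-x))))) eq))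
    (+0-≢0 (σ-joins-off T₁ j₃ (x≢y) (y≢z ∘ sym)) (σ-joins-≢0 T₁ (joins-sym j₁)))
    (0+-≢0 (σ-joins-off T₁ j₁ x≢z y≢z) (σ-joins-≢0 T₁ (joins-sym j₃)))
    (x≢y , y≢z , x≢z)

hanger-diamond : ∀ {n s} {T₁ T₂ : Tour n} {x y z e₁ e₂ e₃} → Vtx C s T₁ → Vtx C s T₂ →
                 Distinct3 x y z → Joins e₁ x y → Joins e₂ y z → Joins e₃ x z →
                 DiffIs C T₁ T₂ (e₁ ∷ e₂ ∷ e₃ ∷ loop x ∷ []) → DoubleDiamond C s T₁ T₂ ⊎ HeavyDiamond C s T₁ T₂
hanger-diamond v₁ v₂ d j₁ j₂ j₃ diff =
  double-or-heavy-diamond Δ middle₁ (Sum.map (Middle-swap₃₄ ∘ Middle-swap) (Middle-swap₃₄ ∘ Middle-swap) middle₃) no-hit₁₃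
  where open Hanger v₁ v₂ d j₁ j₂ j₃ diff

-- D comes from a triangle u v w and the pair on u–v, which share the game u–v.
triangle-pair-diamond : ∀ {Φ n s} {T₁ T₂ : Tour n} {u v w p q} → Φ ≡ B → Vtx Φ s T₁ → Vtx Φ s T₂ →
                        Distinct3 u v w → Joins p v w → Joins q u w →
                        DiffIs Φ T₁ T₂ (p ∷ q ∷ half u ∷ half v ∷ []) → SingleDiamond Φ s T₁ T₂
triangle-pair-diamond {T₁ = T₁} {u = u} {v} {w} {p} {q} refl v₁ v₂ (u≢v , v≢w , u≢w) jp jq diff =
  single-diamond (Difference-↭ (prep p (prep q (swap hu hv refl))) Δ) (Middle-swap₃₄ middle-pq) middle-pv
    (no-split-hit T₁ (Neutral-↭ {T = T₁} (prep p (swap q hu (refl {xs = hv ∷ []}))) (Difference.neutral Δ))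
      (+0-≢0 (σ-half-off T₁ u≢w) (σ-joins-≢0 T₁ (joins-sym jp)))
      (0+-≢0 (σ-joins-off T₁ jp (u≢v ∘ sym) (u≢w ∘ sym)) (σ-half-≢0 T₁ u))
      (+0-≢0 (σ-half-off T₁ u≢v) (σ-joins-≢0 T₁ jp))
      (u≢w ∘ sym , u≢v , v≢w ∘ sym))
  where
  hu = half u
  hv = half v
  hw = half w
  Δ : Difference B _ T₁ _ (p ∷ q ∷ hu ∷ hv ∷ [])
  Δ = DiffIs⇒Difference v₁ v₂
    (unique₄ (joins-edge-≢ jp jq (u≢v ∘ sym) v≢w) (joins-≢half u jp) (joins-≢half v jp)
             (joins-≢half u jq) (joins-≢half v jq) (u≢v ∘ half-injective)) diff
  middle-pq : Middle B _ T₁ _ false false p q hu hv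
  middle-pq = Sum.reduce (split-middle± Δ g∉ (triangle-generator T₁ (v≢w , u≢w ∘ sym , u≢v ∘ sym) jp (joins-sym jq) joins parallel)
                                         refl (pair refl (joins-sym joins)) (trans (swap edge hu refl) (prep hu (swap edge hv refl))) parallel)
    where
    open ClosingEdge (closing-edge T₁ (v≢w , u≢w ∘ sym , u≢v ∘ sym) jp (joins-sym jq)
      (pair-cancels T₁ w p q (Difference.neutral Δ) refl (σ-half-off T₁ u≢w ∷ σ-half-off T₁ v≢w ∷ [])))
    g∉ : edge ∉ p ∷ q ∷ hu ∷ hv ∷ []
    g∉ = All¬⇒¬Any (joins-edge-≢ (joins-sym joins) jp u≢v u≢w ∷ joins-edge-≢ joins jq (u≢v ∘ sym) v≢w ∷
                    joins-≢half u joins ∷ joins-≢half v joins ∷ [])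
  middle-pv : Middle B _ T₁ _ false false p hv q hu
  middle-pv = Sum.reduce (split-middle± (Difference-↭ (prep p (trans (prep q (swap hu hv refl)) (swap q hv refl))) Δ) hw∉
                                         (pair refl jp) refl (pair refl jq) refl
                                         (half-closing T₁ jp (pair-cancels T₁ v p hv (Difference.neutral Δ)
                                           (prep p (trans (prep q (swap hu hv refl)) (swap q hv refl)))
                                           (σ-joins-off T₁ jq (u≢v) (v≢w ∘ sym) ∷ σ-half-off T₁ u≢v ∷ []))))
    where
    hw∉ : hw ∉ p ∷ hv ∷ q ∷ hu ∷ []
    hw∉ = All¬⇒¬Any ((joins-≢half w jp ∘ sym) ∷ (v≢w ∘ sym ∘ half-injective) ∷ (joins-≢half w jq ∘ sym) ∷ (u≢w ∘ sym ∘ half-injective) ∷ [])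

-- D comes from two pairs sharing the half edge at i.
pair-pair-diamond : ∀ {Φ n s} {T₁ T₂ : Tour n} {i j j' e e'} → Φ ≡ B → Vtx Φ s T₁ → Vtx Φ s T₂ →
                    Distinct3 i j j' → Joins e i j → Joins e' i j' →
                    DiffIs Φ T₁ T₂ (e ∷ half j ∷ e' ∷ half j' ∷ []) → SingleDiamond Φ s T₁ T₂
pair-pair-diamond {T₁ = T₁} {i = i} {j} {j'} {e} {e'} refl v₁ v₂ (i≢j , j≢j' , i≢j') je je' diff =
  single-diamond Δ middle-e-hj middle-e-e′
    (no-split-hit T₁ (Neutral-↭ {T = T₁} (prep e (trans (prep hj (swap e' hj' refl)) (swap hj hj' (refl {xs = e' ∷ []})))) (Difference.neutral Δ))
      (+0-≢0 (σ-half-off T₁ (i≢j' ∘ sym)) (σ-joins-≢0 T₁ je))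
      (+0-≢0 (σ-half-off T₁ (j≢j' ∘ sym)) (σ-joins-≢0 T₁ (joins-sym je)))
      (0+-≢0 (σ-joins-off T₁ je i≢j' j≢j') (σ-half-≢0 T₁ j'))
      (i≢j , j≢j' , i≢j'))
  where
  hi = half i
  hj = half j
  hj' = half j'
  Δ : Difference B _ T₁ _ (e ∷ hj ∷ e' ∷ hj' ∷ [])
  Δ = DiffIs⇒Difference v₁ v₂
    (unique₄ (joins-≢half j je) (joins-edge-≢ (joins-sym je) je' (i≢j ∘ sym) j≢j') (joins-≢half j' je)
             (joins-≢half j je' ∘ sym) (j≢j' ∘ half-injective) (joins-≢half j' je')) diff
  middle-e-hj : Middle B _ T₁ _ false false e hj e' hj'
  middle-e-hj = Sum.reduce (split-middle± Δ hi∉ (pair refl je) (prep e (swap hi hj refl)) (pair refl je') (prep e' (swap hi hj' refl))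
    (half-closing T₁ (joins-sym je) (pair-cancels T₁ j e hj (Difference.neutral Δ) refl
      (σ-joins-off T₁ je' i≢j (j≢j' ∘ sym) ∷ σ-half-off T₁ (j≢j' ∘ sym) ∷ []))))
    where
    hi∉ : hi ∉ e ∷ hj ∷ e' ∷ hj' ∷ []
    hi∉ = All¬⇒¬Any ((joins-≢half i je ∘ sym) ∷ (i≢j ∘ half-injective) ∷ (joins-≢half i je' ∘ sym) ∷ (i≢j' ∘ half-injective) ∷ [])
  Δ′ : Difference B _ T₁ _ (e ∷ e' ∷ hj ∷ hj' ∷ [])
  Δ′ = Difference-↭ (prep e (swap hj e' refl)) Δ
  middle-e-e′ : Middle B _ T₁ _ false false e e' hj hj'
  middle-e-e′ = Sum.reduce (split-middle± Δ′ g∉ (triangle-generator T₁ (i≢j ∘ sym , i≢j' , j≢j') (joins-sym je) je' joins parallel) refl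
                                           (pair refl joins) (trans (swap edge hj refl) (prep hj (swap edge hj' refl))) parallel)
    where
    open ClosingEdge (closing-edge T₁ (i≢j ∘ sym , i≢j' , j≢j') (joins-sym je) je'
      (pair-cancels T₁ i e e' (Difference.neutral Δ′) refl (σ-half-off T₁ (i≢j ∘ sym) ∷ σ-half-off T₁ (i≢j' ∘ sym) ∷ [])))
    g∉ : edge ∉ e ∷ e' ∷ hj ∷ hj' ∷ []
    g∉ = All¬⇒¬Any (joins-edge-≢ (joins-sym joins) je (i≢j' ∘ sym) (j≢j' ∘ sym) ∷ joins-edge-≢ joins je' (i≢j ∘ sym) j≢j' ∷
                    joins-≢half j joins ∷ joins-≢half j' joins ∷ [])

generators-DiffIs : ∀ {Φ n} {T₁ T₁₂ T₂ : Tour n} {G₁ G₂ f p₁ q₁ p₂ q₂} →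
                    T₁ ≈[ Φ ] (T₁₂ * G₁ ⟨flip⟩) → T₂ ≈[ Φ ] (T₁₂ * G₂ ⟨flip⟩) → All (InK Φ) G₁ → All (InK Φ) G₂ →
                    (∀ e → e ∈ G₁ → e ∈ G₂ → e ≡ f) → G₁ ↭ f ∷ p₁ ∷ q₁ ∷ [] → G₂ ↭ f ∷ p₂ ∷ q₂ ∷ [] →
                    p₁ ≢ f → q₁ ≢ f → p₂ ≢ f → q₂ ≢ f → DiffIs Φ T₁ T₂ (p₁ ∷ q₁ ∷ p₂ ∷ q₂ ∷ [])
generators-DiffIs {Φ} {T₁ = T₁} {T₁₂} {T₂} {G₁} {G₂} {f} {p₁} {q₁} {p₂} {q₂}
                  T₁≈ T₂≈ G₁K G₂K only-f G₁↭ G₂↭ p₁≢f q₁≢f p₂≢f q₂≢f e = to , from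
  where
  ∈G₁ : ∀ {x} → x ∈ f ∷ p₁ ∷ q₁ ∷ [] → x ∈ G₁
  ∈G₁ = ∈-resp-↭ (↭-sym G₁↭)
  ∈G₂ : ∀ {x} → x ∈ f ∷ p₂ ∷ q₂ ∷ [] → x ∈ G₂
  ∈G₂ = ∈-resp-↭ (↭-sym G₂↭)
  flipped-once : ∀ {x} → InK Φ x → (T₁ x ≡ not (T₁₂ x) × T₂ x ≡ T₁₂ x) ⊎ (T₁ x ≡ T₁₂ x × T₂ x ≡ not (T₁₂ x)) → T₁ x ≢ T₂ x
  flipped-once xK (inj₁ (T₁x , T₂x)) eq = not-¬ refl (sym (≡-trans (sym T₁x) (≡-trans eq T₂x)))
  flipped-once xK (inj₂ (T₁x , T₂x)) eq = not-¬ refl (≡-trans (sym T₁x) (≡-trans eq T₂x))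
  only-in₁ : ∀ {x} → x ∈ G₁ → x ≢ f → InK Φ x × T₁ x ≢ T₂ x
  only-in₁ {x} x∈ x≢f = xK , flipped-once xK (inj₁ (≡-trans (T₁≈ x xK) (flip-∈ T₁₂ x∈) ,
                                                    ≡-trans (T₂≈ x xK) (flip-∉ T₁₂ (x≢f ∘ only-f x x∈))))
    where xK = All.lookup G₁K x∈
  only-in₂ : ∀ {x} → x ∈ G₂ → x ≢ f → InK Φ x × T₁ x ≢ T₂ x
  only-in₂ {x} x∈ x≢f = xK , flipped-once xK (inj₂ (≡-trans (T₁≈ x xK) (flip-∉ T₁₂ (x≢f ∘ λ x∈₁ → only-f x x∈₁ x∈)) ,
                                                    ≡-trans (T₂≈ x xK) (flip-∈ T₁₂ x∈)))
    where xK = All.lookup G₂K x∈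
  from : e ∈ p₁ ∷ q₁ ∷ p₂ ∷ q₂ ∷ [] → InK Φ e × T₁ e ≢ T₂ e
  from (here refl)                         = only-in₁ (∈G₁ (there (here refl))) p₁≢f
  from (there (here refl))                 = only-in₁ (∈G₁ (there (there (here refl)))) q₁≢f
  from (there (there (here refl)))         = only-in₂ (∈G₂ (there (here refl))) p₂≢f
  from (there (there (there (here refl)))) = only-in₂ (∈G₂ (there (there (here refl)))) q₂≢f
  to : InK Φ e × T₁ e ≢ T₂ e → e ∈ p₁ ∷ q₁ ∷ p₂ ∷ q₂ ∷ []
  to (eK , T₁e≢T₂e) with mem? _≟E_ e G₁ | mem? _≟E_ e G₂
  ... | yes e∈₁ | yes e∈₂ = ⊥-elim (T₁e≢T₂e (≡-trans (≡-trans (T₁≈ e eK) (flip-∈ T₁₂ e∈₁)) (sym (≡-trans (T₂≈ e eK) (flip-∈ T₁₂ e∈₂)))))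
  ... | no e∉₁  | no e∉₂  = ⊥-elim (T₁e≢T₂e (≡-trans (≡-trans (T₁≈ e eK) (flip-∉ T₁₂ e∉₁)) (sym (≡-trans (T₂≈ e eK) (flip-∉ T₁₂ e∉₂)))))
  ... | yes e∈₁ | no e∉₂ with ∈-resp-↭ G₁↭ e∈₁
  ...   | here refl = ⊥-elim (e∉₂ (∈G₂ (here refl)))
  ...   | there e∈  = ∈-++⁺ˡ e∈
  to (eK , _) | no e∉₁ | yes e∈₂ with ∈-resp-↭ G₂↭ e∈₂
  ...   | here refl = ⊥-elim (e∉₁ (∈G₁ (here refl)))
  ...   | there e∈  = ∈-++⁺ʳ (p₁ ∷ q₁ ∷ []) e∈

data Pointed (Φ : Ty) {n} (f : Edge n) (G : List (Edge n)) : Set where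
  triangle-at  : ∀ {u v w p q} → Distinct3 u v w → Joins f u v → Joins p v w → Joins q u w →
                 G ↭ f ∷ p ∷ q ∷ [] → Pointed Φ f G
  pair-at-edge : ∀ {i j} → Φ ≡ B → Joins f i j → G ↭ f ∷ half i ∷ half j ∷ [] → Pointed Φ f G
  pair-at-half : ∀ {i j e} → Φ ≡ B → f ≡ half i → Joins e i j → G ↭ f ∷ e ∷ half j ∷ [] → Pointed Φ f G

pointed : ∀ {Φ n c} {G : List (Edge n)} {f} → Φ ≢ C → GenShape Φ G c → f ∈ G → Pointed Φ f G
pointed _ (triangle d j₁ j₂ j₃ _) (here refl) = triangle-at d j₁ j₂ j₃ refl
pointed _ (triangle (a≢b , b≢c , a≢c) j₁ j₂ j₃ _) (there (here refl)) =
  triangle-at (b≢c , a≢c ∘ sym , a≢b ∘ sym) j₂ (joins-sym j₃) (joins-sym j₁) (trans (swap _ _ refl) (prep _ (swap _ _ refl)))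
pointed _ (triangle (a≢b , b≢c , a≢c) j₁ j₂ j₃ _) (there (there (here refl))) =
  triangle-at (a≢c , b≢c ∘ sym , a≢b) j₃ (joins-sym j₂) j₁ (trans (swap _ _ refl) (trans (prep _ (swap _ _ refl)) (swap _ _ refl)))
pointed _ (pair Φ≡B j) (here refl) = pair-at-edge Φ≡B j refl
pointed _ (pair Φ≡B j) (there (here refl)) = pair-at-half Φ≡B refl j (swap _ _ refl)
pointed _ (pair Φ≡B j) (there (there (here refl))) = pair-at-half Φ≡B refl (joins-sym j) (trans (prep _ (swap _ _ refl)) (swap _ _ refl))
pointed Φ≢C (clover Φ≡C _ _ _ _) _ = ⊥-elim (Φ≢C Φ≡C)

module AdjacentGenerators {Φ n s} {T₁ T₁₂ T₂ : Tour n} {G₁ G₂ : List (Edge n)} {f : Edge n} (Φ≢C : Φ ≢ C)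
                          (v₁ : Vtx Φ s T₁) (v₂ : Vtx Φ s T₂)
                          (T₁≈ : T₁ ≈[ Φ ] (T₁₂ * G₁ ⟨flip⟩)) (T₂≈ : T₂ ≈[ Φ ] (T₁₂ * G₂ ⟨flip⟩))
                          (G₁K : All (InK Φ) G₁) (G₂K : All (InK Φ) G₂) (only-f : ∀ e → e ∈ G₁ → e ∈ G₂ → e ≡ f) where

  private
    diff : ∀ {p₁ q₁ p₂ q₂} → G₁ ↭ f ∷ p₁ ∷ q₁ ∷ [] → G₂ ↭ f ∷ p₂ ∷ q₂ ∷ [] →
           p₁ ≢ f → q₁ ≢ f → p₂ ≢ f → q₂ ≢ f → DiffIs Φ T₁ T₂ (p₁ ∷ q₁ ∷ p₂ ∷ q₂ ∷ [])
    diff = generators-DiffIs T₁≈ T₂≈ G₁K G₂K only-f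

    unshared : ∀ {x y} → x ∈ G₁ → y ∈ G₂ → x ≢ f → x ≢ y
    unshared x∈ y∈ x≢f refl = x≢f (only-f _ x∈ y∈)

    2nd∈ : ∀ {G : List (Edge n)} {a b c} → G ↭ a ∷ b ∷ c ∷ [] → b ∈ G
    2nd∈ G↭ = ∈-resp-↭ (↭-sym G↭) (there (here refl))

    3rd∈ : ∀ {G : List (Edge n)} {a b c} → G ↭ a ∷ b ∷ c ∷ [] → c ∈ G
    3rd∈ G↭ = ∈-resp-↭ (↭-sym G↭) (there (there (here refl)))

    away-from-f : ∀ {u v w p q} → Distinct3 u v w → Joins f u v → Joins p v w → Joins q u w → p ≢ f × q ≢ f
    away-from-f (u≢v , v≢w , u≢w) jf jp jq =
      joins-edge-≢ (joins-sym jp) jf (u≢w ∘ sym) (v≢w ∘ sym) , joins-edge-≢ (joins-sym jq) jf (u≢w ∘ sym) (v≢w ∘ sym)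

    triangle-triangle : ∀ {u v w p₁ q₁ u' v' w' p₂ q₂} → Distinct3 u v w → Joins p₁ v w → Joins q₁ u w →
                        Distinct3 u' v' w' → Joins p₂ v' w' → Joins q₂ u' w' →
                        p₁ ≢ p₂ → q₁ ≢ q₂ → p₁ ≢ q₂ → q₁ ≢ p₂ → DiffIs Φ T₁ T₂ (p₁ ∷ q₁ ∷ p₂ ∷ q₂ ∷ []) →
                        (u ≡ u' × v ≡ v') ⊎ (u ≡ v' × v ≡ u') → Dec (w ≡ w') → SingleDiamond Φ s T₁ T₂
    triangle-triangle {p₁ = p₁} {q₁} (u≢v , v≢w , u≢w) jp₁ jq₁ (_ , v≢w' , u≢w') jp₂ jq₂ _ _ _ _ Δ (inj₁ (refl , refl)) (no w≢w') =
      square-diamond v₁ v₂ (u≢w , u≢v , u≢w' , v≢w ∘ sym , w≢w' , v≢w') jq₁ (joins-sym jp₁) jp₂ (joins-sym jq₂)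
                     (DiffIs-↭ (swap p₁ q₁ refl) Δ)
    triangle-triangle {p₁ = p₁} {q₁} {p₂ = p₂} (u≢v , v≢w , u≢w) jp₁ jq₁ _ jp₂ jq₂ p₁≢p₂ q₁≢q₂ _ _ Δ (inj₁ (refl , refl)) (yes refl) =
      tent-single-diamond Φ≢C v₁ v₂ (v≢w ∘ sym , u≢v ∘ sym , u≢w ∘ sym) (joins-sym jp₁) (joins-sym jp₂) p₁≢p₂
                          (joins-sym jq₁) (joins-sym jq₂) q₁≢q₂ (DiffIs-↭ (prep p₁ (swap q₁ p₂ refl)) Δ)
    triangle-triangle {p₁ = p₁} {q₁} {p₂ = p₂} {q₂} (u≢v , v≢w , u≢w) jp₁ jq₁ (_ , u≢w' , v≢w') jp₂ jq₂ _ _ _ _ Δ (inj₂ (refl , refl)) (no w≢w') =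
      square-diamond v₁ v₂ (u≢w , u≢v , u≢w' , v≢w ∘ sym , w≢w' , v≢w') jq₁ (joins-sym jp₁) jq₂ (joins-sym jp₂)
                     (DiffIs-↭ (trans (swap p₁ q₁ refl) (prep q₁ (prep p₁ (swap p₂ q₂ refl)))) Δ)
    triangle-triangle {p₁ = p₁} {q₁} {p₂ = p₂} {q₂} (u≢v , v≢w , u≢w) jp₁ jq₁ _ jp₂ jq₂ _ _ p₁≢q₂ q₁≢p₂ Δ (inj₂ (refl , refl)) (yes refl) =
      tent-single-diamond Φ≢C v₁ v₂ (v≢w ∘ sym , u≢v ∘ sym , u≢w ∘ sym) (joins-sym jp₁) (joins-sym jq₂) p₁≢q₂
                          (joins-sym jq₁) (joins-sym jp₂) q₁≢p₂ (DiffIs-↭ (prep p₁ (trans (prep q₁ (swap p₂ q₂ refl)) (swap q₁ q₂ refl))) Δ)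

    triangle-pair : ∀ {u v w p q i j} → Φ ≡ B → Distinct3 u v w → Joins p v w → Joins q u w →
                    DiffIs Φ T₁ T₂ (p ∷ q ∷ half i ∷ half j ∷ []) → (u ≡ i × v ≡ j) ⊎ (u ≡ j × v ≡ i) → SingleDiamond Φ s T₁ T₂
    triangle-pair Φ≡B d jp jq Δ (inj₁ (refl , refl)) = triangle-pair-diamond Φ≡B v₁ v₂ d jp jq Δ
    triangle-pair {p = p} {q} Φ≡B d jp jq Δ (inj₂ (refl , refl)) =
      triangle-pair-diamond Φ≡B v₁ v₂ d jp jq (DiffIs-↭ (prep p (prep q (swap _ _ refl))) Δ)

    shared-half : ∀ {i j i' j'} → Joins f i j → Joins f i' j' → half i ∈ G₁ →
                  G₂ ↭ f ∷ half i' ∷ half j' ∷ [] → ⊥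
    shared-half {i} jf jf' hi∈ G₂↭ with joins-unique jf jf'
    ... | inj₁ (refl , _) = joins-≢half i jf (sym (only-f _ hi∈ (2nd∈ G₂↭)))
    ... | inj₂ (refl , _) = joins-≢half i jf (sym (only-f _ hi∈ (3rd∈ G₂↭)))

    pair-pair : ∀ {i j e₁ i' j' e₂} → Φ ≡ B → f ≡ half i → Joins e₁ i j → G₁ ↭ f ∷ e₁ ∷ half j ∷ [] →
                f ≡ half i' → Joins e₂ i' j' → G₂ ↭ f ∷ e₂ ∷ half j' ∷ [] → i ≡ i' → SingleDiamond Φ s T₁ T₂
    pair-pair {i} {j} {j' = j'} Φ≡B refl je₁ G₁↭ f≡hi' je₂ G₂↭ refl =
      pair-pair-diamond Φ≡B v₁ v₂ (joins-≢ je₁ , j≢j' , joins-≢ je₂) je₁ je₂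
        (diff G₁↭ G₂↭ (joins-≢half i je₁) (joins-≢ je₁ ∘ sym ∘ half-injective) (joins-≢half i je₂) (joins-≢ je₂ ∘ sym ∘ half-injective))
      where
      j≢j' : j ≢ j'
      j≢j' refl = joins-≢ je₁ (sym (half-injective (only-f _ (3rd∈ G₁↭) (3rd∈ G₂↭))))

  diamond : Pointed Φ f G₁ → Pointed Φ f G₂ → SingleDiamond Φ s T₁ T₂
  diamond (triangle-at {w = w} d₁ jf₁ jp₁ jq₁ G₁↭) (triangle-at {w = w'} d₂ jf₂ jp₂ jq₂ G₂↭) =
    triangle-triangle d₁ jp₁ jq₁ d₂ jp₂ jq₂ (unshared (2nd∈ G₁↭) (2nd∈ G₂↭) p₁≢f) (unshared (3rd∈ G₁↭) (3rd∈ G₂↭) q₁≢f)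
                      (unshared (2nd∈ G₁↭) (3rd∈ G₂↭) p₁≢f) (unshared (3rd∈ G₁↭) (2nd∈ G₂↭) q₁≢f)
                      (diff G₁↭ G₂↭ p₁≢f q₁≢f p₂≢f q₂≢f) (joins-unique jf₁ jf₂) (w ≟F w')
    where
    p₁≢f = proj₁ (away-from-f d₁ jf₁ jp₁ jq₁)
    q₁≢f = proj₂ (away-from-f d₁ jf₁ jp₁ jq₁)
    p₂≢f = proj₁ (away-from-f d₂ jf₂ jp₂ jq₂)
    q₂≢f = proj₂ (away-from-f d₂ jf₂ jp₂ jq₂)
  diamond (triangle-at d jf jp jq G₁↭) (pair-at-edge Φ≡B jf′ G₂↭) =
    triangle-pair Φ≡B d jp jq (diff G₁↭ G₂↭ (proj₁ (away-from-f d jf jp jq)) (proj₂ (away-from-f d jf jp jq))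
                                  (joins-≢half _ jf ∘ sym) (joins-≢half _ jf ∘ sym)) (joins-unique jf jf′)
  diamond (pair-at-edge Φ≡B jf G₁↭) (triangle-at d jf′ jp jq G₂↭) =
    triangle-pair Φ≡B d jp jq (DiffIs-↭ (++-comm (half _ ∷ half _ ∷ []) (_ ∷ _ ∷ []))
                                 (diff G₁↭ G₂↭ (joins-≢half _ jf′ ∘ sym) (joins-≢half _ jf′ ∘ sym)
                                       (proj₁ (away-from-f d jf′ jp jq)) (proj₂ (away-from-f d jf′ jp jq))))
                  (joins-unique jf′ jf)
  diamond (triangle-at _ jf _ _ _) (pair-at-half _ f≡hi _ _) = ⊥-elim (joins-≢half _ jf f≡hi)
  diamond (pair-at-half _ f≡hi _ _) (triangle-at _ jf _ _ _) = ⊥-elim (joins-≢half _ jf f≡hi)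
  diamond (pair-at-edge _ jf G₁↭) (pair-at-edge _ jf′ G₂↭) = ⊥-elim (shared-half jf jf′ (2nd∈ G₁↭) G₂↭)
  diamond (pair-at-edge _ jf _) (pair-at-half _ f≡hi _ _) = ⊥-elim (joins-≢half _ jf f≡hi)
  diamond (pair-at-half _ f≡hi _ _) (pair-at-edge _ jf _) = ⊥-elim (joins-≢half _ jf f≡hi)
  diamond (pair-at-half Φ≡B f≡hi je₁ G₁↭) (pair-at-half _ f≡hi′ je₂ G₂↭) =
    pair-pair Φ≡B f≡hi je₁ G₁↭ f≡hi′ je₂ G₂↭ (half-injective (≡-trans (sym f≡hi) f≡hi′))

adjacent-generators-diamond : ∀ {Φ n s} {T₁ T₁₂ T₂ : Tour n} {G₁ G₂ c₁ c₂ f} → Φ ≢ C → Vtx Φ s T₁ → Vtx Φ s T₂ →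
                              GenShape Φ G₁ c₁ → GenShape Φ G₂ c₂ →
                              T₁ ≈[ Φ ] (T₁₂ * G₁ ⟨flip⟩) → T₂ ≈[ Φ ] (T₁₂ * G₂ ⟨flip⟩) →
                              f ∈ G₁ → f ∈ G₂ → (∀ e → e ∈ G₁ → e ∈ G₂ → e ≡ f) → SingleDiamond Φ s T₁ T₂
adjacent-generators-diamond Φ≢C v₁ v₂ sh₁ sh₂ T₁≈ T₂≈ f∈G₁ f∈G₂ only-f =
  diamond (pointed Φ≢C sh₁ f∈G₁) (pointed Φ≢C sh₂ f∈G₂)
  where open AdjacentGenerators Φ≢C v₁ v₂ T₁≈ T₂≈ (genShape-InK sh₁) (genShape-InK sh₂) only-f

lemma17 : (Φ : Ty) (n : ℕ) (s : Fin n → ℤ) (T₁ T₁₂ T₂ : Tour n) (G₁ G₂ : List (Edge n)) →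
          Vtx Φ s T₁ → Vtx Φ s T₁₂ → Vtx Φ s T₂ →
          GenCopyAny Φ T₁₂ G₁ → GenCopyAny Φ T₁₂ G₂ →
          T₁ ≈[ Φ ] (T₁₂ * G₁ ⟨flip⟩) → T₂ ≈[ Φ ] (T₁₂ * G₂ ⟨flip⟩) →
          OneCommon G₁ G₂ →
          ((Φ ≡ B ⊎ Φ ≡ D) → SingleDiamond Φ s T₁ T₂) ×
          (Φ ≡ C → ProjSquare Φ T₁ T₂ → SingleDiamond Φ s T₁ T₂) ×
          (Φ ≡ C → ProjTent Φ T₁ T₂ → SplitDiamond Φ s T₁ T₂) ×
          (Φ ≡ C → ProjHanger Φ T₁ T₂ → DoubleDiamond Φ s T₁ T₂ ⊎ HeavyDiamond Φ s T₁ T₂)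
lemma17 Φ n s T₁ T₁₂ T₂ G₁ G₂ v₁ _ v₂ (_ , sh₁ , _) (_ , sh₂ , _) T₁≈ T₂≈ (f , f∈G₁ , f∈G₂ , only-f) =
  (λ B⊎D → adjacent-generators-diamond (not-C B⊎D) v₁ v₂ sh₁ sh₂ T₁≈ T₂≈ f∈G₁ f∈G₂ only-f) ,
  (λ { _ (_ , _ , _ , _ , _ , _ , _ , _ , d , j₁ , j₂ , j₃ , j₄ , diff) → square-diamond v₁ v₂ d j₁ j₂ j₃ j₄ diff }) ,
  (λ { Φ≡C (_ , _ , _ , _ , _ , _ , _ , d , j₁ , j₂ , e₁≢e₂ , j₃ , j₄ , e₃≢e₄ , diff) →
         tent-split-diamond Φ≡C v₁ v₂ d j₁ j₂ e₁≢e₂ j₃ j₄ e₃≢e₄ diff }) ,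
  (λ { refl (_ , _ , _ , _ , _ , _ , d , j₁ , j₂ , j₃ , diff) → hanger-diamond v₁ v₂ d j₁ j₂ j₃ diff })
  where
  not-C : Φ ≡ B ⊎ Φ ≡ D → Φ ≢ C
  not-C (inj₁ refl) ()
  not-C (inj₂ refl) ()
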